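{- Let $\Sigma$ be a signature and $R$ a linear term rewriting system over $\Sigma$. The encoding $(\cdot)^\circ$ is an embedding, i.e.: (1) (step-preserving) for all linear terms $s,t$, if $s\to_R t$ then $s^\circ\Rightarrow_{R^\circ} t^\circ$; and (2) (closed) for every linear term $s$ and every graph $G$, if $s^\circ\Rightarrow_{R^\circ} G$ then $G\cong t^\circ$ for some term $t$ with $s\to_R t$.
   Context: Terms. A signature $\Sigma$ is a non-empty set of function symbols with arities $\#:\Sigma\to\mathbb{N}$; terms over $\Sigma$ and variables $\mathcal{X}$ as usual. A term is linear if each variable occurs at most once; $\mathrm{Var}(t)$ is its set of variables. Positions are sequences of positive integers ($\epsilon$ the root; the $i$-th argument of the symbol at position $p$ has position $pi$). A term rewrite rule is $l\to r$ with $l\notin\mathcal{X}$, $\mathrm{Var}(r)\subseteq\mathrm{Var}(l)$; linear if $l,r$ are linear; a TRS is linear if all its rules are. $s\to_R t$ iff $s=C[l\sigma]$, $t=C[r\sigma]$ for a context $C$, substitution $\sigma$ and rule $l\to r\in R$. Graphs. For a complete lattice $(\mathcal{L},\le)$, $\mathbf{Graph}(\mathcal{L},\le)$ has as objects graphs $(V,E,s,t,\ell)$ with labels $\ell:V\cup E\to\mathcal{L}$ and as morphisms pairs of maps on vertices and edges commuting with source and target and satisfying $\ell(x)\le\ell(\phi(x))$. The flat lattice $\mathcal{L}_0^{\bot,\top}$ on a set $\mathcal{L}_0$ adds a bottom $\bot$ and top $\top$, elements of $\mathcal{L}_0$ being incomparable; $\Sigma^\circ=(\Sigma\uplus\mathbb{N}^+)^{\bot,\top}$.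 All graphs here are $\Sigma^\circ$-labeled. PBPO$^+$. A PBPO$^+$ rule consists of objects $L,K,R,L',K'$, morphisms $l:K\to L$, $r:K\to R$, $l':K'\to L'$, monos $t_L:L\rightarrowtail L'$, $t_K:K\rightarrowtail K'$ with $t_L\circ l=l'\circ t_K$ a pullback square. A step $G_L\Rightarrow G_R$ holds if there are a mono $m:L\rightarrowtail G_L$ and $\alpha:G_L\to L'$ with $\alpha\circ m=t_L$ such that ($L$, $1_L$, $m$) is a pullback of $t_L$ and $\alpha$; $(G_K,g_L:G_K\to G_L,u':G_K\to K')$ a pullback of $\alpha$ and $l'$; $u:K\to G_K$ the unique morphism with $u'\circ u=t_K$, $g_L\circ u=m\circ l$; and $(G_R,g_R:G_K\to G_R,w:R\to G_R)$ a pushout of $u$ and $r$. $\Rightarrow_{R^\circ}$ is the union of the step relations of the rules in $R^\circ$. Encodings. For a linear term $t$, $t^\circ$ is the graph with a vertex $p$ labeled $f$ for every position $p$ of $t$ holding a function symbol $f$, a vertex $x$ labeled $\bot$ for every variable $x$ in $t$, and for each position $p$ holding a symbol of arity $n$ and $1\le i\le n$ an edge labeled $i$ from the vertex at $p$ to the vertex at $pi$; its root is the vertex at $\epsilon$. The context closure $\mathcal{C}[G{\downarrow_\mathcal{X}}]$ of a rooted graph $G$: relabel each vertex $x\in V_G\cap\mathcal{X}$ to $\top$ and add a fresh $\top$-vertex $x'$ with $\top$-edges $x\to x'$, $x'\to x'$; add a fresh $\top$-vertex $\mathcal{C}$ with $\top$-edges from $\mathcal{C}$ to the root and $\mathcal{C}\to\mathcal{C}$.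 $\mathcal{I}(r)$ is the discrete graph on $\mathrm{Var}(r)\cup\{\epsilon\}$, all labeled $\bot$, rooted at $\epsilon$. For a linear rule $\rho=l\to r$, $\rho^\circ$ is the PBPO$^+$ rule with $L=l^\circ$, $K=\mathcal{I}(r)$, $R=r^\circ$, $L'=\mathcal{C}[l^\circ{\downarrow_\mathcal{X}}]$, $K'=\mathcal{C}[\mathcal{I}(r){\downarrow_\mathcal{X}}]$, all morphisms mapping roots to roots and inclusions otherwise. $R^\circ=\{\rho^\circ\mid\rho\in R\}$. -}

module Defs where

open import Data.Nat using (ℕ; zero; suc)
open import Data.Fin using (Fin; toℕ)
open import Data.Vec using (Vec; []; _∷_; lookup; _[_]≔_)
open import Data.Bool using (Bool; true; false; if_then_else_)
open import Data.Maybe using (Maybe; just; nothing)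
open import Data.Product using (Σ; _×_; _,_; proj₁; proj₂)
open import Data.Empty using (⊥)
open import Relation.Nullary using (¬_)
open import Relation.Binary.PropositionalEquality using (_≡_; refl; trans; cong)

record Signature : Set₁ where
  field
    Sym      : Set
    ar       : Sym → ℕ
    nonempty : Sym

module WithSig (Sg : Signature) where
  open Signature Sg public

  data Term : Set where
    var : ℕ → Term
    fun : (f : Sym) → Vec Term (ar f) → Term

  -- occurrences of a variable x in a term (one proof per occurrence)
  data _∈V_ (x : ℕ) : Term → Set where
    here  : x ∈V var x
    there : ∀ {f ts} (i : Fin (ar f)) → x ∈V lookup ts i → x ∈V fun f ts

  Linear : Term → Set
  Linear t = ∀ x (p q : x ∈V t) → p ≡ q

  mutual
    subst : (ℕ → Term) → Term → Term
    subst σ (var x)    = σ x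
    subst σ (fun f ts) = fun f (substs σ ts)

    substs : ∀ {n} → (ℕ → Term) → Vec Term n → Vec Term n
    substs σ []       = []
    substs σ (t ∷ ts) = subst σ t ∷ substs σ ts

  data Ctx : Set where
    hole : Ctx
    node : (f : Sym) (i : Fin (ar f)) (ts : Vec Term (ar f)) → Ctx → Ctx

  plug : Ctx → Term → Term
  plug hole u            = u
  plug (node f i ts C) u = fun f (ts [ i ]≔ plug C u)

  record Rule : Set where
    field
      lhs     : Term
      rhs     : Term
      lhs-nv  : ∀ x → ¬ (lhs ≡ var x)
      var-sub : ∀ x → x ∈V rhs → x ∈V lhs
  open Rule public

  LinearRule : Rule → Set
  LinearRule ρ = Linear (lhs ρ) × Linear (rhs ρ)

  record TRS : Set₁ where
    field
      Idx  : Set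
      rule : Idx → Rule
  open TRS public

  LinearTRS : TRS → Set
  LinearTRS R = ∀ i → LinearRule (rule R i)

  _⟶[_]_ : Term → TRS → Term → Set
  s ⟶[ R ] t = Σ (Idx R) λ i → Σ Ctx λ C → Σ (ℕ → Term) λ σ →
      (s ≡ plug C (subst σ (lhs (rule R i)))) × (t ≡ plug C (subst σ (rhs (rule R i))))

  -- The flat lattice Σ° = (Σ ⊎ ℕ⁺)^{⊥,⊤}.
  -- `num n` denotes the positive integer n+1.

  data Lab : Set where
    bot : Lab
    top : Lab
    sym : Sym → Lab
    num : ℕ → Lab

  data _≤L_ : Lab → Lab → Set where
    bot≤  : ∀ {x} → bot ≤L x
    ≤top  : ∀ {x} → x ≤L top
    refl≤ : ∀ {x} → x ≤L x

  ≤L-trans : ∀ {x y z} → x ≤L y → y ≤L z → x ≤L z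
  ≤L-trans p ≤top  = ≤top
  ≤L-trans p refl≤ = p
  ≤L-trans bot≤ q  = bot≤
  ≤L-trans refl≤ q = q

  record Graph : Set₁ where
    field
      V   : Set
      E   : Set
      src : E → V
      tgt : E → V
      lv  : V → Lab
      le  : E → Lab
  open Graph public

  record Hom (G H : Graph) : Set where
    field
      fV    : V G → V H
      fE    : E G → E H
      src-c : ∀ e → fV (src G e) ≡ src H (fE e)
      tgt-c : ∀ e → fV (tgt G e) ≡ tgt H (fE e)
      lv-c  : ∀ v → lv G v ≤L lv H (fV v)
      le-c  : ∀ e → le G e ≤L le H (fE e)
  open Hom public

  _≈_ : ∀ {G H} → Hom G H → Hom G H → Set
  f ≈ g = (∀ v → fV f v ≡ fV g v) × (∀ e → fE f e ≡ fE g e)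

  idH : ∀ {G} → Hom G G
  idH = record { fV = λ v → v ; fE = λ e → e ; src-c = λ _ → refl ; tgt-c = λ _ → refl
               ; lv-c = λ _ → refl≤ ; le-c = λ _ → refl≤ }

  _∘H_ : ∀ {A B C} → Hom B C → Hom A B → Hom A C
  g ∘H f = record
    { fV = λ v → fV g (fV f v)
    ; fE = λ e → fE g (fE f e)
    ; src-c = λ e → trans (cong (fV g) (src-c f e)) (src-c g (fE f e))
    ; tgt-c = λ e → trans (cong (fV g) (tgt-c f e)) (tgt-c g (fE f e))
    ; lv-c = λ v → ≤L-trans (lv-c f v) (lv-c g (fV f v))
    ; le-c = λ e → ≤L-trans (le-c f e) (le-c g (fE f e)) }

  Mono : ∀ {A B} → Hom A B → Set₁
  Mono {A} {B} m = ∀ {X} (g h : Hom X A) → (m ∘H g) ≈ (m ∘H h) → g ≈ h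

  IsPullback : ∀ {A B C} (f : Hom A C) (g : Hom B C) (P : Graph) → Hom P A → Hom P B → Set₁
  IsPullback {A} {B} f g P p₁ p₂ =
    ((f ∘H p₁) ≈ (g ∘H p₂)) ×
    (∀ (X : Graph) (q₁ : Hom X A) (q₂ : Hom X B) → (f ∘H q₁) ≈ (g ∘H q₂) →
       Σ (Hom X P) λ h → ((p₁ ∘H h) ≈ q₁) × ((p₂ ∘H h) ≈ q₂) ×
         (∀ (h' : Hom X P) → (p₁ ∘H h') ≈ q₁ → (p₂ ∘H h') ≈ q₂ → h' ≈ h))

  IsPushout : ∀ {A B C} (f : Hom C A) (g : Hom C B) (Q : Graph) → Hom A Q → Hom B Q → Set₁
  IsPushout {A} {B} f g Q i₁ i₂ =
    ((i₁ ∘H f) ≈ (i₂ ∘H g)) ×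
    (∀ (X : Graph) (q₁ : Hom A X) (q₂ : Hom B X) → (q₁ ∘H f) ≈ (q₂ ∘H g) →
       Σ (Hom Q X) λ h → ((h ∘H i₁) ≈ q₁) × ((h ∘H i₂) ≈ q₂) ×
         (∀ (h' : Hom Q X) → (h' ∘H i₁) ≈ q₁ → (h' ∘H i₂) ≈ q₂ → h' ≈ h))

  _≅_ : Graph → Graph → Set
  G ≅ H = Σ (Hom G H) λ f → Σ (Hom H G) λ g → ((g ∘H f) ≈ idH) × ((f ∘H g) ≈ idH)

  -- PBPO⁺ rules (the data; the side conditions -- monos t_L, t_K and the
  -- pullback square -- are not needed to define the step relation) and steps.

  record PBPORule : Set₁ where
    field
      L K R L' K' : Graph
      l  : Hom K L
      r  : Hom K R
      l' : Hom K' L'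
      tL : Hom L L'
      tK : Hom K K'

  IsPBPORule : PBPORule → Set₁
  IsPBPORule ρ = Mono tL × Mono tK × ((tL ∘H l) ≈ (l' ∘H tK)) × IsPullback tL l' K l tK
    where open PBPORule ρ

  Step : PBPORule → Graph → Graph → Set₁
  Step ρ GL GR =
    Σ (Hom L GL) λ m → Mono m × Σ (Hom GL L') λ α → ((α ∘H m) ≈ tL) ×
    IsPullback tL α L idH m ×
    Σ Graph λ GK → Σ (Hom GK GL) λ gL → Σ (Hom GK K') λ u' →
    IsPullback α l' GK gL u' ×
    Σ (Hom K GK) λ u → ((u' ∘H u) ≈ tK) × ((gL ∘H u) ≈ (m ∘H l)) ×
    Σ (Hom GK GR) λ gR → Σ (Hom R GR) λ w → IsPushout u r GR gR w
    where open PBPORule ρ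

  data Pos : Term → Set where
    here  : ∀ {t} → Pos t
    there : ∀ {f ts} (i : Fin (ar f)) → Pos (lookup ts i) → Pos (fun f ts)

  subAt : (t : Term) → Pos t → Term
  subAt t here                = t
  subAt (fun f ts) (there i p) = subAt (lookup ts i) p

  arity : Term → ℕ
  arity (var _)   = 0
  arity (fun f _) = ar f

  headLab : Term → Lab
  headLab (var _)   = bot
  headLab (fun f _) = sym f

  isVarT : Term → Bool
  isVarT (var _)   = true
  isVarT (fun _ _) = false

  child : (t : Term) (p : Pos t) → Fin (arity (subAt t p)) → Pos t
  child (var x) here ()
  child (fun f ts) here i        = there i here
  child (fun f ts) (there j p) i = there j (child (lookup ts j) p i)

  varPos : ∀ {x t} → x ∈V t → Pos t
  varPos here        = here
  varPos (there i p) = there i (varPos p)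

  subAt-varPos : ∀ {x t} (p : x ∈V t) → subAt t (varPos p) ≡ var x
  subAt-varPos here        = refl
  subAt-varPos (there i p) = subAt-varPos p

  isVarPos : (t : Term) → Pos t → Bool
  isVarPos t p = isVarT (subAt t p)

  isVarPos-varPos : ∀ {x t} (p : x ∈V t) → isVarPos t (varPos p) ≡ true
  isVarPos-varPos p = cong isVarT (subAt-varPos p)

  -- t° : vertices are the positions of t (the vertex of a variable x is
  -- its unique position), labelled by the head symbol or ⊥; edges (p , i)
  -- from p to p·i labelled i (num (toℕ i) stands for the integer i+1).
  enc : Term → Graph
  enc t = record
    { V   = Pos t
    ; E   = Σ (Pos t) λ p → Fin (arity (subAt t p))
    ; src = proj₁
    ; tgt = λ e → child t (proj₁ e) (proj₂ e)
    ; lv  = λ p → headLab (subAt t p)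
    ; le  = λ e → num (toℕ (proj₂ e)) }

  -- 𝓘(r): discrete graph on Var(r) ∪ {ε} (nothing = ε), all labelled ⊥
  IG : Term → Graph
  IG r = record
    { V = Maybe (Σ ℕ λ x → x ∈V r) ; E = ⊥
    ; src = λ () ; tgt = λ () ; lv = λ _ → bot ; le = λ () }

  isVarK : ∀ {r} → V (IG r) → Bool
  isVarK nothing  = false
  isVarK (just _) = true

  -- Context closure 𝒞[G↓𝒳] of a rooted graph G whose variable vertices
  -- are given by isV.

  module _ (G : Graph) (isV : V G → Bool) where
    VarV : Set
    VarV = Σ (V G) λ v → isV v ≡ true

    data CV : Set where
      old   : V G → CV
      prime : VarV → CV
      cnode : CV

    data CE : Set where
      oldE   : E G → CE
      toPrm  : VarV → CE
      loopP  : VarV → CE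
      toRoot : CE
      loopC  : CE

  closure : (G : Graph) (root : V G) (isV : V G → Bool) → Graph
  closure G root isV = record
    { V = CV G isV ; E = CE G isV ; src = s ; tgt = t ; lv = lvC ; le = leC }
    where
      s : CE G isV → CV G isV
      s (oldE e)  = old (src G e)
      s (toPrm x) = old (proj₁ x)
      s (loopP x) = prime x
      s toRoot    = cnode
      s loopC     = cnode
      t : CE G isV → CV G isV
      t (oldE e)  = old (tgt G e)
      t (toPrm x) = prime x
      t (loopP x) = prime x
      t toRoot    = old root
      t loopC     = cnode
      lvC : CV G isV → Lab
      lvC (old v)   = if isV v then top else lv G v
      lvC (prime _) = top
      lvC cnode     = top
      leC : CE G isV → Lab
      leC (oldE e) = le G e
      leC _        = top

  incl-lv : (G : Graph) (isV : V G → Bool) (v : V G) → lv G v ≤L (if isV v then top else lv G v)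
  incl-lv G isV v with isV v
  ... | true  = ≤top
  ... | false = refl≤

  inclH : (G : Graph) (root : V G) (isV : V G → Bool) → Hom G (closure G root isV)
  inclH G root isV = record
    { fV = old ; fE = oldE ; src-c = λ _ → refl ; tgt-c = λ _ → refl
    ; lv-c = incl-lv G isV ; le-c = λ _ → refl≤ }

  module _ {G H : Graph} (rG : V G) (rH : V H) (isG : V G → Bool) (isH : V H → Bool)
           (h : Hom G H) (rootP : fV h rG ≡ rH)
           (varP : ∀ v → isG v ≡ true → isH (fV h v) ≡ true) where

    private
      CG = closure G rG isG
      CH = closure H rH isH

      hv : CV G isG → CV H isH
      hv (old v)         = old (fV h v)
      hv (prime (v , p)) = prime (fV h v , varP v p)
      hv cnode           = cnode

      he : CE G isG → CE H isH
      he (oldE e)        = oldE (fE h e)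
      he (toPrm (v , p)) = toPrm (fV h v , varP v p)
      he (loopP (v , p)) = loopP (fV h v , varP v p)
      he toRoot          = toRoot
      he loopC           = loopC

      hs : ∀ e → hv (src CG e) ≡ src CH (he e)
      hs (oldE e)        = cong old (src-c h e)
      hs (toPrm _)       = refl
      hs (loopP _)       = refl
      hs toRoot          = refl
      hs loopC           = refl

      ht : ∀ e → hv (tgt CG e) ≡ tgt CH (he e)
      ht (oldE e)        = cong old (tgt-c h e)
      ht (toPrm _)       = refl
      ht (loopP _)       = refl
      ht toRoot          = cong old rootP
      ht loopC           = refl

      oldLab : ∀ v → (if isG v then top else lv G v) ≤L (if isH (fV h v) then top else lv H (fV h v))
      oldLab v with isG v in eq
      ... | true rewrite varP v eq = refl≤
      ... | false with isH (fV h v)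
      ...   | true  = ≤top
      ...   | false = lv-c h v

      hl : ∀ v → lv CG v ≤L lv CH (hv v)
      hl (old v)   = oldLab v
      hl (prime _) = refl≤
      hl cnode     = refl≤

      hle : ∀ e → le CG e ≤L le CH (he e)
      hle (oldE e)  = le-c h e
      hle (toPrm _) = refl≤
      hle (loopP _) = refl≤
      hle toRoot    = refl≤
      hle loopC     = refl≤

    closureH : Hom CG CH
    closureH = record { fV = hv ; fE = he ; src-c = hs ; tgt-c = ht ; lv-c = hl ; le-c = hle }

  module _ (ρ : Rule) where
    private
      l = lhs ρ
      r = rhs ρ

    Kl : Hom (IG r) (enc l)
    Kl = record
      { fV = λ { nothing → here ; (just (x , p)) → varPos (var-sub ρ x p) }
      ; fE = λ () ; src-c = λ () ; tgt-c = λ () ; lv-c = λ _ → bot≤ ; le-c = λ () }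

    Kr : Hom (IG r) (enc r)
    Kr = record
      { fV = λ { nothing → here ; (just (x , p)) → varPos p }
      ; fE = λ () ; src-c = λ () ; tgt-c = λ () ; lv-c = λ _ → bot≤ ; le-c = λ () }

    private
      varP : ∀ v → isVarK {r} v ≡ true → isVarPos l (fV Kl v) ≡ true
      varP nothing ()
      varP (just (x , p)) _ = isVarPos-varPos (var-sub ρ x p)

    encRule : PBPORule
    encRule = record
      { L  = enc l
      ; K  = IG r
      ; R  = enc r
      ; L' = closure (enc l) here (isVarPos l)
      ; K' = closure (IG r) nothing isVarK
      ; l  = Kl
      ; r  = Kr
      ; l' = closureH nothing here isVarK (isVarPos l) Kl refl varP
      ; tL = inclH (enc l) here (isVarPos l)
      ; tK = inclH (IG r) nothing isVarK }

  _⇒[_]_ : Graph → TRS → Graph → Set₁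
  G ⇒[ R ] H = Σ (Idx R) λ i → Step (encRule (rule R i)) G H

{-# OPTIONS --safe #-}
module Submission where

-- A step C[lσ] → C[rσ] is simulated by a canonical PBPO⁺ step: the match m₀ embeds l° at the redex,
-- α₀ collapses the context onto 𝒞 and each instance σ x onto x and its primed copy x', the pullback
-- G_K keeps the context, the redex root and one copy of σ x per variable of r, and gluing r° into
-- G_K yields C[rσ]°. Conversely, a match of l° in s° is rigid, so it fixes the redex position p and
-- a substitution σ with s|p = lσ and coincides with m₀; the pullback condition then forces α = α₀,
-- so the given pullback and pushout are isomorphic to the canonical ones. Linearity of r makes the
-- copies of the σ x disjoint and carries linearity of s over to the result.

open import Defs
open import Data.Nat using (ℕ; suc) renaming (_≟_ to _≟ℕ_)
open import Data.Fin using (Fin; toℕ; _≟_) renaming (zero to fz; suc to fs)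
open import Data.Fin.Properties using (toℕ-injective)
open import Data.Vec using (Vec; []; _∷_; lookup; _[_]≔_)
open import Data.Vec.Properties using ([]≔-idempotent; []≔-lookup)
open import Data.Bool using (Bool; true; false; if_then_else_)
open import Data.Maybe using (Maybe; just; nothing)
open import Data.Product using (Σ; _×_; _,_; proj₁; proj₂)
open import Data.Sum using (_⊎_; inj₁; inj₂; [_,_]) renaming (map to smap)
open import Data.Empty using (⊥; ⊥-elim; ⊥-elim-irr)
open import Data.Unit using (⊤; tt)
open import Level using (0ℓ)
open import Relation.Nullary using (yes; no)
open import Relation.Binary.Core using (Rel)
open import Relation.Binary.Bundles using (Setoid)
import Relation.Binary.Reasoning.Setoid as SetoidReasoning
open import Relation.Binary.PropositionalEquality using (_≡_; refl; sym; trans; cong; cong₂; subst; _≢_)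
open import Relation.Binary.PropositionalEquality.Properties using () renaming (isEquivalence to ≡-isEquivalence)
open import Relation.Binary.Construct.Closure.Equivalence as EqClosure using (EqClosure)
open import Relation.Binary.Construct.Closure.ReflexiveTransitive using (ε)
open import Axiom.UniquenessOfIdentityProofs.WithK using (uip)

module GraphMorphisms (Sg : Signature) where
  open WithSig Sg renaming (sym to ssym; subst to tsubst)

  ≈-refl : ∀ {A B} {f : Hom A B} → f ≈ f
  ≈-refl = (λ _ → refl) , (λ _ → refl)

  ≈-sym : ∀ {A B} {f g : Hom A B} → f ≈ g → g ≈ f
  ≈-sym (a , b) = (λ v → sym (a v)) , (λ e → sym (b e))

  ≈-trans : ∀ {A B} {f g h : Hom A B} → f ≈ g → g ≈ h → f ≈ h
  ≈-trans (a , b) (c , d) = (λ v → trans (a v) (c v)) , (λ e → trans (b e) (d e))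

  homSetoid : Graph → Graph → Setoid _ _
  homSetoid A B = record
    { Carrier = Hom A B ; _≈_ = _≈_
    ; isEquivalence = record
      { refl = λ {f} → ≈-refl {f = f}
      ; sym = λ {f} {g} → ≈-sym {f = f} {g = g}
      ; trans = λ {f} {g} {h} → ≈-trans {f = f} {g = g} {h = h} } }

  -- The morphisms are explicit: _≈_ unfolds to pointwise equations, from which they cannot be inferred.
  ∘-congˡ : ∀ {A B C} (h : Hom B C) (f g : Hom A B) → f ≈ g → (h ∘H f) ≈ (h ∘H g)
  ∘-congˡ h f g (a , b) = (λ v → cong (fV h) (a v)) , (λ e → cong (fE h) (b e))

  ∘-congʳ : ∀ {A B C} (f g : Hom B C) (h : Hom A B) → f ≈ g → (f ∘H h) ≈ (g ∘H h)
  ∘-congʳ f g h (a , b) = (λ v → a (fV h v)) , (λ e → b (fE h e))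

  injective⇒mono : ∀ {A B} (m : Hom A B)
                 → (∀ a a' → fV m a ≡ fV m a' → a ≡ a')
                 → (∀ e e' → fE m e ≡ fE m e' → e ≡ e')
                 → Mono m
  injective⇒mono m injV injE g h (a , b) = (λ v → injV _ _ (a v)) , (λ e → injE _ _ (b e))

  -- A commuting square is a pullback once every compatible pair of vertices (edges) has a unique
  -- preimage, whose label is the meet of the two labels.
  module ExplicitPullback {A B C : Graph} (f : Hom A C) (g : Hom B C) (P : Graph) (p₁ : Hom P A) (p₂ : Hom P B)
    (com : (f ∘H p₁) ≈ (g ∘H p₂))
    (pairV : ∀ a b → fV f a ≡ fV g b → V P)
    (pairV-p₁ : ∀ a b e → fV p₁ (pairV a b e) ≡ a)
    (pairV-p₂ : ∀ a b e → fV p₂ (pairV a b e) ≡ b)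
    (pairV-η : ∀ x → pairV (fV p₁ x) (fV p₂ x) (proj₁ com x) ≡ x)
    (pairE : ∀ a b → fE f a ≡ fE g b → E P)
    (pairE-p₁ : ∀ a b e → fE p₁ (pairE a b e) ≡ a)
    (pairE-p₂ : ∀ a b e → fE p₂ (pairE a b e) ≡ b)
    (pairE-η : ∀ x → pairE (fE p₁ x) (fE p₂ x) (proj₂ com x) ≡ x)
    (pairV-lab : ∀ a b e lab → lab ≤L lv A a → lab ≤L lv B b → lab ≤L lv P (pairV a b e))
    (pairE-lab : ∀ a b e lab → lab ≤L le A a → lab ≤L le B b → lab ≤L le P (pairE a b e)) where

    private
      pairV-cong : ∀ {a a' b b'} {e e'} → a ≡ a' → b ≡ b' → pairV a b e ≡ pairV a' b' e'
      pairV-cong {e = e} {e'} refl refl = cong (pairV _ _) (uip e e')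

      pairE-cong : ∀ {a a' b b'} {e e'} → a ≡ a' → b ≡ b' → pairE a b e ≡ pairE a' b' e'
      pairE-cong {e = e} {e'} refl refl = cong (pairE _ _) (uip e e')

      extV : ∀ x y → fV p₁ x ≡ fV p₁ y → fV p₂ x ≡ fV p₂ y → x ≡ y
      extV x y a b = trans (sym (pairV-η x)) (trans (pairV-cong a b) (pairV-η y))

      extE : ∀ x y → fE p₁ x ≡ fE p₁ y → fE p₂ x ≡ fE p₂ y → x ≡ y
      extE x y a b = trans (sym (pairE-η x)) (trans (pairE-cong a b) (pairE-η y))

      module _ (X : Graph) (q₁ : Hom X A) (q₂ : Hom X B) (cm : (f ∘H q₁) ≈ (g ∘H q₂)) where
        hV : V X → V P
        hV x = pairV (fV q₁ x) (fV q₂ x) (proj₁ cm x)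

        hE : E X → E P
        hE x = pairE (fE q₁ x) (fE q₂ x) (proj₂ cm x)

        hE-p₁ : ∀ e → fE p₁ (hE e) ≡ fE q₁ e
        hE-p₁ e = pairE-p₁ _ _ (proj₂ cm e)

        hE-p₂ : ∀ e → fE p₂ (hE e) ≡ fE q₂ e
        hE-p₂ e = pairE-p₂ _ _ (proj₂ cm e)

        mediator : Hom X P
        mediator = record
          { fV = hV ; fE = hE
          ; src-c = λ e → extV _ _
              (trans (pairV-p₁ _ _ _) (trans (src-c q₁ e) (trans (cong (src A) (sym (hE-p₁ e))) (sym (src-c p₁ (hE e))))))
              (trans (pairV-p₂ _ _ _) (trans (src-c q₂ e) (trans (cong (src B) (sym (hE-p₂ e))) (sym (src-c p₂ (hE e))))))
          ; tgt-c = λ e → extV _ _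
              (trans (pairV-p₁ _ _ _) (trans (tgt-c q₁ e) (trans (cong (tgt A) (sym (hE-p₁ e))) (sym (tgt-c p₁ (hE e))))))
              (trans (pairV-p₂ _ _ _) (trans (tgt-c q₂ e) (trans (cong (tgt B) (sym (hE-p₂ e))) (sym (tgt-c p₂ (hE e))))))
          ; lv-c = λ x → pairV-lab _ _ _ _ (lv-c q₁ x) (lv-c q₂ x)
          ; le-c = λ x → pairE-lab _ _ _ _ (le-c q₁ x) (le-c q₂ x) }

        mediator-unique : ∀ (h : Hom X P) → (p₁ ∘H h) ≈ q₁ → (p₂ ∘H h) ≈ q₂ → h ≈ mediator
        mediator-unique h (a , b) (c , d) =
          (λ v → extV _ _ (trans (a v) (sym (pairV-p₁ _ _ _))) (trans (c v) (sym (pairV-p₂ _ _ _)))) ,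
          (λ e → extE _ _ (trans (b e) (sym (hE-p₁ e))) (trans (d e) (sym (hE-p₂ e))))

    isPullback : IsPullback f g P p₁ p₂
    isPullback = com , λ X q₁ q₂ cm →
      mediator X q₁ q₂ cm ,
      ((λ v → pairV-p₁ _ _ _) , (λ e → pairE-p₁ _ _ _)) ,
      ((λ v → pairV-p₂ _ _ _) , (λ e → pairE-p₂ _ _ _)) ,
      mediator-unique X q₁ q₂ cm

  data Glued {C₀ A₀ B₀ : Set} (φ : C₀ → A₀) (ψ : C₀ → B₀) : Rel (A₀ ⊎ B₀) 0ℓ where
    glue : ∀ c → Glued φ ψ (inj₁ (φ c)) (inj₂ (ψ c))

  Glued* : {C₀ A₀ B₀ : Set} (φ : C₀ → A₀) (ψ : C₀ → B₀) → Rel (A₀ ⊎ B₀) 0ℓ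
  Glued* φ ψ = EqClosure (Glued φ ψ)

  glued : ∀ {C₀ A₀ B₀ : Set} {φ : C₀ → A₀} {ψ : C₀ → B₀} c → Glued* φ ψ (inj₁ (φ c)) (inj₂ (ψ c))
  glued c = EqClosure.return (glue c)

  copair-resp-Glued* : ∀ {C₀ A₀ B₀ X₀ : Set} {φ : C₀ → A₀} {ψ : C₀ → B₀} (q₁ : A₀ → X₀) (q₂ : B₀ → X₀)
                     → (∀ c → q₁ (φ c) ≡ q₂ (ψ c)) → ∀ {z z'} → Glued* φ ψ z z' → [ q₁ , q₂ ] z ≡ [ q₁ , q₂ ] z'
  copair-resp-Glued* q₁ q₂ q∘φ≡q∘ψ = EqClosure.gfold ≡-isEquivalence [ q₁ , q₂ ] λ { (glue c) → q∘φ≡q∘ψ c }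

  -- A commuting square is a pushout once every vertex (edge) of Q has a preimage whose label is
  -- at least its own, and all preimages of an element are identified by the equivalence relation
  -- generated by the span.
  module ExplicitPushout {A B C : Graph} (f : Hom C A) (g : Hom C B) (Q : Graph) (i₁ : Hom A Q) (i₂ : Hom B Q)
    (com : (i₁ ∘H f) ≈ (i₂ ∘H g))
    (origV : V Q → V A ⊎ V B) (origV-sect : ∀ v → [ fV i₁ , fV i₂ ] (origV v) ≡ v)
    (origE : E Q → E A ⊎ E B) (origE-sect : ∀ e → [ fE i₁ , fE i₂ ] (origE e) ≡ e)
    (origV-i₁ : ∀ a → Glued* (fV f) (fV g) (origV (fV i₁ a)) (inj₁ a))
    (origV-i₂ : ∀ b → Glued* (fV f) (fV g) (origV (fV i₂ b)) (inj₂ b))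
    (origE-i₁ : ∀ a → Glued* (fE f) (fE g) (origE (fE i₁ a)) (inj₁ a))
    (origE-i₂ : ∀ b → Glued* (fE f) (fE g) (origE (fE i₂ b)) (inj₂ b))
    (origV-lab : ∀ v → lv Q v ≤L [ lv A , lv B ] (origV v))
    (origE-lab : ∀ e → le Q e ≤L [ le A , le B ] (origE e)) where

    private
      module _ (X : Graph) (q₁ : Hom A X) (q₂ : Hom B X) (cm : (q₁ ∘H f) ≈ (q₂ ∘H g)) where
        hV : V Q → V X
        hV v = [ fV q₁ , fV q₂ ] (origV v)

        hE : E Q → E X
        hE e = [ fE q₁ , fE q₂ ] (origE e)

        hV-i₁ : ∀ a → hV (fV i₁ a) ≡ fV q₁ a
        hV-i₁ a = copair-resp-Glued* (fV q₁) (fV q₂) (proj₁ cm) (origV-i₁ a)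

        hV-i₂ : ∀ b → hV (fV i₂ b) ≡ fV q₂ b
        hV-i₂ b = copair-resp-Glued* (fV q₁) (fV q₂) (proj₁ cm) (origV-i₂ b)

        hE-i₁ : ∀ a → hE (fE i₁ a) ≡ fE q₁ a
        hE-i₁ a = copair-resp-Glued* (fE q₁) (fE q₂) (proj₂ cm) (origE-i₁ a)

        hE-i₂ : ∀ b → hE (fE i₂ b) ≡ fE q₂ b
        hE-i₂ b = copair-resp-Glued* (fE q₁) (fE q₂) (proj₂ cm) (origE-i₂ b)

        src-on-image : ∀ z → hV (src Q ([ fE i₁ , fE i₂ ] z)) ≡ src X ([ fE q₁ , fE q₂ ] z)
        src-on-image (inj₁ a) = trans (cong hV (sym (src-c i₁ a))) (trans (hV-i₁ _) (src-c q₁ a))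
        src-on-image (inj₂ b) = trans (cong hV (sym (src-c i₂ b))) (trans (hV-i₂ _) (src-c q₂ b))

        tgt-on-image : ∀ z → hV (tgt Q ([ fE i₁ , fE i₂ ] z)) ≡ tgt X ([ fE q₁ , fE q₂ ] z)
        tgt-on-image (inj₁ a) = trans (cong hV (sym (tgt-c i₁ a))) (trans (hV-i₁ _) (tgt-c q₁ a))
        tgt-on-image (inj₂ b) = trans (cong hV (sym (tgt-c i₂ b))) (trans (hV-i₂ _) (tgt-c q₂ b))

        lv-copair : ∀ z → [ lv A , lv B ] z ≤L lv X ([ fV q₁ , fV q₂ ] z)
        lv-copair (inj₁ a) = lv-c q₁ a
        lv-copair (inj₂ b) = lv-c q₂ b

        le-copair : ∀ z → [ le A , le B ] z ≤L le X ([ fE q₁ , fE q₂ ] z)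
        le-copair (inj₁ a) = le-c q₁ a
        le-copair (inj₂ b) = le-c q₂ b

        mediator : Hom Q X
        mediator = record
          { fV = hV ; fE = hE
          ; src-c = λ e → trans (cong (λ e' → hV (src Q e')) (sym (origE-sect e))) (src-on-image (origE e))
          ; tgt-c = λ e → trans (cong (λ e' → hV (tgt Q e')) (sym (origE-sect e))) (tgt-on-image (origE e))
          ; lv-c = λ v → ≤L-trans (origV-lab v) (lv-copair (origV v))
          ; le-c = λ e → ≤L-trans (origE-lab e) (le-copair (origE e)) }

        mediator-unique : ∀ (h : Hom Q X) → (h ∘H i₁) ≈ q₁ → (h ∘H i₂) ≈ q₂ → h ≈ mediator
        mediator-unique h (a , b) (c , d) =
          (λ v → trans (cong (fV h) (sym (origV-sect v))) (onV (origV v))) ,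
          (λ e → trans (cong (fE h) (sym (origE-sect e))) (onE (origE e)))
          where
          onV : ∀ z → fV h ([ fV i₁ , fV i₂ ] z) ≡ [ fV q₁ , fV q₂ ] z
          onV (inj₁ x) = a x
          onV (inj₂ y) = c y
          onE : ∀ z → fE h ([ fE i₁ , fE i₂ ] z) ≡ [ fE q₁ , fE q₂ ] z
          onE (inj₁ x) = b x
          onE (inj₂ y) = d y

    isPushout : IsPushout f g Q i₁ i₂
    isPushout = com , λ X q₁ q₂ cm →
      mediator X q₁ q₂ cm ,
      (hV-i₁ X q₁ q₂ cm , hE-i₁ X q₁ q₂ cm) ,
      (hV-i₂ X q₁ q₂ cm , hE-i₂ X q₁ q₂ cm) ,
      mediator-unique X q₁ q₂ cm

  module Pullback {A B C P} (f : Hom A C) (g : Hom B C) (p₁ : Hom P A) (p₂ : Hom P B)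
                  (pb : IsPullback f g P p₁ p₂) where

    commutes : (f ∘H p₁) ≈ (g ∘H p₂)
    commutes = proj₁ pb

    mediator : ∀ {X} (q₁ : Hom X A) (q₂ : Hom X B) → (f ∘H q₁) ≈ (g ∘H q₂) → Hom X P
    mediator q₁ q₂ cm = proj₁ (proj₂ pb _ q₁ q₂ cm)

    mediator-p₁ : ∀ {X} (q₁ : Hom X A) (q₂ : Hom X B) (cm : (f ∘H q₁) ≈ (g ∘H q₂)) → (p₁ ∘H mediator q₁ q₂ cm) ≈ q₁
    mediator-p₁ q₁ q₂ cm = proj₁ (proj₂ (proj₂ pb _ q₁ q₂ cm))

    mediator-p₂ : ∀ {X} (q₁ : Hom X A) (q₂ : Hom X B) (cm : (f ∘H q₁) ≈ (g ∘H q₂)) → (p₂ ∘H mediator q₁ q₂ cm) ≈ q₂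
    mediator-p₂ q₁ q₂ cm = proj₁ (proj₂ (proj₂ (proj₂ pb _ q₁ q₂ cm)))

    jointly-monic : ∀ {X} (h h' : Hom X P) → (p₁ ∘H h) ≈ (p₁ ∘H h') → (p₂ ∘H h) ≈ (p₂ ∘H h') → h ≈ h'
    jointly-monic {X} h h' e₁ e₂ = begin
      h  ≈⟨ uniq h e₁ e₂ ⟩
      k  ≈⟨ uniq h' (≈-refl {f = p₁ ∘H h'}) (≈-refl {f = p₂ ∘H h'}) ⟨
      h' ∎
      where
      open SetoidReasoning (homSetoid X P)
      med = proj₂ pb X (p₁ ∘H h') (p₂ ∘H h') (∘-congʳ (f ∘H p₁) (g ∘H p₂) h' commutes)
      k = proj₁ med
      uniq = proj₂ (proj₂ (proj₂ med))

  module Pushout {A B C Q} (f : Hom C A) (g : Hom C B) (i₁ : Hom A Q) (i₂ : Hom B Q)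
                 (po : IsPushout f g Q i₁ i₂) where

    commutes : (i₁ ∘H f) ≈ (i₂ ∘H g)
    commutes = proj₁ po

    mediator : ∀ {X} (q₁ : Hom A X) (q₂ : Hom B X) → (q₁ ∘H f) ≈ (q₂ ∘H g) → Hom Q X
    mediator q₁ q₂ cm = proj₁ (proj₂ po _ q₁ q₂ cm)

    mediator-i₁ : ∀ {X} (q₁ : Hom A X) (q₂ : Hom B X) (cm : (q₁ ∘H f) ≈ (q₂ ∘H g)) → (mediator q₁ q₂ cm ∘H i₁) ≈ q₁
    mediator-i₁ q₁ q₂ cm = proj₁ (proj₂ (proj₂ po _ q₁ q₂ cm))

    mediator-i₂ : ∀ {X} (q₁ : Hom A X) (q₂ : Hom B X) (cm : (q₁ ∘H f) ≈ (q₂ ∘H g)) → (mediator q₁ q₂ cm ∘H i₂) ≈ q₂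
    mediator-i₂ q₁ q₂ cm = proj₁ (proj₂ (proj₂ (proj₂ po _ q₁ q₂ cm)))

    jointly-epic : ∀ {X} (h h' : Hom Q X) → (h ∘H i₁) ≈ (h' ∘H i₁) → (h ∘H i₂) ≈ (h' ∘H i₂) → h ≈ h'
    jointly-epic {X} h h' e₁ e₂ = begin
      h  ≈⟨ uniq h e₁ e₂ ⟩
      k  ≈⟨ uniq h' (≈-refl {f = h' ∘H i₁}) (≈-refl {f = h' ∘H i₂}) ⟨
      h' ∎
      where
      open SetoidReasoning (homSetoid Q X)
      med = proj₂ po X (h' ∘H i₁) (h' ∘H i₂) (∘-congˡ h' (i₁ ∘H f) (i₂ ∘H g) commutes)
      k = proj₁ med
      uniq = proj₂ (proj₂ (proj₂ med))

  pullback-resp-≈ : ∀ {A B C P} {f f' : Hom A C} {g : Hom B C} {p₁ : Hom P A} {p₂ : Hom P B}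
                  → f ≈ f' → IsPullback f g P p₁ p₂ → IsPullback f' g P p₁ p₂
  pullback-resp-≈ {f = f} {f'} {g} {p₁} {p₂} ff' (com , med) =
    ≈-trans {f = f' ∘H p₁} {g = f ∘H p₁} {h = g ∘H p₂} (∘-congʳ f' f p₁ (≈-sym {f = f} {g = f'} ff')) com ,
    λ X q₁ q₂ cm → med X q₁ q₂ (≈-trans {f = f ∘H q₁} {g = f' ∘H q₁} {h = g ∘H q₂} (∘-congʳ f f' q₁ ff') cm)


  module PullbackComparison {A B C P P'} (f : Hom A C) (g : Hom B C)
           (p₁ : Hom P A) (p₂ : Hom P B) (p₁' : Hom P' A) (p₂' : Hom P' B)
           (pb : IsPullback f g P p₁ p₂) (pb' : IsPullback f g P' p₁' p₂') where

    private
      module PB = Pullback f g p₁ p₂ pb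
      module PB' = Pullback f g p₁' p₂' pb'

    to : Hom P P'
    to = PB'.mediator p₁ p₂ PB.commutes

    from : Hom P' P
    from = PB.mediator p₁' p₂' PB'.commutes

    to-p₁ : (p₁' ∘H to) ≈ p₁
    to-p₁ = PB'.mediator-p₁ p₁ p₂ PB.commutes

    to-p₂ : (p₂' ∘H to) ≈ p₂
    to-p₂ = PB'.mediator-p₂ p₁ p₂ PB.commutes

    from-p₁ : (p₁ ∘H from) ≈ p₁'
    from-p₁ = PB.mediator-p₁ p₁' p₂' PB'.commutes

    from-p₂ : (p₂ ∘H from) ≈ p₂'
    from-p₂ = PB.mediator-p₂ p₁' p₂' PB'.commutes

    from∘to : (from ∘H to) ≈ idH
    from∘to = PB.jointly-monic (from ∘H to) idH
      (let open SetoidReasoning (homSetoid P A) in begin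
        p₁ ∘H (from ∘H to)  ≈⟨ ∘-congʳ (p₁ ∘H from) p₁' to from-p₁ ⟩
        p₁' ∘H to           ≈⟨ to-p₁ ⟩
        p₁                  ∎)
      (let open SetoidReasoning (homSetoid P B) in begin
        p₂ ∘H (from ∘H to)  ≈⟨ ∘-congʳ (p₂ ∘H from) p₂' to from-p₂ ⟩
        p₂' ∘H to           ≈⟨ to-p₂ ⟩
        p₂                  ∎)

    to∘from : (to ∘H from) ≈ idH
    to∘from = PB'.jointly-monic (to ∘H from) idH
      (let open SetoidReasoning (homSetoid P' A) in begin
        p₁' ∘H (to ∘H from)  ≈⟨ ∘-congʳ (p₁' ∘H to) p₁ from to-p₁ ⟩
        p₁ ∘H from           ≈⟨ from-p₁ ⟩
        p₁'                  ∎)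
      (let open SetoidReasoning (homSetoid P' B) in begin
        p₂' ∘H (to ∘H from)  ≈⟨ ∘-congʳ (p₂' ∘H to) p₂ from to-p₂ ⟩
        p₂ ∘H from           ≈⟨ from-p₂ ⟩
        p₂'                  ∎)

  module PushoutComparison {K GK₀ GK R Q₀ Q} (u₀ : Hom K GK₀) (u : Hom K GK) (r : Hom K R)
           (gR₀ : Hom GK₀ Q₀) (w₀ : Hom R Q₀) (gR : Hom GK Q) (w : Hom R Q)
           (po₀ : IsPushout u₀ r Q₀ gR₀ w₀) (po : IsPushout u r Q gR w)
           (φ : Hom GK₀ GK) (ψ : Hom GK GK₀) (ψ∘φ : (ψ ∘H φ) ≈ idH) (φ∘ψ : (φ ∘H ψ) ≈ idH)
           (φ∘u₀ : (φ ∘H u₀) ≈ u) where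

    private
      module PO₀ = Pushout u₀ r gR₀ w₀ po₀
      module PO = Pushout u r gR w po

    ψ∘u : (ψ ∘H u) ≈ u₀
    ψ∘u = begin
      ψ ∘H u          ≈⟨ ∘-congˡ ψ (φ ∘H u₀) u φ∘u₀ ⟨
      (ψ ∘H φ) ∘H u₀  ≈⟨ ∘-congʳ (ψ ∘H φ) idH u₀ ψ∘φ ⟩
      u₀              ∎
      where open SetoidReasoning (homSetoid K GK₀)

    to : Hom Q₀ Q
    to = PO₀.mediator (gR ∘H φ) w (begin
      gR ∘H (φ ∘H u₀)  ≈⟨ ∘-congˡ gR (φ ∘H u₀) u φ∘u₀ ⟩
      gR ∘H u          ≈⟨ PO.commutes ⟩
      w ∘H r           ∎)
      where open SetoidReasoning (homSetoid K Q)

    from : Hom Q Q₀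
    from = PO.mediator (gR₀ ∘H ψ) w₀ (begin
      gR₀ ∘H (ψ ∘H u)  ≈⟨ ∘-congˡ gR₀ (ψ ∘H u) u₀ ψ∘u ⟩
      gR₀ ∘H u₀        ≈⟨ PO₀.commutes ⟩
      w₀ ∘H r          ∎)
      where open SetoidReasoning (homSetoid K Q₀)

    from∘to : (from ∘H to) ≈ idH
    from∘to = PO₀.jointly-epic (from ∘H to) idH
      (let open SetoidReasoning (homSetoid GK₀ Q₀) in begin
        from ∘H (to ∘H gR₀)  ≈⟨ ∘-congˡ from (to ∘H gR₀) (gR ∘H φ) (PO₀.mediator-i₁ _ _ _) ⟩
        (from ∘H gR) ∘H φ    ≈⟨ ∘-congʳ (from ∘H gR) (gR₀ ∘H ψ) φ (PO.mediator-i₁ _ _ _) ⟩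
        gR₀ ∘H (ψ ∘H φ)      ≈⟨ ∘-congˡ gR₀ (ψ ∘H φ) idH ψ∘φ ⟩
        gR₀                  ∎)
      (let open SetoidReasoning (homSetoid R Q₀) in begin
        from ∘H (to ∘H w₀)  ≈⟨ ∘-congˡ from (to ∘H w₀) w (PO₀.mediator-i₂ _ _ _) ⟩
        from ∘H w           ≈⟨ PO.mediator-i₂ _ _ _ ⟩
        w₀                  ∎)

    to∘from : (to ∘H from) ≈ idH
    to∘from = PO.jointly-epic (to ∘H from) idH
      (let open SetoidReasoning (homSetoid GK Q) in begin
        to ∘H (from ∘H gR)  ≈⟨ ∘-congˡ to (from ∘H gR) (gR₀ ∘H ψ) (PO.mediator-i₁ _ _ _) ⟩
        (to ∘H gR₀) ∘H ψ    ≈⟨ ∘-congʳ (to ∘H gR₀) (gR ∘H φ) ψ (PO₀.mediator-i₁ _ _ _) ⟩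
        gR ∘H (φ ∘H ψ)      ≈⟨ ∘-congˡ gR (φ ∘H ψ) idH φ∘ψ ⟩
        gR                  ∎)
      (let open SetoidReasoning (homSetoid R Q) in begin
        to ∘H (from ∘H w)  ≈⟨ ∘-congˡ to (from ∘H w) w₀ (PO.mediator-i₂ _ _ _) ⟩
        to ∘H w₀           ≈⟨ PO₀.mediator-i₂ _ _ _ ⟩
        w                  ∎)

    iso : Q ≅ Q₀
    iso = from , to , to∘from , from∘to

  pushout-over-pullback-unique :
    ∀ {GL L' K' K R GK₀ GK Q₀ Q} (α : Hom GL L') (l' : Hom K' L') (tK : Hom K K') (x : Hom K GL) (r : Hom K R)
      (gL₀ : Hom GK₀ GL) (u'₀ : Hom GK₀ K') (u₀ : Hom K GK₀) (gR₀ : Hom GK₀ Q₀) (w₀ : Hom R Q₀)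
      (gL : Hom GK GL) (u' : Hom GK K') (u : Hom K GK) (gR : Hom GK Q) (w : Hom R Q)
    → IsPullback α l' GK₀ gL₀ u'₀ → (u'₀ ∘H u₀) ≈ tK → (gL₀ ∘H u₀) ≈ x → IsPushout u₀ r Q₀ gR₀ w₀
    → IsPullback α l' GK gL u'    → (u' ∘H u) ≈ tK   → (gL ∘H u) ≈ x   → IsPushout u r Q gR w
    → Q ≅ Q₀
  pushout-over-pullback-unique {K = K} {GK = GK} α l' tK x r gL₀ u'₀ u₀ gR₀ w₀ gL u' u gR w
                               pb₀ u'₀∘u₀ gL₀∘u₀ po₀ pb u'∘u gL∘u po =
    PushoutComparison.iso u₀ u r gR₀ w₀ gR w po₀ po to from from∘to to∘from to∘u₀
    where
    open PullbackComparison α l' gL₀ u'₀ gL u' pb₀ pb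
    to∘u₀ : (to ∘H u₀) ≈ u
    to∘u₀ = Pullback.jointly-monic α l' gL u' pb (to ∘H u₀) u
      (let open SetoidReasoning (homSetoid K _) in begin
        (gL ∘H to) ∘H u₀  ≈⟨ ∘-congʳ (gL ∘H to) gL₀ u₀ to-p₁ ⟩
        gL₀ ∘H u₀         ≈⟨ gL₀∘u₀ ⟩
        x                 ≈⟨ gL∘u ⟨
        gL ∘H u           ∎)
      (let open SetoidReasoning (homSetoid K _) in begin
        (u' ∘H to) ∘H u₀  ≈⟨ ∘-congʳ (u' ∘H to) u'₀ u₀ to-p₂ ⟩
        u'₀ ∘H u₀         ≈⟨ u'₀∘u₀ ⟩
        tK                ≈⟨ u'∘u ⟨
        u' ∘H u           ∎)

  pointGraph : Graph
  pointGraph = record { V = ⊤ ; E = ⊥ ; src = λ () ; tgt = λ () ; lv = λ _ → bot ; le = λ () }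

  constHom : ∀ {A : Graph} → V A → Hom pointGraph A
  constHom a = record { fV = λ _ → a ; fE = λ () ; src-c = λ () ; tgt-c = λ () ; lv-c = λ _ → bot≤ ; le-c = λ () }

  pullback-lifts-vertices : ∀ {L L' GL : Graph} (tL : Hom L L') (α : Hom GL L') (m : Hom L GL)
                          → IsPullback tL α L idH m → ∀ q w → fV α q ≡ fV tL w → fV m w ≡ q
  pullback-lifts-vertices tL α m (com , med) q w h with med pointGraph (constHom w) (constHom q) ((λ _ → sym h) , (λ ()))
  ... | h' , (a₁ , _) , (a₂ , _) , _ = trans (cong (fV m) (sym (a₁ tt))) (a₂ tt)

module TermPositions (Sg : Signature) where
  open WithSig Sg renaming (sym to ssym; subst to tsubst)
  open GraphMorphisms Sg

  castF : ∀ {m n} → m ≡ n → Fin m → Fin n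
  castF refl j = j

  toℕ-castF : ∀ {m n} (e : m ≡ n) (j : Fin m) → toℕ (castF e j) ≡ toℕ j
  toℕ-castF refl j = refl

  castF-irr : ∀ {m n} (e e' : m ≡ n) (j : Fin m) → castF e j ≡ castF e' j
  castF-irr e e' j = cong (λ z → castF z j) (uip e e')

  castF-trans : ∀ {a b c} (x : a ≡ b) (y : b ≡ c) (j : Fin a) → castF (trans x y) j ≡ castF y (castF x j)
  castF-trans refl refl j = refl

  castF-split : ∀ {a b c} (e : a ≡ c) (x : a ≡ b) (y : b ≡ c) (j : Fin a) → castF e j ≡ castF y (castF x j)
  castF-split e x y j = trans (castF-irr e (trans x y) j) (castF-trans x y j)

  EdgeT : Term → Set
  EdgeT t = Σ (Pos t) λ q → Fin (arity (subAt t q))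

  edgeEq : ∀ (t : Term) {q q' : Pos t} {j : Fin (arity (subAt t q))} {j' : Fin (arity (subAt t q'))}
         → q ≡ q' → toℕ j ≡ toℕ j' → _≡_ {A = EdgeT t} (q , j) (q' , j')
  edgeEq t refl e = cong (_ ,_) (toℕ-injective e)

  castP : ∀ {t t'} → t ≡ t' → Pos t → Pos t'
  castP refl q = q

  castP-here : ∀ {t t'} (e : t ≡ t') → castP e here ≡ here
  castP-here refl = refl

  castP-inv : ∀ {t t'} (e : t ≡ t') (q : Pos t) → castP (sym e) (castP e q) ≡ q
  castP-inv refl q = refl

  castP-inv' : ∀ {t t'} (e : t ≡ t') (q : Pos t') → castP e (castP (sym e) q) ≡ q
  castP-inv' refl q = refl

  castP-inj : ∀ {t t'} (e : t ≡ t') {q q' : Pos t} → castP e q ≡ castP e q' → q ≡ q'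
  castP-inj refl x = x

  subAt-castP : ∀ {t t'} (e : t ≡ t') (q : Pos t) → subAt t' (castP e q) ≡ subAt t q
  subAt-castP refl q = refl

  child-castP : ∀ {t t'} (e : t ≡ t') (q : Pos t) (j : Fin (arity (subAt t q)))
                (e' : arity (subAt t q) ≡ arity (subAt t' (castP e q)))
              → child t' (castP e q) (castF e' j) ≡ castP e (child t q j)
  child-castP refl q j e' rewrite uip e' refl = refl

  ext : (t : Term) (p : Pos t) → Pos (subAt t p) → Pos t
  ext t here q = q
  ext (fun f ts) (there i p) q = there i (ext (lookup ts i) p q)

  subAt-ext : (t : Term) (p : Pos t) (q : Pos (subAt t p)) → subAt t (ext t p q) ≡ subAt (subAt t p) q
  subAt-ext t here q = refl
  subAt-ext (fun f ts) (there i p) q = subAt-ext (lookup ts i) p q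

  child-ext : (t : Term) (p : Pos t) (q : Pos (subAt t p)) (j : Fin (arity (subAt (subAt t p) q)))
              (e : arity (subAt (subAt t p) q) ≡ arity (subAt t (ext t p q)))
            → child t (ext t p q) (castF e j) ≡ ext t p (child (subAt t p) q j)
  child-ext t here q j e rewrite uip e refl = refl
  child-ext (fun f ts) (there i p) q j e = cong (there i) (child-ext (lookup ts i) p q j e)

  ext-here : (t : Term) (p : Pos t) → ext t p here ≡ p
  ext-here t here = refl
  ext-here (fun f ts) (there i p) = cong (there i) (ext-here (lookup ts i) p)

  there-inj : ∀ {f ts i} {q q' : Pos (lookup ts i)} → _≡_ {A = Pos (fun f ts)} (there i q) (there i q') → q ≡ q'
  there-inj refl = refl

  there-inj' : ∀ {f ts i j} {q : Pos (lookup ts i)} {q' : Pos (lookup ts j)} → _≡_ {A = Pos (fun f ts)} (there i q) (there j q') → i ≡ j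
  there-inj' refl = refl

  ext-inj : (t : Term) (p : Pos t) {q q' : Pos (subAt t p)} → ext t p q ≡ ext t p q' → q ≡ q'
  ext-inj t here e = e
  ext-inj (fun f ts) (there i p) e = ext-inj (lookup ts i) p (there-inj e)

  snocInd : (t : Term) (P : Pos t → Set) → P here → (∀ w j → P w → P (child t w j)) → ∀ w → P w
  snocInd t P h st here = h
  snocInd (fun f ts) P h st (there i w) =
    snocInd (lookup ts i) (λ w' → P (there i w')) (st here i h) (λ w' j → st (there i w') j) w

  data SameHead : Term → Term → Set where
    shv : ∀ {x y} → SameHead (var x) (var y)
    shf : ∀ {f ts us} → SameHead (fun f ts) (fun f us)

  sh-lab : ∀ {a b} → SameHead a b → headLab a ≡ headLab b
  sh-lab shv = refl
  sh-lab shf = refl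

  sh-ar : ∀ {a b} → SameHead a b → arity a ≡ arity b
  sh-ar shv = refl
  sh-ar shf = refl

  sh-refl : ∀ a → SameHead a a
  sh-refl (var x) = shv
  sh-refl (fun f ts) = shf

  ≡⇒≤L : ∀ {a b} → a ≡ b → a ≤L b
  ≡⇒≤L refl = refl≤

  ≤sym : ∀ {f} {t} → ssym f ≤L headLab t → headLab t ≡ ssym f
  ≤sym {t = var x} ()
  ≤sym {t = fun f ts} refl≤ = refl

  ≤num : ∀ {a b} → num a ≤L num b → a ≡ b
  ≤num refl≤ = refl

  ≤bot : ∀ {a} → a ≤L bot → a ≡ bot
  ≤bot bot≤ = refl
  ≤bot refl≤ = refl

module Replacement (Sg : Signature) where
  open WithSig Sg renaming (sym to ssym; subst to tsubst)
  open GraphMorphisms Sg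
  open TermPositions Sg

  replace : (s : Term) → Pos s → Term → Term
  replace s here v = v
  replace (fun f ts) (there i p) v = fun f (ts [ i ]≔ replace (lookup ts i) p v)

  updAt : ∀ {n} (ts : Vec Term n) (i : Fin n) {X : Term} → Pos X → Pos (lookup (ts [ i ]≔ X) i)
  updAt (t ∷ ts) fz q = q
  updAt (t ∷ ts) (fs i) q = updAt ts i q

  updAt⁻ : ∀ {n} (ts : Vec Term n) (i : Fin n) {X : Term} → Pos (lookup (ts [ i ]≔ X) i) → Pos X
  updAt⁻ (t ∷ ts) fz q = q
  updAt⁻ (t ∷ ts) (fs i) q = updAt⁻ ts i q

  updAt-rt : ∀ {n} (ts : Vec Term n) (i : Fin n) {X : Term} (q : Pos X) → updAt⁻ ts i (updAt ts i q) ≡ q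
  updAt-rt (t ∷ ts) fz q = refl
  updAt-rt (t ∷ ts) (fs i) q = updAt-rt ts i q

  updAt-rt' : ∀ {n} (ts : Vec Term n) (i : Fin n) {X : Term} (q : Pos (lookup (ts [ i ]≔ X) i)) → updAt ts i (updAt⁻ ts i q) ≡ q
  updAt-rt' (t ∷ ts) fz q = refl
  updAt-rt' (t ∷ ts) (fs i) q = updAt-rt' ts i q

  subAt-updAt : ∀ {n} (ts : Vec Term n) (i : Fin n) {X : Term} (q : Pos X) → subAt (lookup (ts [ i ]≔ X) i) (updAt ts i q) ≡ subAt X q
  subAt-updAt (t ∷ ts) fz q = refl
  subAt-updAt (t ∷ ts) (fs i) q = subAt-updAt ts i q

  child-updAt : ∀ {n} (ts : Vec Term n) (i : Fin n) {X : Term} (q : Pos X) (j : Fin (arity (subAt X q)))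
                (e : arity (subAt X q) ≡ arity (subAt (lookup (ts [ i ]≔ X) i) (updAt ts i q)))
              → child (lookup (ts [ i ]≔ X) i) (updAt ts i q) (castF e j) ≡ updAt ts i (child X q j)
  child-updAt (t ∷ ts) fz q j e rewrite uip e refl = refl
  child-updAt (t ∷ ts) (fs i) q j e = child-updAt ts i q j e

  updNe : ∀ {n} (ts : Vec Term n) (i j : Fin n) {X : Term} → .(j ≢ i) → Pos (lookup ts j) → Pos (lookup (ts [ i ]≔ X) j)
  updNe (t ∷ ts) fz fz ne q = ⊥-elim-irr (ne refl)
  updNe (t ∷ ts) fz (fs j) ne q = q
  updNe (t ∷ ts) (fs i) fz ne q = q
  updNe (t ∷ ts) (fs i) (fs j) ne q = updNe ts i j (λ e → ne (cong fs e)) q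

  updNe⁻ : ∀ {n} (ts : Vec Term n) (i j : Fin n) {X : Term} → .(j ≢ i) → Pos (lookup (ts [ i ]≔ X) j) → Pos (lookup ts j)
  updNe⁻ (t ∷ ts) fz fz ne q = ⊥-elim-irr (ne refl)
  updNe⁻ (t ∷ ts) fz (fs j) ne q = q
  updNe⁻ (t ∷ ts) (fs i) fz ne q = q
  updNe⁻ (t ∷ ts) (fs i) (fs j) ne q = updNe⁻ ts i j (λ e → ne (cong fs e)) q

  updNe-rt : ∀ {n} (ts : Vec Term n) (i j : Fin n) {X : Term} .(ne : j ≢ i) (q : Pos (lookup ts j)) → updNe⁻ ts i j {X} ne (updNe ts i j ne q) ≡ q
  updNe-rt (t ∷ ts) fz fz ne q = ⊥-elim-irr (ne refl)
  updNe-rt (t ∷ ts) fz (fs j) ne q = refl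
  updNe-rt (t ∷ ts) (fs i) fz ne q = refl
  updNe-rt (t ∷ ts) (fs i) (fs j) ne q = updNe-rt ts i j (λ e → ne (cong fs e)) q

  updNe-rt' : ∀ {n} (ts : Vec Term n) (i j : Fin n) {X : Term} .(ne : j ≢ i) (q : Pos (lookup (ts [ i ]≔ X) j)) → updNe ts i j ne (updNe⁻ ts i j ne q) ≡ q
  updNe-rt' (t ∷ ts) fz fz ne q = ⊥-elim-irr (ne refl)
  updNe-rt' (t ∷ ts) fz (fs j) ne q = refl
  updNe-rt' (t ∷ ts) (fs i) fz ne q = refl
  updNe-rt' (t ∷ ts) (fs i) (fs j) ne q = updNe-rt' ts i j (λ e → ne (cong fs e)) q

  subAt-updNe : ∀ {n} (ts : Vec Term n) (i j : Fin n) {X : Term} .(ne : j ≢ i) (q : Pos (lookup ts j))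
              → subAt (lookup (ts [ i ]≔ X) j) (updNe ts i j ne q) ≡ subAt (lookup ts j) q
  subAt-updNe (t ∷ ts) fz fz ne q = ⊥-elim-irr (ne refl)
  subAt-updNe (t ∷ ts) fz (fs j) ne q = refl
  subAt-updNe (t ∷ ts) (fs i) fz ne q = refl
  subAt-updNe (t ∷ ts) (fs i) (fs j) ne q = subAt-updNe ts i j (λ e → ne (cong fs e)) q

  child-updNe : ∀ {n} (ts : Vec Term n) (i j : Fin n) {X : Term} .(ne : j ≢ i) (q : Pos (lookup ts j))
                (k : Fin (arity (subAt (lookup ts j) q)))
                (e : arity (subAt (lookup ts j) q) ≡ arity (subAt (lookup (ts [ i ]≔ X) j) (updNe ts i j ne q)))
              → child (lookup (ts [ i ]≔ X) j) (updNe ts i j ne q) (castF e k) ≡ updNe ts i j ne (child (lookup ts j) q k)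
  child-updNe (t ∷ ts) fz fz ne q k e = ⊥-elim-irr (ne refl)
  child-updNe (t ∷ ts) fz (fs j) ne q k e rewrite uip e refl = refl
  child-updNe (t ∷ ts) (fs i) fz ne q k e rewrite uip e refl = refl
  child-updNe (t ∷ ts) (fs i) (fs j) ne q k e = child-updNe ts i j (λ e → ne (cong fs e)) q k e

  updAt-here : ∀ {n} (ts : Vec Term n) (i : Fin n) {X : Term} → updAt ts i {X} here ≡ here
  updAt-here (t ∷ ts) fz = refl
  updAt-here (t ∷ ts) (fs i) = updAt-here ts i

  updNe-here : ∀ {n} (ts : Vec Term n) (i j : Fin n) {X : Term} .(ne : j ≢ i) → updNe ts i j {X} ne here ≡ here
  updNe-here (t ∷ ts) fz fz ne = ⊥-elim-irr (ne refl)
  updNe-here (t ∷ ts) fz (fs j) ne = refl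
  updNe-here (t ∷ ts) (fs i) fz ne = refl
  updNe-here (t ∷ ts) (fs i) (fs j) ne = updNe-here ts i j (λ e → ne (cong fs e))

  data Out : (s : Term) → Pos s → Set where
    oroot : ∀ {f ts i} {p : Pos (lookup ts i)} → Out (fun f ts) (there i p)
    oside : ∀ {f ts i} {p : Pos (lookup ts i)} (j : Fin (ar f)) → .(j ≢ i) → Pos (lookup ts j) → Out (fun f ts) (there i p)
    odown : ∀ {f ts i} {p : Pos (lookup ts i)} → Out (lookup ts i) p → Out (fun f ts) (there i p)

  outS : ∀ {s p} → Out s p → Pos s
  outS oroot = here
  outS (oside j ne q) = there j q
  outS (odown o) = there _ (outS o)

  outR : ∀ {s p} (v : Term) → Out s p → Pos (replace s p v)
  outR v oroot = here
  outR {fun f ts} {there i p} v (oside j ne q) = there j (updNe ts i j ne q)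
  outR {fun f ts} {there i p} v (odown o) = there i (updAt ts i (outR v o))

  extT : (s : Term) (p : Pos s) (v : Term) → Pos v → Pos (replace s p v)
  extT s here v q = q
  extT (fun f ts) (there i p) v q = there i (updAt ts i (extT (lookup ts i) p v q))

  outS-inj : ∀ {s p} (o o' : Out s p) → outS o ≡ outS o' → o ≡ o'
  outS-inj oroot oroot e = refl
  outS-inj oroot (oside j x x₁) ()
  outS-inj oroot (odown o') ()
  outS-inj (oside j x x₁) oroot ()
  outS-inj (oside j ne q) (oside .j ne' .q) refl = refl
  outS-inj {fun f ts} {there i p} (oside j ne q) (odown o') e = ⊥-elim-irr (ne (there-inj' e))
  outS-inj (odown o) oroot ()
  outS-inj {fun f ts} {there i p} (odown o) (oside j ne q) e = ⊥-elim-irr (ne (sym (there-inj' e)))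
  outS-inj {fun f ts} {there i p} (odown o) (odown o') e = cong odown (outS-inj o o' (there-inj e))

  chooseS : (s : Term) (p : Pos s) → Pos s → Out s p ⊎ Pos (subAt s p)
  chooseS s here q = inj₂ q
  chooseS (fun f ts) (there i p) here = inj₁ oroot
  chooseS (fun f ts) (there i p) (there j q) with j ≟ i
  ... | yes refl = smap odown (λ x → x) (chooseS (lookup ts i) p q)
  ... | no ne = inj₁ (oside j ne q)

  sectS : (s : Term) (p : Pos s) (q : Pos s) → [ outS , ext s p ] (chooseS s p q) ≡ q
  sectS s here q = refl
  sectS (fun f ts) (there i p) here = refl
  sectS (fun f ts) (there i p) (there j q) with j ≟ i
  ... | no ne = refl
  ... | yes refl with chooseS (lookup ts i) p q | sectS (lookup ts i) p q
  ...   | inj₁ o | e = cong (there i) e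
  ...   | inj₂ q' | e = cong (there i) e

  chooseS-out : ∀ {s p} (o : Out s p) → chooseS s p (outS o) ≡ inj₁ o
  chooseS-out oroot = refl
  chooseS-out {fun f ts} {there i p} (oside j ne q) with j ≟ i
  ... | yes refl = ⊥-elim-irr (ne refl)
  ... | no ne' = refl
  chooseS-out {fun f ts} {there i p} (odown o) with i ≟ i
  ... | no ne = ⊥-elim (ne refl)
  ... | yes refl rewrite chooseS-out o = refl

  chooseS-ext : (s : Term) (p : Pos s) (q : Pos (subAt s p)) → chooseS s p (ext s p q) ≡ inj₂ q
  chooseS-ext s here q = refl
  chooseS-ext (fun f ts) (there i p) q with i ≟ i
  ... | no ne = ⊥-elim (ne refl)
  ... | yes refl rewrite chooseS-ext (lookup ts i) p q = refl

  chooseT : (s : Term) (p : Pos s) (v : Term) → Pos (replace s p v) → Out s p ⊎ Pos v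
  chooseT s here v q = inj₂ q
  chooseT (fun f ts) (there i p) v here = inj₁ oroot
  chooseT (fun f ts) (there i p) v (there j q) with j ≟ i
  ... | yes refl = smap odown (λ x → x) (chooseT (lookup ts i) p v (updAt⁻ ts i q))
  ... | no ne = inj₁ (oside j ne (updNe⁻ ts i j ne q))

  sectT : (s : Term) (p : Pos s) (v : Term) (q : Pos (replace s p v)) → [ outR v , extT s p v ] (chooseT s p v q) ≡ q
  sectT s here v q = refl
  sectT (fun f ts) (there i p) v here = refl
  sectT (fun f ts) (there i p) v (there j q) with j ≟ i
  ... | no ne = cong (there j) (updNe-rt' ts i j ne q)
  ... | yes refl with chooseT (lookup ts i) p v (updAt⁻ ts i q) | sectT (lookup ts i) p v (updAt⁻ ts i q)
  ...   | inj₁ o | e = cong (there i) (trans (cong (updAt ts i) e) (updAt-rt' ts i q))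
  ...   | inj₂ q' | e = cong (there i) (trans (cong (updAt ts i) e) (updAt-rt' ts i q))

  chooseT-out : ∀ {s p} (v : Term) (o : Out s p) → chooseT s p v (outR v o) ≡ inj₁ o
  chooseT-out v oroot = refl
  chooseT-out {fun f ts} {there i p} v (oside j ne q) with j ≟ i
  ... | yes refl = ⊥-elim-irr (ne refl)
  ... | no ne' rewrite updNe-rt ts i j {replace (lookup ts i) p v} ne q = refl
  chooseT-out {fun f ts} {there i p} v (odown o) with i ≟ i
  ... | no ne = ⊥-elim (ne refl)
  ... | yes refl rewrite updAt-rt ts i (outR v o) | chooseT-out v o = refl

  chooseT-ext : (s : Term) (p : Pos s) (v : Term) (q : Pos v) → chooseT s p v (extT s p v q) ≡ inj₂ q
  chooseT-ext s here v q = refl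
  chooseT-ext (fun f ts) (there i p) v q with i ≟ i
  ... | no ne = ⊥-elim (ne refl)
  ... | yes refl rewrite updAt-rt ts i (extT (lookup ts i) p v q) | chooseT-ext (lookup ts i) p v q = refl

  sameOut : ∀ {s p} (v : Term) (o : Out s p) → SameHead (subAt s (outS o)) (subAt (replace s p v) (outR v o))
  sameOut v oroot = shf
  sameOut {fun f ts} {there i p} v (oside j ne q) rewrite subAt-updNe ts i j {replace (lookup ts i) p v} ne q = sh-refl _
  sameOut {fun f ts} {there i p} v (odown o) rewrite subAt-updAt ts i (outR v o) = sameOut v o

  subAt-extT : (s : Term) (p : Pos s) (v : Term) (q : Pos v) → subAt (replace s p v) (extT s p v q) ≡ subAt v q
  subAt-extT s here v q = refl
  subAt-extT (fun f ts) (there i p) v q = trans (subAt-updAt ts i (extT (lookup ts i) p v q)) (subAt-extT (lookup ts i) p v q)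

  child-extT : (s : Term) (p : Pos s) (v : Term) (q : Pos v) (j : Fin (arity (subAt v q)))
               (e : arity (subAt v q) ≡ arity (subAt (replace s p v) (extT s p v q)))
             → child (replace s p v) (extT s p v q) (castF e j) ≡ extT s p v (child v q j)
  child-extT s here v q j e rewrite uip e refl = refl
  child-extT (fun f ts) (there i p) v q j e =
    cong (there i) (trans (cong (child (lookup (ts [ i ]≔ replace (lookup ts i) p v) i) (updAt ts i (extT (lookup ts i) p v q)))
                                (trans (castF-irr e (trans e₁ e₂) j) (castF-trans e₁ e₂ j)))
                   (trans (child-updAt ts i (extT (lookup ts i) p v q) (castF e₁ j) e₂)
                          (cong (updAt ts i) (child-extT (lookup ts i) p v q j e₁))))
    where
    e₁ : arity (subAt v q) ≡ arity (subAt (replace (lookup ts i) p v) (extT (lookup ts i) p v q))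
    e₁ = cong arity (sym (subAt-extT (lookup ts i) p v q))
    e₂ : arity (subAt (replace (lookup ts i) p v) (extT (lookup ts i) p v q)) ≡ arity (subAt (lookup (ts [ i ]≔ replace (lookup ts i) p v) i) (updAt ts i (extT (lookup ts i) p v q)))
    e₂ = cong arity (sym (subAt-updAt ts i (extT (lookup ts i) p v q)))

  firstOut : (u : Term) (p : Pos u) → Maybe (Out u p)
  firstOut u here = nothing
  firstOut (fun g us) (there k p) = just oroot

  mapO : ∀ {f ts i} {p : Pos (lookup ts i)} → Maybe (Out (lookup ts i) p) → Maybe (Out (fun f ts) (there i p))
  mapO nothing = nothing
  mapO (just o) = just (odown o)

  outTgt : ∀ {s p} (o : Out s p) → Fin (arity (subAt s (outS o))) → Maybe (Out s p)
  outTgt {fun f ts} {there i p} oroot j with j ≟ i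
  ... | no ne = just (oside j ne here)
  ... | yes refl = mapO (firstOut (lookup ts i) p)
  outTgt {fun f ts} {there i p} (oside j ne q) k = just (oside j ne (child (lookup ts j) q k))
  outTgt {fun f ts} {there i p} (odown o) k = mapO (outTgt o k)

  ocS : ∀ {s} (p : Pos s) → Maybe (Out s p) → Pos s
  ocS p nothing = p
  ocS p (just o) = outS o

  ocR : ∀ {s} (p : Pos s) (v : Term) → Maybe (Out s p) → Pos (replace s p v)
  ocR {s} p v nothing = extT s p v here
  ocR p v (just o) = outR v o

  fo-S : (u : Term) (p : Pos u) → ocS p (firstOut u p) ≡ here
  fo-S u here = refl
  fo-S (fun g us) (there k p) = refl

  fo-R : (u : Term) (p : Pos u) (v : Term) → ocR p v (firstOut u p) ≡ here
  fo-R u here v = refl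
  fo-R (fun g us) (there k p) v = refl

  mapO-S : ∀ {f ts i} {p : Pos (lookup ts i)} (m : Maybe (Out (lookup ts i) p)) → _≡_ {A = Pos (fun f ts)} (there i (ocS p m)) (ocS (there i p) (mapO m))
  mapO-S nothing = refl
  mapO-S (just o) = refl

  mapO-R : ∀ {f ts i} {p : Pos (lookup ts i)} (v : Term) (m : Maybe (Out (lookup ts i) p)) → _≡_ {A = Pos (replace (fun f ts) (there i p) v)} (there i (updAt ts i (ocR p v m))) (ocR (there i p) v (mapO m))
  mapO-R v nothing = refl
  mapO-R v (just o') = refl

  outTgtS : ∀ {s p} (o : Out s p) (j : Fin (arity (subAt s (outS o)))) → child s (outS o) j ≡ ocS p (outTgt o j)
  outTgtS {fun f ts} {there i p} oroot j with j ≟ i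
  ... | no ne = refl
  ... | yes refl = trans (cong (there i) (sym (fo-S (lookup ts i) p))) (mapO-S (firstOut (lookup ts i) p))
  outTgtS {fun f ts} {there i p} (oside j ne q) k = refl
  outTgtS {fun f ts} {there i p} (odown o) k = trans (cong (there i) (outTgtS o k)) (mapO-S (outTgt o k))

  outTgtR : ∀ {s p} (v : Term) (o : Out s p) (j : Fin (arity (subAt s (outS o))))
            (e : arity (subAt s (outS o)) ≡ arity (subAt (replace s p v) (outR v o)))
          → child (replace s p v) (outR v o) (castF e j) ≡ ocR p v (outTgt o j)
  outTgtR {fun f ts} {there i p} v oroot j e rewrite uip e refl with j ≟ i
  ... | no ne = cong (there j) (sym (updNe-here ts i j ne))
  ... | yes refl = trans (cong (there i) (trans (sym (updAt-here ts i)) (cong (updAt ts i) (sym (fo-R (lookup ts i) p v)))))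
                         (mapO-R v (firstOut (lookup ts i) p))
  outTgtR {fun f ts} {there i p} v (oside j ne q) k e =
    cong (there j) (trans (cong (child (lookup (ts [ i ]≔ replace (lookup ts i) p v) j) (updNe ts i j ne q)) (castF-irr e e' k))
                          (child-updNe ts i j ne q k e'))
    where
    e' = cong arity (sym (subAt-updNe ts i j {replace (lookup ts i) p v} ne q))
  outTgtR {fun f ts} {there i p} v (odown o) k e =
    trans (cong (there i) (trans (cong (child (lookup (ts [ i ]≔ replace (lookup ts i) p v) i) (updAt ts i (outR v o))) (castF-split e e₁ e₂ k))
                   (trans (child-updAt ts i (outR v o) (castF e₁ k) e₂)
                          (cong (updAt ts i) (outTgtR v o k e₁)))))
          (mapO-R v (outTgt o k))
    where
    e₁ = sh-ar (sameOut v o)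
    e₂ = cong arity (sym (subAt-updAt ts i (outR v o)))

  holePos : (C : Ctx) (u : Term) → Pos (plug C u)
  holePos hole u = here
  holePos (node f i ts C) u = there i (updAt ts i (holePos C u))

  subAt-hole : (C : Ctx) (u : Term) → subAt (plug C u) (holePos C u) ≡ u
  subAt-hole hole u = refl
  subAt-hole (node f i ts C) u = trans (subAt-updAt ts i (holePos C u)) (subAt-hole C u)

  replace-updAt : ∀ {n} (ts : Vec Term n) (i : Fin n) {X : Term} (q : Pos X) (v : Term)
                → replace (lookup (ts [ i ]≔ X) i) (updAt ts i q) v ≡ replace X q v
  replace-updAt (t ∷ ts) fz q v = refl
  replace-updAt (t ∷ ts) (fs i) q v = replace-updAt ts i q v

  replace-hole : (C : Ctx) (u v : Term) → replace (plug C u) (holePos C u) v ≡ plug C v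
  replace-hole hole u v = refl
  replace-hole (node f i ts C) u v =
    cong (fun f) (trans (cong (λ z → (ts [ i ]≔ plug C u) [ i ]≔ z) (trans (replace-updAt ts i (holePos C u) v) (replace-hole C u v)))
                        ([]≔-idempotent ts i))

  ctxOf : (s : Term) → Pos s → Ctx
  ctxOf s here = hole
  ctxOf (fun f ts) (there i p) = node f i ts (ctxOf (lookup ts i) p)

  plug-ctxOf : (s : Term) (p : Pos s) (v : Term) → plug (ctxOf s p) v ≡ replace s p v
  plug-ctxOf s here v = refl
  plug-ctxOf (fun f ts) (there i p) v = cong (λ z → fun f (ts [ i ]≔ z)) (plug-ctxOf (lookup ts i) p v)

  replace-self : (s : Term) (p : Pos s) → replace s p (subAt s p) ≡ s
  replace-self s here = refl
  replace-self (fun f ts) (there i p) = cong (fun f) (trans (cong (ts [ i ]≔_) (replace-self (lookup ts i) p)) ([]≔-lookup ts i))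

module PositionMorphisms (Sg : Signature) where
  open WithSig Sg renaming (sym to ssym; subst to tsubst)
  open GraphMorphisms Sg
  open TermPositions Sg

  arCast : (u u' : Term) → (isVarT u ≡ false → SameHead u u') → Fin (arity u) → Fin (arity u')
  arCast (var x) u' h ()
  arCast (fun f ts) u' h j = castF (sh-ar (h refl)) j

  toℕ-arCast : (u u' : Term) (h : isVarT u ≡ false → SameHead u u') (j : Fin (arity u)) → toℕ (arCast u u' h j) ≡ toℕ j
  toℕ-arCast (var x) u' h ()
  toℕ-arCast (fun f ts) u' h j = toℕ-castF _ j

  fin-var : (u : Term) → isVarT u ≡ true → Fin (arity u) → ⊥
  fin-var (var x) _ ()

  arCast-nv : (u u' : Term) (h : isVarT u ≡ false → SameHead u u') (nv : isVarT u ≡ false) (j : Fin (arity u))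
            → arCast u u' h j ≡ castF (sh-ar (h nv)) j
  arCast-nv (fun f ts) u' h refl j = refl

  module PositionHom (a b : Term) (f : Pos a → Pos b)
            (sh : ∀ q → isVarT (subAt a q) ≡ false → SameHead (subAt a q) (subAt b (f q)))
            (lab : ∀ q → headLab (subAt a q) ≤L headLab (subAt b (f q)))
            (ch : ∀ q j e → child b (f q) (castF e j) ≡ f (child a q j)) where
    edgeMap : EdgeT a → EdgeT b
    edgeMap (q , j) = f q , arCast (subAt a q) (subAt b (f q)) (sh q) j

    edgeMap-tgt : ∀ q j → f (child a q j) ≡ child b (f q) (arCast (subAt a q) (subAt b (f q)) (sh q) j)
    edgeMap-tgt q j with isVarT (subAt a q) in nvq
    ... | true = ⊥-elim (fin-var _ nvq j)
    ... | false = sym (trans (cong (child b (f q)) (arCast-nv (subAt a q) _ (sh q) nvq j)) (ch q j _))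

    hom : Hom (enc a) (enc b)
    hom = record { fV = f ; fE = edgeMap ; src-c = λ _ → refl ; tgt-c = λ e → edgeMap-tgt (proj₁ e) (proj₂ e)
                 ; lv-c = lab
                 ; le-c = λ e → ≡⇒≤L (cong num (sym (toℕ-arCast (subAt a (proj₁ e)) _ (sh (proj₁ e)) (proj₂ e)))) }

  subtermH : (t : Term) (p : Pos t) → Hom (enc (subAt t p)) (enc t)
  subtermH t p = PositionHom.hom (subAt t p) t (ext t p)
               (λ q _ → subst (SameHead (subAt (subAt t p) q)) (sym (subAt-ext t p q)) (sh-refl _))
               (λ q → ≡⇒≤L (cong headLab (sym (subAt-ext t p q))))
               (λ q j e → child-ext t p q j e)

  castH : ∀ {t t'} → t ≡ t' → Hom (enc t) (enc t')
  castH e = PositionHom.hom _ _ (castP e)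
               (λ q _ → subst (SameHead _) (sym (subAt-castP e q)) (sh-refl _))
               (λ q → ≡⇒≤L (cong headLab (sym (subAt-castP e q))))
               (λ q j e' → child-castP e q j e')

  module Instantiation (σ : ℕ → Term) where

    lookup-substs : ∀ {n} (ls : Vec Term n) (i : Fin n) → lookup (substs σ ls) i ≡ tsubst σ (lookup ls i)
    lookup-substs (l ∷ ls) fz = refl
    lookup-substs (l ∷ ls) (fs i) = lookup-substs ls i

    lpos : (l : Term) → Pos l → Pos (tsubst σ l)
    lpos (var x) here = here
    lpos (fun f ls) here = here
    lpos (fun f ls) (there i w) = there i (castP (sym (lookup-substs ls i)) (lpos (lookup ls i) w))

    varpos : ∀ {x} {l : Term} → x ∈V l → Pos (σ x) → Pos (tsubst σ l)
    varpos here q = q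
    varpos (there {f} {ls} i pf) q = there i (castP (sym (lookup-substs ls i)) (varpos pf q))

    lpos-here : (l : Term) → lpos l here ≡ here
    lpos-here (var x) = refl
    lpos-here (fun f ls) = refl

    lpos-varPos : ∀ {x} {l : Term} (pf : x ∈V l) → lpos l (varPos pf) ≡ varpos pf here
    lpos-varPos here = refl
    lpos-varPos (there {f} {ls} i pf) = cong (λ z → there i (castP (sym (lookup-substs ls i)) z)) (lpos-varPos pf)

    subAt-lpos : (l : Term) (w : Pos l) → subAt (tsubst σ l) (lpos l w) ≡ tsubst σ (subAt l w)
    subAt-lpos (var x) here = refl
    subAt-lpos (fun f ls) here = refl
    subAt-lpos (fun f ls) (there i w) = trans (subAt-castP (sym (lookup-substs ls i)) (lpos (lookup ls i) w)) (subAt-lpos (lookup ls i) w)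

    subAt-varpos : ∀ {x} {l : Term} (pf : x ∈V l) (q : Pos (σ x)) → subAt (tsubst σ l) (varpos pf q) ≡ subAt (σ x) q
    subAt-varpos here q = refl
    subAt-varpos (there {f} {ls} i pf) q = trans (subAt-castP (sym (lookup-substs ls i)) (varpos pf q)) (subAt-varpos pf q)

    sh-subst : (u : Term) → isVarT u ≡ false → SameHead u (tsubst σ u)
    sh-subst (fun f ts) _ = shf

    lab-subst : (u : Term) → headLab u ≤L headLab (tsubst σ u)
    lab-subst (var x) = bot≤
    lab-subst (fun f ts) = refl≤

    child-lpos : (l : Term) (w : Pos l) (j : Fin (arity (subAt l w))) (e : arity (subAt l w) ≡ arity (subAt (tsubst σ l) (lpos l w)))
               → child (tsubst σ l) (lpos l w) (castF e j) ≡ lpos l (child l w j)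
    child-lpos (var x) here () e
    child-lpos (fun f ls) here j e rewrite uip e refl =
      cong (there j) (sym (trans (cong (castP (sym (lookup-substs ls j))) (lpos-here (lookup ls j))) (castP-here (sym (lookup-substs ls j)))))
    child-lpos (fun f ls) (there i w) j e =
      cong (there i) (trans (cong (child (lookup (substs σ ls) i) (castP (sym (lookup-substs ls i)) (lpos (lookup ls i) w))) (castF-split e e₁ e₂ j))
                     (trans (child-castP (sym (lookup-substs ls i)) (lpos (lookup ls i) w) (castF e₁ j) e₂)
                            (cong (castP (sym (lookup-substs ls i))) (child-lpos (lookup ls i) w j e₁))))
      where
      e₁ = trans e (cong arity (subAt-castP (sym (lookup-substs ls i)) (lpos (lookup ls i) w)))
      e₂ = cong arity (sym (subAt-castP (sym (lookup-substs ls i)) (lpos (lookup ls i) w)))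

    child-varpos : ∀ {x} {l : Term} (pf : x ∈V l) (q : Pos (σ x)) (j : Fin (arity (subAt (σ x) q)))
                   (e : arity (subAt (σ x) q) ≡ arity (subAt (tsubst σ l) (varpos pf q)))
                 → child (tsubst σ l) (varpos pf q) (castF e j) ≡ varpos pf (child (σ x) q j)
    child-varpos here q j e rewrite uip e refl = refl
    child-varpos (there {f} {ls} i pf) q j e =
      cong (there i) (trans (cong (child (lookup (substs σ ls) i) (castP (sym (lookup-substs ls i)) (varpos pf q))) (castF-split e e₁ e₂ j))
                     (trans (child-castP (sym (lookup-substs ls i)) (varpos pf q) (castF e₁ j) e₂)
                            (cong (castP (sym (lookup-substs ls i))) (child-varpos pf q j e₁))))
      where
      e₁ = trans e (cong arity (subAt-castP (sym (lookup-substs ls i)) (varpos pf q)))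
      e₂ = cong arity (sym (subAt-castP (sym (lookup-substs ls i)) (varpos pf q)))

    lposH : (l : Term) → Hom (enc l) (enc (tsubst σ l))
    lposH l = PositionHom.hom l (tsubst σ l) (lpos l)
                (λ w nv → subst (SameHead (subAt l w)) (sym (subAt-lpos l w)) (sh-subst _ nv))
                (λ w → subst (λ z → headLab (subAt l w) ≤L headLab z) (sym (subAt-lpos l w)) (lab-subst _))
                (λ w j e → child-lpos l w j e)

    VarOcc : Term → Set
    VarOcc l = Σ ℕ λ x → Σ (x ∈V l) λ _ → Pos (σ x)

    NVPos : Term → Set
    NVPos l = Σ (Pos l) λ w → isVarPos l w ≡ false

    chooseI' : (l u : Term) → u ≡ tsubst σ l → Pos u → NVPos l ⊎ VarOcc l
    chooseI' (var x) u e q = inj₂ (x , here , castP e q)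
    chooseI' (fun f ls) .(fun f (substs σ ls)) refl here = inj₁ (here , refl)
    chooseI' (fun f ls) .(fun f (substs σ ls)) refl (there i q) =
      smap (λ z → there i (proj₁ z) , proj₂ z) (λ z → proj₁ z , there i (proj₁ (proj₂ z)) , proj₂ (proj₂ z))
           (chooseI' (lookup ls i) (lookup (substs σ ls) i) (lookup-substs ls i) q)

    chooseI : (l : Term) → Pos (tsubst σ l) → NVPos l ⊎ VarOcc l
    chooseI l q = chooseI' l (tsubst σ l) refl q

    chooseI'-cast : (l u : Term) (e : u ≡ tsubst σ l) (q : Pos (tsubst σ l)) → chooseI' l u e (castP (sym e) q) ≡ chooseI l q
    chooseI'-cast l u refl q = refl

    embI : (l : Term) → NVPos l ⊎ VarOcc l → Pos (tsubst σ l)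
    embI l (inj₁ (w , _)) = lpos l w
    embI l (inj₂ (x , pf , q)) = varpos pf q

    sectI' : (l u : Term) (e : u ≡ tsubst σ l) (q : Pos u) → embI l (chooseI' l u e q) ≡ castP e q
    sectI' (var x) u e q = refl
    sectI' (fun f ls) .(fun f (substs σ ls)) refl here = refl
    sectI' (fun f ls) .(fun f (substs σ ls)) refl (there i q)
      with chooseI' (lookup ls i) (lookup (substs σ ls) i) (lookup-substs ls i) q | sectI' (lookup ls i) (lookup (substs σ ls) i) (lookup-substs ls i) q
    ... | inj₁ (w , nv) | e = cong (there i) (trans (cong (castP (sym (lookup-substs ls i))) e) (castP-inv (lookup-substs ls i) q))
    ... | inj₂ (x , pf , q') | e = cong (there i) (trans (cong (castP (sym (lookup-substs ls i))) e) (castP-inv (lookup-substs ls i) q))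

    sectI : (l : Term) (q : Pos (tsubst σ l)) → embI l (chooseI l q) ≡ q
    sectI l q = sectI' l (tsubst σ l) refl q

    chooseI-lpos : (l : Term) (w : Pos l) (nv : isVarPos l w ≡ false) → chooseI l (lpos l w) ≡ inj₁ (w , nv)
    chooseI-lpos (var x) here ()
    chooseI-lpos (fun f ls) here refl = refl
    chooseI-lpos (fun f ls) (there i w) nv
      rewrite chooseI'-cast (lookup ls i) (lookup (substs σ ls) i) (lookup-substs ls i) (lpos (lookup ls i) w) | chooseI-lpos (lookup ls i) w nv = refl

    chooseI-varpos : ∀ {x} (l : Term) (pf : x ∈V l) (q : Pos (σ x)) → chooseI l (varpos pf q) ≡ inj₂ (x , pf , q)
    chooseI-varpos (var x) here q = refl
    chooseI-varpos (fun f ls) (there i pf) q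
      rewrite chooseI'-cast (lookup ls i) (lookup (substs σ ls) i) (lookup-substs ls i) (varpos pf q) | chooseI-varpos (lookup ls i) pf q = refl

module CanonicalStep (Sg : Signature) where
  open WithSig Sg renaming (sym to ssym; subst to tsubst)
  open GraphMorphisms Sg
  open TermPositions Sg
  open Replacement Sg
  open PositionMorphisms Sg

  isHere : ∀ {u} → Pos u → Bool
  isHere here = true
  isHere (there _ _) = false

  isHere-child : (u : Term) (q : Pos u) (j : Fin (arity (subAt u q))) → isHere (child u q j) ≡ false
  isHere-child (var x) here ()
  isHere-child (fun f ts) here j = refl
  isHere-child (fun f ts) (there i q) j = refl

  posOcc : (l : Term) (w : Pos l) → isVarPos l w ≡ true → Σ ℕ λ x → Σ (x ∈V l) λ pf → varPos pf ≡ w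
  posOcc (var x) here e = x , here , refl
  posOcc (fun f ls) here ()
  posOcc (fun f ls) (there i w) e with posOcc (lookup ls i) w e
  ... | x , pf , eq = x , there i pf , cong (there i) eq

  varPos-inj : ∀ {l : Term} {x y} (pf₁ : x ∈V l) (pf₂ : y ∈V l) → varPos pf₁ ≡ varPos pf₂ → _≡_ {A = Σ ℕ λ z → z ∈V l} (x , pf₁) (y , pf₂)
  varPos-inj here here e = refl
  varPos-inj (there i pf₁) (there j pf₂) e with there-inj' e
  ... | refl with varPos-inj pf₁ pf₂ (there-inj e)
  ...   | refl = refl

  Σinj : ∀ {l : Term} {x} {pf pf' : x ∈V l} → _≡_ {A = Σ ℕ λ z → z ∈V l} (x , pf) (x , pf') → pf ≡ pf'
  Σinj refl = refl

  castF-inv : ∀ {m n} (e : m ≡ n) (j : Fin n) → castF e (castF (sym e) j) ≡ j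
  castF-inv refl j = refl

  record Redex : Set where
    field
      ρ : Rule
      lhs-linear : Linear (lhs ρ)
      rhs-linear : Linear (rhs ρ)
      σ : ℕ → Term
      s : Term
      p : Pos s
      s∣p≡lσ : subAt s p ≡ tsubst σ (lhs ρ)

  module CanonicalMatch (X : Redex) where
    open Redex X public
    open Instantiation σ public

    l r v t : Term
    l = lhs ρ
    r = rhs ρ
    v = tsubst σ r
    t = replace s p v

    L' : Graph
    L' = closure (enc l) here (isVarPos l)
    K' : Graph
    K' = closure (IG r) nothing isVarK
    l' : Hom K' L'
    l' = PBPORule.l' (encRule ρ)

    lhs-nonvar : isVarT l ≡ false
    lhs-nonvar with l | lhs-nv ρ
    ... | var x | h = ⊥-elim (h x refl)
    ... | fun f ls | h = refl

    redexPos : Pos (tsubst σ l) → Pos s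
    redexPos q = ext s p (castP (sym s∣p≡lσ) q)

    m₀ : Hom (enc l) (enc s)
    m₀ = subtermH s p ∘H (castH (sym s∣p≡lσ) ∘H lposH l)

    substPos : ∀ {x} → x ∈V l → Pos (σ x) → Pos s
    substPos pf q = redexPos (varpos pf q)

    -- α₀ sends positions outside the redex to the context vertex 𝒞, a position of lσ at a function
    -- symbol of l to that position of l, the root of an instance σ x to the vertex x, and every
    -- position strictly inside σ x to its primed copy x'.
    αInstV : NVPos l ⊎ VarOcc l → CV (enc l) (isVarPos l)
    αInstV (inj₁ (w , _)) = old w
    αInstV (inj₂ (x , pf , q)) = if isHere q then old (varPos pf) else prime (varPos pf , isVarPos-varPos pf)

    αRedexV : Pos (tsubst σ l) → CV (enc l) (isVarPos l)
    αRedexV q = αInstV (chooseI l q)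

    αSplitV : Out s p ⊎ Pos (subAt s p) → CV (enc l) (isVarPos l)
    αSplitV (inj₁ o) = cnode
    αSplitV (inj₂ q') = αRedexV (castP s∣p≡lσ q')

    α₀V : Pos s → CV (enc l) (isVarPos l)
    α₀V q = αSplitV (chooseS s p q)

    αInstE : (z : NVPos l ⊎ VarOcc l) (q : Pos (tsubst σ l)) → embI l z ≡ q → Fin (arity (subAt (tsubst σ l) q)) → CE (enc l) (isVarPos l)
    αInstE (inj₁ (w , nv)) q e j = oldE (w , castF (trans (cong (λ z → arity (subAt (tsubst σ l) z)) (sym e))
                                                  (trans (cong arity (subAt-lpos l w)) (sym (sh-ar (sh-subst _ nv))))) j)
    αInstE (inj₂ (x , pf , q')) q e j = if isHere q' then toPrm (varPos pf , isVarPos-varPos pf) else loopP (varPos pf , isVarPos-varPos pf)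

    αRedexE : (q : Pos (tsubst σ l)) → Fin (arity (subAt (tsubst σ l) q)) → CE (enc l) (isVarPos l)
    αRedexE q j = αInstE (chooseI l q) q (sectI l q) j

    L'-contextE : Maybe (Out s p) → CE (enc l) (isVarPos l)
    L'-contextE nothing = toRoot
    L'-contextE (just _) = loopC

    αSplitE : (z : Out s p ⊎ Pos (subAt s p)) (q : Pos s) → [ outS , ext s p ] z ≡ q → Fin (arity (subAt s q)) → CE (enc l) (isVarPos l)
    αSplitE (inj₁ o) q e j = L'-contextE (outTgt o (castF (cong (λ z → arity (subAt s z)) (sym e)) j))
    αSplitE (inj₂ q') q e j = αRedexE (castP s∣p≡lσ q') (castF (trans (cong (λ z → arity (subAt s z)) (sym e))
                                                       (trans (cong arity (subAt-ext s p q')) (cong arity (sym (subAt-castP s∣p≡lσ q'))))) j)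

    α₀E : EdgeT s → CE (enc l) (isVarPos l)
    α₀E (q , j) = αSplitE (chooseS s p q) q (sectS s p q) j

    α₀V-out : (o : Out s p) → α₀V (outS o) ≡ cnode
    α₀V-out o rewrite chooseS-out o = refl

    α₀V-ext : (q' : Pos (subAt s p)) → α₀V (ext s p q') ≡ αRedexV (castP s∣p≡lσ q')
    α₀V-ext q' rewrite chooseS-ext s p q' = refl

    αRedexV-lpos : (w : Pos l) → αRedexV (lpos l w) ≡ old w
    αRedexV-lpos w with isVarPos l w in nvw
    ... | false rewrite chooseI-lpos l w nvw = refl
    ... | true with posOcc l w nvw
    ...   | x , pf , refl rewrite lpos-varPos pf | chooseI-varpos l pf here = refl

    αRedexV-varpos : ∀ {x} (pf : x ∈V l) (q : Pos (σ x)) → αRedexV (varpos pf q) ≡ αInstV (inj₂ (x , pf , q))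
    αRedexV-varpos pf q rewrite chooseI-varpos l pf q = refl

    α₀V-p : α₀V p ≡ old here
    α₀V-p = trans (cong α₀V (sym (ext-here s p)))
                  (trans (α₀V-ext here) (trans (cong αRedexV (trans (castP-here s∣p≡lσ) (sym (lpos-here l)))) (αRedexV-lpos here)))

    L'-contextE-src : (m : Maybe (Out s p)) → src L' (L'-contextE m) ≡ cnode
    L'-contextE-src nothing = refl
    L'-contextE-src (just _) = refl

    αInstE-src : (z : NVPos l ⊎ VarOcc l) (q : Pos (tsubst σ l)) (e : embI l z ≡ q) (j : Fin (arity (subAt (tsubst σ l) q)))
          → αInstV z ≡ src L' (αInstE z q e j)
    αInstE-src (inj₁ (w , nv)) q e j = refl
    αInstE-src (inj₂ (x , pf , q')) q e j with isHere q'
    ... | true = refl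
    ... | false = refl

    α₀-src : (z : Out s p ⊎ Pos (subAt s p)) (q : Pos s) (e : [ outS , ext s p ] z ≡ q) (j : Fin (arity (subAt s q)))
         → αSplitV z ≡ src L' (αSplitE z q e j)
    α₀-src (inj₁ o) q e j = sym (L'-contextE-src _)
    α₀-src (inj₂ q') q e j = αInstE-src (chooseI l (castP s∣p≡lσ q')) (castP s∣p≡lσ q') (sectI l (castP s∣p≡lσ q')) _

    α₀-context-tgt : (m : Maybe (Out s p)) → α₀V (ocS p m) ≡ tgt L' (L'-contextE m)
    α₀-context-tgt nothing = α₀V-p
    α₀-context-tgt (just o) = α₀V-out o

    αInstE-tgt : (z : NVPos l ⊎ VarOcc l) (q : Pos (tsubst σ l)) (e : embI l z ≡ q) (j : Fin (arity (subAt (tsubst σ l) q)))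
          → αRedexV (child (tsubst σ l) q j) ≡ tgt L' (αInstE z q e j)
    αInstE-tgt (inj₁ (w , nv)) .(lpos l w) refl j =
      trans (cong αRedexV (trans (cong (child (tsubst σ l) (lpos l w)) (sym (castF-inv e₃ j))) (child-lpos l w (castF (sym e₃) j) e₃)))
            (trans (αRedexV-lpos _) (cong (λ k → old (child l w k)) (toℕ-injective (trans (toℕ-castF (sym e₃) j) (sym (toℕ-castF _ j))))))
      where
      e₃ : arity (subAt l w) ≡ arity (subAt (tsubst σ l) (lpos l w))
      e₃ = trans (sh-ar (sh-subst _ nv)) (cong arity (sym (subAt-lpos l w)))
    αInstE-tgt (inj₂ (x , pf , q')) .(varpos pf q') refl j =
      trans (cong αRedexV (trans (cong (child (tsubst σ l) (varpos pf q')) (sym (castF-inv e₃ j))) (child-varpos pf q' (castF (sym e₃) j) e₃)))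
            (trans (αRedexV-varpos pf _) (lem (isHere q')))
      where
      e₃ : arity (subAt (σ x) q') ≡ arity (subAt (tsubst σ l) (varpos pf q'))
      e₃ = cong arity (sym (subAt-varpos pf q'))
      lem : ∀ b → αInstV (inj₂ (x , pf , child (σ x) q' (castF (sym e₃) j))) ≡ tgt L' (if b then toPrm (varPos pf , isVarPos-varPos pf) else loopP (varPos pf , isVarPos-varPos pf))
      lem b rewrite isHere-child (σ x) q' (castF (sym e₃) j) with b
      ... | true = refl
      ... | false = refl

    α₀-tgt : (z : Out s p ⊎ Pos (subAt s p)) (q : Pos s) (e : [ outS , ext s p ] z ≡ q) (j : Fin (arity (subAt s q)))
         → α₀V (child s q j) ≡ tgt L' (αSplitE z q e j)
    α₀-tgt (inj₁ o) .(outS o) refl j = trans (cong α₀V (outTgtS o j)) (α₀-context-tgt (outTgt o j))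
    α₀-tgt (inj₂ q') .(ext s p q') refl j =
      trans (cong α₀V (trans (cong (child s (ext s p q')) (sym (castF-inv e₁ j))) (child-ext s p q' (castF (sym e₁) j) e₁)))
      (trans (α₀V-ext _)
      (trans (cong αRedexV (sym (child-castP s∣p≡lσ q' (castF (sym e₁) j) e₂)))
      (trans (αInstE-tgt (chooseI l (castP s∣p≡lσ q')) (castP s∣p≡lσ q') (sectI l (castP s∣p≡lσ q')) (castF e₂ (castF (sym e₁) j)))
             (cong (λ k → tgt L' (αRedexE (castP s∣p≡lσ q') k)) (toℕ-injective (trans (toℕ-castF e₂ _) (trans (toℕ-castF (sym e₁) j) (sym (toℕ-castF _ j)))))))))
      where
      e₁ : arity (subAt (subAt s p) q') ≡ arity (subAt s (ext s p q'))
      e₁ = cong arity (sym (subAt-ext s p q'))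
      e₂ : arity (subAt (subAt s p) q') ≡ arity (subAt (tsubst σ l) (castP s∣p≡lσ q'))
      e₂ = cong arity (sym (subAt-castP s∣p≡lσ q'))

    αInstV-lab : (z : NVPos l ⊎ VarOcc l) (q : Pos (tsubst σ l)) → embI l z ≡ q → headLab (subAt (tsubst σ l) q) ≤L lv L' (αInstV z)
    αInstV-lab (inj₁ (w , nv)) .(lpos l w) refl rewrite nv | subAt-lpos l w = ≡⇒≤L (sym (sh-lab (sh-subst _ nv)))
    αInstV-lab (inj₂ (x , pf , q')) q e with isHere q'
    ... | true rewrite isVarPos-varPos pf = ≤top
    ... | false = ≤top

    α₀-lv : (z : Out s p ⊎ Pos (subAt s p)) (q : Pos s) (e : [ outS , ext s p ] z ≡ q) → headLab (subAt s q) ≤L lv L' (αSplitV z)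
    α₀-lv (inj₁ o) q e = ≤top
    α₀-lv (inj₂ q') .(ext s p q') refl rewrite subAt-ext s p q' | sym (subAt-castP s∣p≡lσ q') =
      αInstV-lab (chooseI l (castP s∣p≡lσ q')) (castP s∣p≡lσ q') (sectI l (castP s∣p≡lσ q'))

    L'-contextE-lab : (m : Maybe (Out s p)) {x : Lab} → x ≤L le L' (L'-contextE m)
    L'-contextE-lab nothing = ≤top
    L'-contextE-lab (just _) = ≤top

    αInstE-lab : (z : NVPos l ⊎ VarOcc l) (q : Pos (tsubst σ l)) (e : embI l z ≡ q) (j : Fin (arity (subAt (tsubst σ l) q)))
         → num (toℕ j) ≤L le L' (αInstE z q e j)
    αInstE-lab (inj₁ (w , nv)) q e j = ≡⇒≤L (cong num (sym (toℕ-castF _ j)))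
    αInstE-lab (inj₂ (x , pf , q')) q e j with isHere q'
    ... | true = ≤top
    ... | false = ≤top

    α₀-le : (z : Out s p ⊎ Pos (subAt s p)) (q : Pos s) (e : [ outS , ext s p ] z ≡ q) (j : Fin (arity (subAt s q)))
        → num (toℕ j) ≤L le L' (αSplitE z q e j)
    α₀-le (inj₁ o) q e j = L'-contextE-lab (outTgt o (castF (cong (λ z → arity (subAt s z)) (sym e)) j))
    α₀-le (inj₂ q') q e j = subst (λ n → num n ≤L le L' (αSplitE (inj₂ q') q e j)) (toℕ-castF _ j)
                            (αInstE-lab (chooseI l (castP s∣p≡lσ q')) (castP s∣p≡lσ q') (sectI l (castP s∣p≡lσ q')) _)

    α₀ : Hom (enc s) L'
    α₀ = record
      { fV = α₀V ; fE = α₀E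
      ; src-c = λ e → α₀-src (chooseS s p (proj₁ e)) (proj₁ e) (sectS s p (proj₁ e)) (proj₂ e)
      ; tgt-c = λ e → α₀-tgt (chooseS s p (proj₁ e)) (proj₁ e) (sectS s p (proj₁ e)) (proj₂ e)
      ; lv-c = λ q → α₀-lv (chooseS s p q) q (sectS s p q)
      ; le-c = λ e → α₀-le (chooseS s p (proj₁ e)) (proj₁ e) (sectS s p (proj₁ e)) (proj₂ e) }

    tL : Hom (enc l) L'
    tL = PBPORule.tL (encRule ρ)

    isHere-true : ∀ {u} (q : Pos u) → isHere q ≡ true → q ≡ here
    isHere-true here _ = refl
    isHere-true (there _ _) ()

    ifOld : ∀ (b : Bool) {A : Pos l} {B : VarV (enc l) (isVarPos l)} {w : Pos l} → _≡_ {A = CV (enc l) (isVarPos l)} (if b then old A else prime B) (old w) → (b ≡ true) × (A ≡ w)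
    ifOld true refl = refl , refl
    ifOld false ()

    ifPrime : ∀ (b : Bool) {A : Pos l} {B w : VarV (enc l) (isVarPos l)} → _≡_ {A = CV (enc l) (isVarPos l)} (if b then old A else prime B) (prime w) → (b ≡ false) × (B ≡ w)
    ifPrime true ()
    ifPrime false refl = refl , refl

    homE₁ : ∀ {a b : Term} (h : Hom (enc a) (enc b)) (e : EdgeT a) → proj₁ (fE h e) ≡ fV h (proj₁ e)
    homE₁ h e = sym (src-c h e)

    homE₂ : ∀ {a b : Term} (h : Hom (enc a) (enc b)) (e : EdgeT a) → toℕ (proj₂ (fE h e)) ≡ toℕ (proj₂ e)
    homE₂ h e = sym (≤num (le-c h e))

    α₀-m₀V : (w : Pos l) → α₀V (fV m₀ w) ≡ old w
    α₀-m₀V w = trans (α₀V-ext _) (trans (cong αRedexV (castP-inv' s∣p≡lσ (lpos l w))) (αRedexV-lpos w))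

    αSplitE-inside : (q' : Pos (subAt s p)) (z : Out s p ⊎ Pos (subAt s p)) (e : [ outS , ext s p ] z ≡ ext s p q')
              (j : Fin (arity (subAt s (ext s p q')))) (k : Fin (arity (subAt (tsubst σ l) (castP s∣p≡lσ q'))))
            → toℕ k ≡ toℕ j → z ≡ inj₂ q' → αSplitE z (ext s p q') e j ≡ αRedexE (castP s∣p≡lσ q') k
    αSplitE-inside q' .(inj₂ q') e j k tk refl = cong (αRedexE (castP s∣p≡lσ q')) (toℕ-injective (trans (toℕ-castF _ j) (sym tk)))

    αInstE-lpos : (w : Pos l) (nv : isVarPos l w ≡ false) (z : NVPos l ⊎ VarOcc l) (e : embI l z ≡ lpos l w)
               (k : Fin (arity (subAt (tsubst σ l) (lpos l w)))) (k' : Fin (arity (subAt l w)))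
             → toℕ k' ≡ toℕ k → z ≡ inj₁ (w , nv) → αInstE z (lpos l w) e k ≡ oldE (w , k')
    αInstE-lpos w nv .(inj₁ (w , nv)) e k k' tk refl = cong (λ j → oldE (w , j)) (toℕ-injective (trans (toℕ-castF _ k) (sym tk)))

    αRedexE-cong : ∀ {q₁ q₂ : Pos (tsubst σ l)} (e : q₁ ≡ q₂) (k₁ : Fin (arity (subAt (tsubst σ l) q₁))) (k₂ : Fin (arity (subAt (tsubst σ l) q₂)))
               → toℕ k₁ ≡ toℕ k₂ → αRedexE q₁ k₁ ≡ αRedexE q₂ k₂
    αRedexE-cong refl k₁ k₂ tk = cong (αRedexE _) (toℕ-injective tk)

    α₀-m₀E : (e : EdgeT l) → α₀E (fE m₀ e) ≡ oldE e
    α₀-m₀E (w , j) with isVarPos l w in nvw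
    ... | true = ⊥-elim (fin-var (subAt l w) nvw j)
    ... | false =
      trans (αSplitE-inside q' (chooseS s p (ext s p q')) (sectS s p (ext s p q')) j' k tk (chooseS-ext s p q'))
            (trans (αRedexE-cong (castP-inv' s∣p≡lσ (lpos l w)) k kk (sym (toℕ-castF ekk k)))
                   (αInstE-lpos w nvw (chooseI l (lpos l w)) (sectI l (lpos l w)) kk j (sym (trans (toℕ-castF ekk k) (trans tk (homE₂ m₀ (w , j))))) (chooseI-lpos l w nvw)))
      where
      q' = castP (sym s∣p≡lσ) (lpos l w)
      j' = proj₂ (fE m₀ (w , j))
      k : Fin (arity (subAt (tsubst σ l) (castP s∣p≡lσ q')))
      k = castF (cong arity (trans (subAt-ext s p q') (sym (subAt-castP s∣p≡lσ q')))) j'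
      tk : toℕ k ≡ toℕ j'
      tk = toℕ-castF _ j'
      kk : Fin (arity (subAt (tsubst σ l) (lpos l w)))
      ekk : arity (subAt (tsubst σ l) (castP s∣p≡lσ q')) ≡ arity (subAt (tsubst σ l) (lpos l w))
      ekk = cong (λ z → arity (subAt (tsubst σ l) z)) (castP-inv' s∣p≡lσ (lpos l w))
      kk = castF ekk k

    αInstV-old : (z : NVPos l ⊎ VarOcc l) (q : Pos (tsubst σ l)) → embI l z ≡ q → ∀ w → αInstV z ≡ old w → lpos l w ≡ q
    αInstV-old (inj₁ (w' , nv)) q e w refl = e
    αInstV-old (inj₂ (x , pf , q')) q e w h =
      trans (cong (lpos l) (sym (proj₂ io))) (trans (lpos-varPos pf) (trans (cong (varpos pf) (sym (isHere-true q' (proj₁ io)))) e))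
      where
      io = ifOld (isHere q') {varPos pf} {varPos pf , isVarPos-varPos pf} h

    α₀-old⇒m₀ : (q : Pos s) (w : Pos l) → α₀V q ≡ old w → fV m₀ w ≡ q
    α₀-old⇒m₀ q w h = go (chooseS s p q) q (sectS s p q) h
      where
      go : (z : Out s p ⊎ Pos (subAt s p)) (q : Pos s) → [ outS , ext s p ] z ≡ q → αSplitV z ≡ old w → fV m₀ w ≡ q
      go (inj₁ o) q e ()
      go (inj₂ q') q e h' = trans (cong (λ z → ext s p (castP (sym s∣p≡lσ) z))
                                          (αInstV-old (chooseI l (castP s∣p≡lσ q')) (castP s∣p≡lσ q') (sectI l (castP s∣p≡lσ q')) w h'))
                                  (trans (cong (ext s p) (castP-inv s∣p≡lσ q')) e)

    oldE-inj : ∀ {e e' : EdgeT l} → _≡_ {A = CE (enc l) (isVarPos l)} (oldE e) (oldE e') → e ≡ e'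
    oldE-inj refl = refl

    old-inj : ∀ {w w' : Pos l} → _≡_ {A = CV (enc l) (isVarPos l)} (old w) (old w') → w ≡ w'
    old-inj refl = refl

    oldE⇒m₀ : (β : Hom (enc s) L') → (∀ q w → fV β q ≡ old w → fV m₀ w ≡ q)
          → ∀ (b : EdgeT s) (a : EdgeT l) → fE β b ≡ oldE a → fE m₀ a ≡ b
    oldE⇒m₀ β hb (q , j) (w , k) h =
      edgeEq s (trans (homE₁ m₀ (w , k)) (hb q w (trans (src-c β (q , j)) (cong (src L') h))))
               (trans (homE₂ m₀ (w , k)) (sym (≤num (subst (λ z → num (toℕ j) ≤L le L' z) h (le-c β (q , j))))))

    m₀-mono : Mono m₀
    m₀-mono = injective⇒mono m₀ (λ a a' e → old-inj (trans (sym (α₀-m₀V a)) (trans (cong α₀V e) (α₀-m₀V a'))))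
                       (λ a a' e → oldE-inj (trans (sym (α₀-m₀E a)) (trans (cong α₀E e) (α₀-m₀E a'))))

    L-pullback : IsPullback tL α₀ (enc l) idH m₀
    L-pullback = ExplicitPullback.isPullback tL α₀ (enc l) idH m₀ com
            (λ a b e → a) (λ a b e → refl) (λ a b e → α₀-old⇒m₀ b a (sym e)) (λ x → refl)
            (λ a b e → a) (λ a b e → refl) (λ a b e → oldE⇒m₀ α₀ α₀-old⇒m₀ b a (sym e)) (λ x → refl)
            (λ a b e lab h₁ h₂ → h₁) (λ a b e lab h₁ h₂ → h₁)
      where
      com : (tL ∘H idH) ≈ (α₀ ∘H m₀)
      com = (λ w → sym (α₀-m₀V w)) , (λ e → sym (α₀-m₀E e))

    -- The content of the PBPO⁺ condition that (L, 1_L, m₀) is a pullback of t_L and β.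
    Classifies : Hom (enc s) L' → Set
    Classifies β = (∀ w → fV β (fV m₀ w) ≡ old w) × (∀ e → fE β (fE m₀ e) ≡ oldE e)
                 × (∀ q w → fV β q ≡ old w → fV m₀ w ≡ q)

    α₀-classifies : Classifies α₀
    α₀-classifies = α₀-m₀V , α₀-m₀E , α₀-old⇒m₀

    s≡C[lσ] : s ≡ plug (ctxOf s p) (tsubst σ l)
    s≡C[lσ] = trans (sym (replace-self s p)) (trans (cong (replace s p) s∣p≡lσ) (sym (plug-ctxOf s p _)))

    t≡C[rσ] : t ≡ plug (ctxOf s p) (tsubst σ r)
    t≡C[rσ] = sym (plug-ctxOf s p _)

  module CanonicalInterface (X : Redex) where
    open CanonicalMatch X public

    rhs⊆lhs : ∀ {x} → x ∈V r → x ∈V l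
    rhs⊆lhs {x} pf = var-sub ρ x pf

    -- The interface graph G_K: the context part of s, the root of the redex, and one copy of σ x
    -- for every occurrence of a variable x in r (r is linear, so these copies are disjoint).
    data KV : Set where
      kout  : Out s p → KV
      kroot : KV
      kvar  : (x : ℕ) (pf : x ∈V r) → Pos (σ x) → KV

    data KE : Set where
      keout : (o : Out s p) → Fin (arity (subAt s (outS o))) → KE
      kevar : (x : ℕ) (pf : x ∈V r) (q : Pos (σ x)) → Fin (arity (subAt (σ x) q)) → KE

    GK₀-contextV : Maybe (Out s p) → KV
    GK₀-contextV nothing = kroot
    GK₀-contextV (just o) = kout o

    GK₀ : Graph
    GK₀ = record { V = KV ; E = KE ; src = sr ; tgt = tg ; lv = lb ; le = leb }
      where
      sr : KE → KV
      sr (keout o j) = kout o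
      sr (kevar x pf q j) = kvar x pf q
      tg : KE → KV
      tg (keout o j) = GK₀-contextV (outTgt o j)
      tg (kevar x pf q j) = kvar x pf (child (σ x) q j)
      lb : KV → Lab
      lb (kout o) = headLab (subAt s (outS o))
      lb kroot = bot
      lb (kvar x pf q) = headLab (subAt (σ x) q)
      leb : KE → Lab
      leb (keout o j) = num (toℕ j)
      leb (kevar x pf q j) = num (toℕ j)

    subAt-substPos : ∀ {x} (pf : x ∈V l) (q : Pos (σ x)) → subAt s (substPos pf q) ≡ subAt (σ x) q
    subAt-substPos pf q = trans (subAt-ext s p _) (trans (subAt-castP (sym s∣p≡lσ) (varpos pf q)) (subAt-varpos pf q))

    child-substPos : ∀ {x} (pf : x ∈V l) (q : Pos (σ x)) (j : Fin (arity (subAt (σ x) q))) (e : arity (subAt (σ x) q) ≡ arity (subAt s (substPos pf q)))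
               → child s (substPos pf q) (castF e j) ≡ substPos pf (child (σ x) q j)
    child-substPos pf q j e =
      trans (cong (child s (ext s p Q)) (toℕ-injective (trans (toℕ-castF e j) (sym (trans (toℕ-castF e₁ _) (trans (toℕ-castF e₂ _) (toℕ-castF e₃ j)))))))
      (trans (child-ext s p Q (castF e₂ (castF e₃ j)) e₁)
      (cong (ext s p) (trans (child-castP (sym s∣p≡lσ) (varpos pf q) (castF e₃ j) e₂)
                             (cong (castP (sym s∣p≡lσ)) (child-varpos pf q j e₃)))))
      where
      Q = castP (sym s∣p≡lσ) (varpos pf q)
      e₃ = cong arity (sym (subAt-varpos pf q))
      e₂ = cong arity (sym (subAt-castP (sym s∣p≡lσ) (varpos pf q)))
      e₁ = cong arity (sym (subAt-ext s p Q))

    gL₀V : KV → Pos s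
    gL₀V (kout o) = outS o
    gL₀V kroot = p
    gL₀V (kvar x pf q) = substPos (rhs⊆lhs pf) q

    gL₀E : KE → EdgeT s
    gL₀E (keout o j) = outS o , j
    gL₀E (kevar x pf q j) = substPos (rhs⊆lhs pf) q , castF (cong arity (sym (subAt-substPos (rhs⊆lhs pf) q))) j

    ocK-S : (m : Maybe (Out s p)) → gL₀V (GK₀-contextV m) ≡ ocS p m
    ocK-S nothing = refl
    ocK-S (just o) = refl

    gL₀ : Hom GK₀ (enc s)
    gL₀ = record { fV = gL₀V ; fE = gL₀E ; src-c = sc ; tgt-c = tc ; lv-c = lc ; le-c = ec }
      where
      sc : ∀ e → gL₀V (src GK₀ e) ≡ proj₁ (gL₀E e)
      sc (keout o j) = refl
      sc (kevar x pf q j) = refl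
      tc : ∀ e → gL₀V (tgt GK₀ e) ≡ child s (proj₁ (gL₀E e)) (proj₂ (gL₀E e))
      tc (keout o j) = trans (ocK-S (outTgt o j)) (sym (outTgtS o j))
      tc (kevar x pf q j) = sym (child-substPos (rhs⊆lhs pf) q j _)
      lc : ∀ v → lv GK₀ v ≤L headLab (subAt s (gL₀V v))
      lc (kout o) = refl≤
      lc kroot = bot≤
      lc (kvar x pf q) = ≡⇒≤L (cong headLab (sym (subAt-substPos (rhs⊆lhs pf) q)))
      ec : ∀ e → le GK₀ e ≤L num (toℕ (proj₂ (gL₀E e)))
      ec (keout o j) = refl≤
      ec (kevar x pf q j) = ≡⇒≤L (cong num (sym (toℕ-castF _ j)))

    K'-varV : (x : ℕ) (pf : x ∈V r) → Bool → CV (IG r) isVarK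
    K'-varV x pf true = old (just (x , pf))
    K'-varV x pf false = prime (just (x , pf) , refl)

    K'-varE : (x : ℕ) (pf : x ∈V r) → Bool → CE (IG r) isVarK
    K'-varE x pf true = toPrm (just (x , pf) , refl)
    K'-varE x pf false = loopP (just (x , pf) , refl)

    K'-contextE : Maybe (Out s p) → CE (IG r) isVarK
    K'-contextE nothing = toRoot
    K'-contextE (just _) = loopC

    u'₀V : KV → CV (IG r) isVarK
    u'₀V (kout o) = cnode
    u'₀V kroot = old nothing
    u'₀V (kvar x pf q) = K'-varV x pf (isHere q)

    u'₀E : KE → CE (IG r) isVarK
    u'₀E (keout o j) = K'-contextE (outTgt o j)
    u'₀E (kevar x pf q j) = K'-varE x pf (isHere q)

    u'₀ : Hom GK₀ K'
    u'₀ = record { fV = u'₀V ; fE = u'₀E ; src-c = sc ; tgt-c = tc ; lv-c = lc ; le-c = ec }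
      where
      scO : ∀ m → cnode ≡ src K' (K'-contextE m)
      scO nothing = refl
      scO (just _) = refl
      scB : ∀ x pf b → K'-varV x pf b ≡ src K' (K'-varE x pf b)
      scB x pf true = refl
      scB x pf false = refl
      sc : ∀ e → u'₀V (src GK₀ e) ≡ src K' (u'₀E e)
      sc (keout o j) = scO (outTgt o j)
      sc (kevar x pf q j) = scB x pf (isHere q)
      tcO : ∀ m → u'₀V (GK₀-contextV m) ≡ tgt K' (K'-contextE m)
      tcO nothing = refl
      tcO (just _) = refl
      tcB : ∀ x pf b → K'-varV x pf false ≡ tgt K' (K'-varE x pf b)
      tcB x pf true = refl
      tcB x pf false = refl
      tc : ∀ e → u'₀V (tgt GK₀ e) ≡ tgt K' (u'₀E e)
      tc (keout o j) = tcO (outTgt o j)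
      tc (kevar x pf q j) rewrite isHere-child (σ x) q j = tcB x pf (isHere q)
      lcB : ∀ x pf b {lab} → lab ≤L lv K' (K'-varV x pf b)
      lcB x pf true = ≤top
      lcB x pf false = ≤top
      lc : ∀ v → lv GK₀ v ≤L lv K' (u'₀V v)
      lc (kout o) = ≤top
      lc kroot = bot≤
      lc (kvar x pf q) = lcB x pf (isHere q)
      ecO : ∀ m {lab} → lab ≤L le K' (K'-contextE m)
      ecO nothing = ≤top
      ecO (just _) = ≤top
      ecB : ∀ x pf b {lab} → lab ≤L le K' (K'-varE x pf b)
      ecB x pf true = ≤top
      ecB x pf false = ≤top
      ec : ∀ e → le GK₀ e ≤L le K' (u'₀E e)
      ec (keout o j) = ecO (outTgt o j)
      ec (kevar x pf q j) = ecB x pf (isHere q)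

    l'-varV : ∀ x (pf : x ∈V r) (b : Bool) → _≡_ {A = CV (enc l) (isVarPos l)}
            (if b then old (varPos (rhs⊆lhs pf)) else prime (varPos (rhs⊆lhs pf) , isVarPos-varPos (rhs⊆lhs pf))) (fV l' (K'-varV x pf b))
    l'-varV x pf true = refl
    l'-varV x pf false = refl

    l'-varE : ∀ x (pf : x ∈V r) (b : Bool) → _≡_ {A = CE (enc l) (isVarPos l)}
            (if b then toPrm (varPos (rhs⊆lhs pf) , isVarPos-varPos (rhs⊆lhs pf)) else loopP (varPos (rhs⊆lhs pf) , isVarPos-varPos (rhs⊆lhs pf))) (fE l' (K'-varE x pf b))
    l'-varE x pf true = refl
    l'-varE x pf false = refl

    l'-contextE : ∀ m → L'-contextE m ≡ fE l' (K'-contextE m)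
    l'-contextE nothing = refl
    l'-contextE (just _) = refl

    αSplitE-outside : (o : Out s p) (z : Out s p ⊎ Pos (subAt s p)) (e : [ outS , ext s p ] z ≡ outS o) (j : Fin (arity (subAt s (outS o))))
            → z ≡ inj₁ o → αSplitE z (outS o) e j ≡ L'-contextE (outTgt o j)
    αSplitE-outside o .(inj₁ o) e j refl rewrite uip e refl = refl

    αInstE-varpos : ∀ {x} (pf : x ∈V l) (q : Pos (σ x)) (z : NVPos l ⊎ VarOcc l) (e : embI l z ≡ varpos pf q)
                 (k : Fin (arity (subAt (tsubst σ l) (varpos pf q))))
               → z ≡ inj₂ (x , pf , q) → αInstE z (varpos pf q) e k ≡ (if isHere q then toPrm (varPos pf , isVarPos-varPos pf) else loopP (varPos pf , isVarPos-varPos pf))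
    αInstE-varpos pf q .(inj₂ (_ , pf , q)) e k refl = refl

    α₀E-out : (o : Out s p) (j : Fin (arity (subAt s (outS o)))) → α₀E (outS o , j) ≡ L'-contextE (outTgt o j)
    α₀E-out o j = αSplitE-outside o (chooseS s p (outS o)) (sectS s p (outS o)) j (chooseS-out o)

    α₀E-var : ∀ {x} (pf : x ∈V l) (q : Pos (σ x)) (j : Fin (arity (subAt s (substPos pf q))))
            → α₀E (substPos pf q , j) ≡ (if isHere q then toPrm (varPos pf , isVarPos-varPos pf) else loopP (varPos pf , isVarPos-varPos pf))
    α₀E-var pf q j =
      trans (αSplitE-inside Q (chooseS s p (ext s p Q)) (sectS s p (ext s p Q)) j k (toℕ-castF ek j) (chooseS-ext s p Q))
      (trans (αRedexE-cong (castP-inv' s∣p≡lσ (varpos pf q)) k kk (sym (toℕ-castF ekk k)))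
             (αInstE-varpos pf q (chooseI l (varpos pf q)) (sectI l (varpos pf q)) kk (chooseI-varpos l pf q)))
      where
      Q = castP (sym s∣p≡lσ) (varpos pf q)
      ek : arity (subAt s (ext s p Q)) ≡ arity (subAt (tsubst σ l) (castP s∣p≡lσ Q))
      ek = cong arity (trans (subAt-ext s p Q) (sym (subAt-castP s∣p≡lσ Q)))
      k = castF ek j
      ekk : arity (subAt (tsubst σ l) (castP s∣p≡lσ Q)) ≡ arity (subAt (tsubst σ l) (varpos pf q))
      ekk = cong (λ z → arity (subAt (tsubst σ l) z)) (castP-inv' s∣p≡lσ (varpos pf q))
      kk = castF ekk k

    α₀V-var : ∀ {x} (pf : x ∈V l) (q : Pos (σ x))
            → α₀V (substPos pf q) ≡ (if isHere q then old (varPos pf) else prime (varPos pf , isVarPos-varPos pf))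
    α₀V-var pf q = trans (α₀V-ext _) (trans (cong αRedexV (castP-inv' s∣p≡lσ (varpos pf q))) (αRedexV-varpos pf q))

    GK₀-commutes : (α₀ ∘H gL₀) ≈ (l' ∘H u'₀)
    GK₀-commutes = cv , ce
      where
      cv : ∀ x → α₀V (gL₀V x) ≡ fV l' (u'₀V x)
      cv (kout o) = α₀V-out o
      cv kroot = α₀V-p
      cv (kvar x pf q) = trans (α₀V-var (rhs⊆lhs pf) q) (l'-varV x pf (isHere q))
      ce : ∀ e → α₀E (gL₀E e) ≡ fE l' (u'₀E e)
      ce (keout o j) = trans (α₀E-out o j) (l'-contextE (outTgt o j))
      ce (kevar x pf q j) = trans (α₀E-var (rhs⊆lhs pf) q _) (l'-varE x pf (isHere q))

    -- A left inverse of varpos; positions off the occurrence go to the junk value here.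
    varpos⁻¹ : ∀ {x} {l₀ : Term} → x ∈V l₀ → Pos (tsubst σ l₀) → Pos (σ x)
    varpos⁻¹ here q = q
    varpos⁻¹ (there {f} {ls} i pf) here = here
    varpos⁻¹ (there {f} {ls} i pf) (there j q) with j ≟ i
    ... | yes refl = varpos⁻¹ pf (castP (lookup-substs ls i) q)
    ... | no _ = here

    varpos⁻¹-varpos : ∀ {x} {l₀ : Term} (pf : x ∈V l₀) (q : Pos (σ x)) → varpos⁻¹ pf (varpos pf q) ≡ q
    varpos⁻¹-varpos here q = refl
    varpos⁻¹-varpos (there {f} {ls} i pf) q with i ≟ i
    ... | no ne = ⊥-elim (ne refl)
    ... | yes refl rewrite castP-inv' (lookup-substs ls i) (varpos pf q) = varpos⁻¹-varpos pf q

    substPos⁻¹ : ∀ {x} → x ∈V l → Pos s → Pos (σ x)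
    substPos⁻¹ pfl q = [ (λ _ → here) , (λ q' → varpos⁻¹ pfl (castP s∣p≡lσ q')) ] (chooseS s p q)

    substPos-inj : ∀ {x} (pf : x ∈V l) {q q' : Pos (σ x)} → substPos pf q ≡ substPos pf q' → q ≡ q'
    substPos-inj pf {q} {q'} e =
      trans (sym (varpos⁻¹-varpos pf q)) (trans (cong (varpos⁻¹ pf) (castP-inj (sym s∣p≡lσ) (ext-inj s p e))) (varpos⁻¹-varpos pf q'))

    ifNotC : ∀ (b : Bool) {A : Pos l} {B : VarV (enc l) (isVarPos l)} → _≡_ {A = CV (enc l) (isVarPos l)} (if b then old A else prime B) cnode → ⊥
    ifNotC true ()
    ifNotC false ()

    αInstV≢cnode : ∀ z → αInstV z ≡ cnode → ⊥
    αInstV≢cnode (inj₁ _) ()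
    αInstV≢cnode (inj₂ (x , pf , q)) h = ifNotC (isHere q) h

    m₀-here : fV m₀ here ≡ p
    m₀-here = trans (cong (ext s p) (trans (cong (castP (sym s∣p≡lσ)) (lpos-here l)) (castP-here (sym s∣p≡lσ)))) (ext-here s p)

    m₀-var : ∀ {x} (pf : x ∈V l) → fV m₀ (varPos pf) ≡ substPos pf here
    m₀-var pf = cong (λ z → ext s p (castP (sym s∣p≡lσ) z)) (lpos-varPos pf)

    αInstV-prime : ∀ {x} (pfl : x ∈V l) c (z : NVPos l ⊎ VarOcc l) (Q : Pos (tsubst σ l)) → embI l z ≡ Q
              → αInstV z ≡ prime (varPos pfl , c) → varpos pfl (varpos⁻¹ pfl Q) ≡ Q
    αInstV-prime pfl c (inj₁ _) Q e ()
    αInstV-prime {x} pfl c (inj₂ (y , pf' , q₃)) Q e h = go (cong proj₁ (varPos-inj pf' pfl (cong proj₁ (proj₂ ip))))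
      where
      ip = ifPrime (isHere q₃) {varPos pf'} {varPos pf' , isVarPos-varPos pf'} h
      go : y ≡ x → varpos pfl (varpos⁻¹ pfl Q) ≡ Q
      go refl with varPos-inj pf' pfl (cong proj₁ (proj₂ ip))
      ... | vi rewrite Σinj vi = trans (cong (λ z → varpos pfl (varpos⁻¹ pfl z)) (sym e)) (trans (cong (varpos pfl) (varpos⁻¹-varpos pfl q₃)) e)

    α₀-prime⇒substPos : ∀ {x} (pfl : x ∈V l) (q : Pos s) c → α₀V q ≡ prime (varPos pfl , c) → substPos pfl (substPos⁻¹ pfl q) ≡ q
    α₀-prime⇒substPos pfl q c h = go (chooseS s p q) (sectS s p q) h
      where
      go : (z : Out s p ⊎ Pos (subAt s p)) → [ outS , ext s p ] z ≡ q → αSplitV z ≡ prime (varPos pfl , c)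
         → substPos pfl ([ (λ _ → here) , (λ q' → varpos⁻¹ pfl (castP s∣p≡lσ q')) ] z) ≡ q
      go (inj₁ o) e ()
      go (inj₂ q') e h' = trans (cong (λ z → ext s p (castP (sym s∣p≡lσ) z))
                                      (αInstV-prime pfl c (chooseI l (castP s∣p≡lσ q')) (castP s∣p≡lσ q') (sectI l (castP s∣p≡lσ q')) h'))
                                (trans (cong (ext s p) (castP-inv s∣p≡lσ q')) e)

    pairV : (q : Pos s) (k : CV (IG r) isVarK) → α₀V q ≡ fV l' k → KV
    pairV q cnode e = [ kout , (λ _ → kroot) ] (chooseS s p q)
    pairV q (old nothing) e = kroot
    pairV q (old (just (x , pf))) e = kvar x pf here
    pairV q (prime (just (x , pf) , _)) e = kvar x pf (substPos⁻¹ (rhs⊆lhs pf) q)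
    pairV q (prime (nothing , ())) e

    pairV-gL₀ : ∀ q k e → gL₀V (pairV q k e) ≡ q
    pairV-gL₀ q cnode e = go (chooseS s p q) (sectS s p q) e
      where
      go : (z : Out s p ⊎ Pos (subAt s p)) → [ outS , ext s p ] z ≡ q → αSplitV z ≡ cnode → gL₀V ([ kout , (λ _ → kroot) ] z) ≡ q
      go (inj₁ o) e' h = e'
      go (inj₂ q') e' h = ⊥-elim (αInstV≢cnode (chooseI l (castP s∣p≡lσ q')) h)
    pairV-gL₀ q (old nothing) e = trans (sym m₀-here) (α₀-old⇒m₀ q here e)
    pairV-gL₀ q (old (just (x , pf))) e = trans (sym (m₀-var (rhs⊆lhs pf))) (α₀-old⇒m₀ q (varPos (rhs⊆lhs pf)) e)
    pairV-gL₀ q (prime (just (x , pf) , c)) e = α₀-prime⇒substPos (rhs⊆lhs pf) q _ e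
    pairV-gL₀ q (prime (nothing , ())) e

    rhs-occ-unique : ∀ {x} (pf pf' : x ∈V r) → pf ≡ pf'
    rhs-occ-unique pf pf' = rhs-linear _ pf pf'

    justInj : ∀ {x y} (pf : x ∈V r) (pf' : y ∈V r) → x ≡ y → _≡_ {A = Maybe (Σ ℕ λ z → z ∈V r)} (just (x , pf)) (just (y , pf'))
    justInj pf pf' refl = cong (λ z → just (_ , z)) (rhs-occ-unique pf pf')

    vpEq : ∀ {x y} (pf : x ∈V r) (pf' : y ∈V r) → varPos (rhs⊆lhs pf) ≡ varPos (rhs⊆lhs pf') → x ≡ y
    vpEq pf pf' e = cong proj₁ (varPos-inj (rhs⊆lhs pf) (rhs⊆lhs pf') e)

    here≢varPos : ∀ {x} (pf : x ∈V l) → here ≡ varPos pf → ⊥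
    here≢varPos pf e with trans (cong (isVarPos l) e) (isVarPos-varPos pf)
    ... | h = bool⊥ (trans (sym lhs-nonvar) h)
      where
      bool⊥ : false ≡ true → ⊥
      bool⊥ ()

    primeInj : ∀ {a b : VarV (enc l) (isVarPos l)} → _≡_ {A = CV (enc l) (isVarPos l)} (prime a) (prime b) → a ≡ b
    primeInj refl = refl

    l'-inj : ∀ k₁ k₂ → fV l' k₁ ≡ fV l' k₂ → k₁ ≡ k₂
    l'-inj cnode cnode e = refl
    l'-inj (old nothing) (old nothing) e = refl
    l'-inj (old nothing) (old (just (x , pf))) e = ⊥-elim (here≢varPos (rhs⊆lhs pf) (old-inj e))
    l'-inj (old (just (x , pf))) (old nothing) e = ⊥-elim (here≢varPos (rhs⊆lhs pf) (sym (old-inj e)))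
    l'-inj (old (just (x , pf))) (old (just (y , pf'))) e = cong old (justInj pf pf' (vpEq pf pf' (old-inj e)))
    l'-inj (prime (just (x , pf) , c₁)) (prime (just (y , pf') , c₂)) e with vpEq pf pf' (cong proj₁ (primeInj e))
    ... | refl rewrite rhs-occ-unique pf pf' | uip c₁ c₂ = refl
    l'-inj (prime (nothing , ())) _ e
    l'-inj _ (prime (nothing , ())) e
    l'-inj cnode (old _) ()
    l'-inj cnode (prime (just _ , _)) ()
    l'-inj (old _) cnode ()
    l'-inj (old nothing) (prime (just _ , _)) ()
    l'-inj (old (just _)) (prime (just _ , _)) ()
    l'-inj (prime (just _ , _)) cnode ()
    l'-inj (prime (just _ , _)) (old _) ()

    kvV≢c : ∀ x pf b → K'-varV x pf b ≡ cnode → ⊥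
    kvV≢c x pf true ()
    kvV≢c x pf false ()

    kvV≢r : ∀ x pf b → K'-varV x pf b ≡ old nothing → ⊥
    kvV≢r x pf true ()
    kvV≢r x pf false ()

    kvV-inj : ∀ x pf b y pf' b' → K'-varV x pf b ≡ K'-varV y pf' b' → x ≡ y
    kvV-inj x pf true .x .pf true refl = refl
    kvV-inj x pf false .x .pf false refl = refl
    kvV-inj x pf true y pf' false ()
    kvV-inj x pf false y pf' true ()

    gL₀-u'₀-jointly-injectiveV : ∀ a b → gL₀V a ≡ gL₀V b → u'₀V a ≡ u'₀V b → a ≡ b
    gL₀-u'₀-jointly-injectiveV (kout o) (kout o') g u = cong kout (outS-inj o o' g)
    gL₀-u'₀-jointly-injectiveV (kout o) kroot g ()
    gL₀-u'₀-jointly-injectiveV (kout o) (kvar y pf q) g u = ⊥-elim (kvV≢c y pf (isHere q) (sym u))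
    gL₀-u'₀-jointly-injectiveV kroot (kout o) g ()
    gL₀-u'₀-jointly-injectiveV kroot kroot g u = refl
    gL₀-u'₀-jointly-injectiveV kroot (kvar y pf q) g u = ⊥-elim (kvV≢r y pf (isHere q) (sym u))
    gL₀-u'₀-jointly-injectiveV (kvar x pf q) (kout o) g u = ⊥-elim (kvV≢c x pf (isHere q) u)
    gL₀-u'₀-jointly-injectiveV (kvar x pf q) kroot g u = ⊥-elim (kvV≢r x pf (isHere q) u)
    gL₀-u'₀-jointly-injectiveV (kvar x pf q) (kvar y pf' q') g u with kvV-inj x pf (isHere q) y pf' (isHere q') u
    ... | refl rewrite rhs-occ-unique pf pf' = cong (kvar x pf') (substPos-inj (rhs⊆lhs pf') g)

    pairV-u'₀ : ∀ q k e → u'₀V (pairV q k e) ≡ k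
    pairV-u'₀ q k e = l'-inj _ _ (trans (sym (proj₁ GK₀-commutes (pairV q k e))) (trans (cong α₀V (pairV-gL₀ q k e)) e))

    pairV-η : ∀ x → pairV (gL₀V x) (u'₀V x) (proj₁ GK₀-commutes x) ≡ x
    pairV-η x = gL₀-u'₀-jointly-injectiveV _ _ (pairV-gL₀ (gL₀V x) (u'₀V x) (proj₁ GK₀-commutes x)) (pairV-u'₀ (gL₀V x) (u'₀V x) (proj₁ GK₀-commutes x))

    arS : ∀ {q q' : Pos s} → q ≡ q' → arity (subAt s q) ≡ arity (subAt s q')
    arS e = cong (λ z → arity (subAt s z)) e

    keoutOf : (q : Pos s) (z : Out s p ⊎ Pos (subAt s p)) → [ outS , ext s p ] z ≡ q → Fin (arity (subAt s q)) → αSplitV z ≡ cnode → KE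
    keoutOf q (inj₁ o) e j h = keout o (castF (arS (sym e)) j)
    keoutOf q (inj₂ q') e j h = ⊥-elim (αInstV≢cnode (chooseI l (castP s∣p≡lσ q')) h)

    kevarOf : ∀ x (pf : x ∈V r) (q : Pos s) (q₃ : Pos (σ x)) → substPos (rhs⊆lhs pf) q₃ ≡ q → Fin (arity (subAt s q)) → KE
    kevarOf x pf q q₃ e j = kevar x pf q₃ (castF (trans (arS (sym e)) (cong arity (subAt-substPos (rhs⊆lhs pf) q₃))) j)

    srcE : (q : Pos s) (j : Fin (arity (subAt s q))) (k' : CE (IG r) isVarK) → α₀E (q , j) ≡ fE l' k' → α₀V q ≡ fV l' (src K' k')
    srcE q j k' h = trans (src-c α₀ (q , j)) (trans (cong (src L') h) (sym (src-c l' k')))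

    pairE : (e : EdgeT s) (k' : CE (IG r) isVarK) → α₀E e ≡ fE l' k' → KE
    pairE (q , j) (oldE ()) h
    pairE (q , j) (toPrm (just (x , pf) , c)) h = kevarOf x pf q here (pairV-gL₀ q (old (just (x , pf))) (srcE q j (toPrm (just (x , pf) , c)) h)) j
    pairE (q , j) (toPrm (nothing , ())) h
    pairE (q , j) (loopP (just (x , pf) , c)) h = kevarOf x pf q (substPos⁻¹ (rhs⊆lhs pf) q) (α₀-prime⇒substPos (rhs⊆lhs pf) q _ (srcE q j (loopP (just (x , pf) , c)) h)) j
    pairE (q , j) (loopP (nothing , ())) h
    pairE (q , j) toRoot h = keoutOf q (chooseS s p q) (sectS s p q) j (srcE q j _ h)
    pairE (q , j) loopC h = keoutOf q (chooseS s p q) (sectS s p q) j (srcE q j _ h)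

    keoutOf₁ : (q : Pos s) (z : Out s p ⊎ Pos (subAt s p)) (e : [ outS , ext s p ] z ≡ q) (j : Fin (arity (subAt s q))) (h : αSplitV z ≡ cnode)
             → gL₀E (keoutOf q z e j h) ≡ (q , j)
    keoutOf₁ q (inj₁ o) e j h = edgeEq s e (toℕ-castF (arS (sym e)) j)
    keoutOf₁ q (inj₂ q') e j h = ⊥-elim (αInstV≢cnode (chooseI l (castP s∣p≡lσ q')) h)

    kevarOf₁ : ∀ x (pf : x ∈V r) (q : Pos s) (q₃ : Pos (σ x)) (e : substPos (rhs⊆lhs pf) q₃ ≡ q) (j : Fin (arity (subAt s q)))
             → gL₀E (kevarOf x pf q q₃ e j) ≡ (q , j)
    kevarOf₁ x pf q q₃ e j = edgeEq s e (trans (toℕ-castF (cong arity (sym (subAt-substPos (rhs⊆lhs pf) q₃))) _) (toℕ-castF (trans (arS (sym e)) (cong arity (subAt-substPos (rhs⊆lhs pf) q₃))) j))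

    pairE-gL₀ : ∀ e k' h → gL₀E (pairE e k' h) ≡ e
    pairE-gL₀ (q , j) (oldE ()) h
    pairE-gL₀ (q , j) (toPrm (just (x , pf) , c)) h = kevarOf₁ x pf q here (pairV-gL₀ q (old (just (x , pf))) (srcE q j (toPrm (just (x , pf) , c)) h)) j
    pairE-gL₀ (q , j) (toPrm (nothing , ())) h
    pairE-gL₀ (q , j) (loopP (just (x , pf) , c)) h = kevarOf₁ x pf q (substPos⁻¹ (rhs⊆lhs pf) q) (α₀-prime⇒substPos (rhs⊆lhs pf) q _ (srcE q j (loopP (just (x , pf) , c)) h)) j
    pairE-gL₀ (q , j) (loopP (nothing , ())) h
    pairE-gL₀ (q , j) toRoot h = keoutOf₁ q (chooseS s p q) (sectS s p q) j (srcE q j toRoot h)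
    pairE-gL₀ (q , j) loopC h = keoutOf₁ q (chooseS s p q) (sectS s p q) j (srcE q j loopC h)

    toPrmInj : ∀ {a b : VarV (enc l) (isVarPos l)} → _≡_ {A = CE (enc l) (isVarPos l)} (toPrm a) (toPrm b) → a ≡ b
    toPrmInj refl = refl
    loopPInj : ∀ {a b : VarV (enc l) (isVarPos l)} → _≡_ {A = CE (enc l) (isVarPos l)} (loopP a) (loopP b) → a ≡ b
    loopPInj refl = refl

    l'E-inj : ∀ k₁ k₂ → fE l' k₁ ≡ fE l' k₂ → k₁ ≡ k₂
    l'E-inj (oldE ()) _ e
    l'E-inj _ (oldE ()) e
    l'E-inj (toPrm (nothing , ())) _ e
    l'E-inj _ (toPrm (nothing , ())) e
    l'E-inj (loopP (nothing , ())) _ e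
    l'E-inj _ (loopP (nothing , ())) e
    l'E-inj (toPrm (just (x , pf) , c₁)) (toPrm (just (y , pf') , c₂)) e with vpEq pf pf' (cong proj₁ (toPrmInj e))
    ... | refl rewrite rhs-occ-unique pf pf' | uip c₁ c₂ = refl
    l'E-inj (loopP (just (x , pf) , c₁)) (loopP (just (y , pf') , c₂)) e with vpEq pf pf' (cong proj₁ (loopPInj e))
    ... | refl rewrite rhs-occ-unique pf pf' | uip c₁ c₂ = refl
    l'E-inj toRoot toRoot e = refl
    l'E-inj loopC loopC e = refl
    l'E-inj (toPrm (just _ , _)) (loopP (just _ , _)) ()
    l'E-inj (toPrm (just _ , _)) toRoot ()
    l'E-inj (toPrm (just _ , _)) loopC ()
    l'E-inj (loopP (just _ , _)) (toPrm (just _ , _)) ()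
    l'E-inj (loopP (just _ , _)) toRoot ()
    l'E-inj (loopP (just _ , _)) loopC ()
    l'E-inj toRoot (toPrm (just _ , _)) ()
    l'E-inj toRoot (loopP (just _ , _)) ()
    l'E-inj toRoot loopC ()
    l'E-inj loopC (toPrm (just _ , _)) ()
    l'E-inj loopC (loopP (just _ , _)) ()
    l'E-inj loopC toRoot ()

    pairE-u'₀ : ∀ e k' h → u'₀E (pairE e k' h) ≡ k'
    pairE-u'₀ e k' h = l'E-inj _ _ (trans (sym (proj₂ GK₀-commutes (pairE e k' h))) (trans (cong α₀E (pairE-gL₀ e k' h)) h))

    ocE'≢kvE : ∀ m x pf b → K'-contextE m ≡ K'-varE x pf b → ⊥
    ocE'≢kvE nothing x pf true ()
    ocE'≢kvE nothing x pf false ()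
    ocE'≢kvE (just _) x pf true ()
    ocE'≢kvE (just _) x pf false ()

    kvE-inj : ∀ x pf b y pf' b' → K'-varE x pf b ≡ K'-varE y pf' b' → x ≡ y
    kvE-inj x pf true .x .pf true refl = refl
    kvE-inj x pf false .x .pf false refl = refl
    kvE-inj x pf true y pf' false ()
    kvE-inj x pf false y pf' true ()

    pairInj : ∀ {q : Pos s} {j j' : Fin (arity (subAt s q))} → _≡_ {A = EdgeT s} (q , j) (q , j') → j ≡ j'
    pairInj refl = refl

    gL₀-u'₀-jointly-injectiveE : ∀ a b → gL₀E a ≡ gL₀E b → u'₀E a ≡ u'₀E b → a ≡ b
    gL₀-u'₀-jointly-injectiveE (keout o j) (keout o' j') g u with outS-inj o o' (cong proj₁ g)
    ... | refl = cong (keout o) (pairInj g)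
    gL₀-u'₀-jointly-injectiveE (keout o j) (kevar y pf q j') g u = ⊥-elim (ocE'≢kvE (outTgt o j) y pf (isHere q) u)
    gL₀-u'₀-jointly-injectiveE (kevar x pf q j) (keout o j') g u = ⊥-elim (ocE'≢kvE (outTgt o j') x pf (isHere q) (sym u))
    gL₀-u'₀-jointly-injectiveE (kevar x pf q j) (kevar y pf' q' j') g u with kvE-inj x pf (isHere q) y pf' (isHere q') u
    ... | refl rewrite rhs-occ-unique pf pf' with substPos-inj (rhs⊆lhs pf') (cong proj₁ g)
    ...   | refl = cong (kevar x pf' q) (toℕ-injective (trans (sym (toℕ-castF _ j)) (trans (cong toℕ (pairInj g)) (toℕ-castF _ j'))))

    pairE-η : ∀ x → pairE (gL₀E x) (u'₀E x) (proj₂ GK₀-commutes x) ≡ x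
    pairE-η x = gL₀-u'₀-jointly-injectiveE _ _ (pairE-gL₀ (gL₀E x) (u'₀E x) (proj₂ GK₀-commutes x)) (pairE-u'₀ (gL₀E x) (u'₀E x) (proj₂ GK₀-commutes x))

    GK₀-lv-meet : ∀ x lab → lab ≤L headLab (subAt s (gL₀V x)) → lab ≤L lv K' (u'₀V x) → lab ≤L lv GK₀ x
    GK₀-lv-meet (kout o) lab h₁ h₂ = h₁
    GK₀-lv-meet kroot lab h₁ h₂ rewrite ≤bot h₂ = bot≤
    GK₀-lv-meet (kvar x pf q) lab h₁ h₂ = subst (λ z → lab ≤L headLab z) (subAt-substPos (rhs⊆lhs pf) q) h₁

    GK₀-le-meet : ∀ x lab → lab ≤L num (toℕ (proj₂ (gL₀E x))) → lab ≤L le GK₀ x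
    GK₀-le-meet (keout o j) lab h = h
    GK₀-le-meet (kevar x pf q j) lab h = subst (λ n → lab ≤L num n) (toℕ-castF _ j) h

    GK₀-pullback : IsPullback α₀ l' GK₀ gL₀ u'₀
    GK₀-pullback = ExplicitPullback.isPullback α₀ l' GK₀ gL₀ u'₀ GK₀-commutes pairV pairV-gL₀ pairV-u'₀ pairV-η pairE pairE-gL₀ pairE-u'₀ pairE-η
            (λ a b e lab h₁ h₂ → GK₀-lv-meet (pairV a b e) lab (subst (λ z → lab ≤L headLab (subAt s z)) (sym (pairV-gL₀ a b e)) h₁)
                                                     (subst (λ z → lab ≤L lv K' z) (sym (pairV-u'₀ a b e)) h₂))
            (λ a b e lab h₁ h₂ → GK₀-le-meet (pairE a b e) lab (subst (λ z → lab ≤L le (enc s) z) (sym (pairE-gL₀ a b e)) h₁))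

  module CanonicalRewrite (X : Redex) where
    open CanonicalInterface X public

    lK : Hom (IG r) (enc l)
    lK = PBPORule.l (encRule ρ)
    rK : Hom (IG r) (enc r)
    rK = PBPORule.r (encRule ρ)
    tK : Hom (IG r) K'
    tK = PBPORule.tK (encRule ρ)

    u₀V : V (IG r) → KV
    u₀V nothing = kroot
    u₀V (just (x , pf)) = kvar x pf here

    u₀ : Hom (IG r) GK₀
    u₀ = record { fV = u₀V ; fE = λ () ; src-c = λ () ; tgt-c = λ () ; lv-c = λ _ → bot≤ ; le-c = λ () }

    u₀-tK : (u'₀ ∘H u₀) ≈ tK
    u₀-tK = cv , (λ ())
      where
      cv : ∀ k → u'₀V (u₀V k) ≡ old k
      cv nothing = refl
      cv (just (x , pf)) = refl

    u₀-m : (gL₀ ∘H u₀) ≈ (m₀ ∘H lK)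
    u₀-m = cv , (λ ())
      where
      cv : ∀ k → gL₀V (u₀V k) ≡ fV m₀ (fV lK k)
      cv nothing = sym m₀-here
      cv (just (x , pf)) = sym (m₀-var (rhs⊆lhs pf))

    extH : Hom (enc v) (enc t)
    extH = PositionHom.hom v t (extT s p v)
             (λ q _ → subst (SameHead (subAt v q)) (sym (subAt-extT s p v q)) (sh-refl _))
             (λ q → ≡⇒≤L (cong headLab (sym (subAt-extT s p v q))))
             (λ q j e → child-extT s p v q j e)

    w₀ : Hom (enc r) (enc t)
    w₀ = extH ∘H lposH r

    subAt-inR : ∀ {x} (pf : x ∈V r) (q : Pos (σ x)) → subAt t (extT s p v (varpos pf q)) ≡ subAt (σ x) q
    subAt-inR pf q = trans (subAt-extT s p v (varpos pf q)) (subAt-varpos pf q)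

    child-inR : ∀ {x} (pf : x ∈V r) (q : Pos (σ x)) (j : Fin (arity (subAt (σ x) q))) (e : arity (subAt (σ x) q) ≡ arity (subAt t (extT s p v (varpos pf q))))
              → child t (extT s p v (varpos pf q)) (castF e j) ≡ extT s p v (varpos pf (child (σ x) q j))
    child-inR pf q j e =
      trans (cong (child t (extT s p v (varpos pf q))) (toℕ-injective (trans (toℕ-castF e j) (sym (trans (toℕ-castF e₁ _) (toℕ-castF e₃ j))))))
      (trans (child-extT s p v (varpos pf q) (castF e₃ j) e₁)
             (cong (extT s p v) (child-varpos pf q j e₃)))
      where
      e₃ = cong arity (sym (subAt-varpos pf q))
      e₁ = cong arity (sym (subAt-extT s p v (varpos pf q)))

    gR₀V : KV → Pos t
    gR₀V (kout o) = outR v o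
    gR₀V kroot = extT s p v here
    gR₀V (kvar x pf q) = extT s p v (varpos pf q)

    gR₀E : KE → EdgeT t
    gR₀E (keout o j) = outR v o , castF (sh-ar (sameOut v o)) j
    gR₀E (kevar x pf q j) = extT s p v (varpos pf q) , castF (cong arity (sym (subAt-inR pf q))) j

    ocK-R : (m : Maybe (Out s p)) → gR₀V (GK₀-contextV m) ≡ ocR p v m
    ocK-R nothing = refl
    ocK-R (just o) = refl

    gR₀ : Hom GK₀ (enc t)
    gR₀ = record { fV = gR₀V ; fE = gR₀E ; src-c = sc ; tgt-c = tc ; lv-c = lc ; le-c = ec }
      where
      sc : ∀ e → gR₀V (src GK₀ e) ≡ proj₁ (gR₀E e)
      sc (keout o j) = refl
      sc (kevar x pf q j) = refl
      tc : ∀ e → gR₀V (tgt GK₀ e) ≡ child t (proj₁ (gR₀E e)) (proj₂ (gR₀E e))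
      tc (keout o j) = trans (ocK-R (outTgt o j)) (sym (outTgtR v o j _))
      tc (kevar x pf q j) = sym (child-inR pf q j _)
      lc : ∀ x → lv GK₀ x ≤L headLab (subAt t (gR₀V x))
      lc (kout o) = ≡⇒≤L (sh-lab (sameOut v o))
      lc kroot = bot≤
      lc (kvar x pf q) = ≡⇒≤L (cong headLab (sym (subAt-inR pf q)))
      ec : ∀ e → le GK₀ e ≤L num (toℕ (proj₂ (gR₀E e)))
      ec (keout o j) = ≡⇒≤L (cong num (sym (toℕ-castF _ j)))
      ec (kevar x pf q j) = ≡⇒≤L (cong num (sym (toℕ-castF _ j)))

    originV-inst : NVPos r ⊎ VarOcc r → KV ⊎ Pos r
    originV-inst (inj₁ (w , nv)) = inj₂ w
    originV-inst (inj₂ (x , pf , q)) = inj₁ (kvar x pf q)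

    originV-split : Out s p ⊎ Pos v → KV ⊎ Pos r
    originV-split (inj₁ o) = inj₁ (kout o)
    originV-split (inj₂ q₁) = originV-inst (chooseI r q₁)

    originV : Pos t → KV ⊎ Pos r
    originV q = originV-split (chooseT s p v q)

    originV-sect : ∀ q → [ gR₀V , fV w₀ ] (originV q) ≡ q
    originV-sect q = trans (cT (chooseT s p v q)) (sectT s p v q)
      where
      cI : ∀ z → [ gR₀V , fV w₀ ] (originV-inst z) ≡ extT s p v (embI r z)
      cI (inj₁ (w , nv)) = refl
      cI (inj₂ (x , pf , q)) = refl
      cT : ∀ z → [ gR₀V , fV w₀ ] (originV-split z) ≡ [ outR v , extT s p v ] z
      cT (inj₁ o) = refl
      cT (inj₂ q₁) = trans (cI (chooseI r q₁)) (cong (extT s p v) (sectI r q₁))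

    arT : ∀ {q q' : Pos t} → q ≡ q' → arity (subAt t q) ≡ arity (subAt t q')
    arT e = cong (λ z → arity (subAt t z)) e

    eI₁ : ∀ (w : Pos r) (nv : isVarPos r w ≡ false) (q : Pos t) → extT s p v (lpos r w) ≡ q → arity (subAt t q) ≡ arity (subAt r w)
    eI₁ w nv q e = trans (arT (sym e)) (trans (cong arity (trans (subAt-extT s p v (lpos r w)) (subAt-lpos r w))) (sym (sh-ar (sh-subst _ nv))))

    eI₂ : ∀ {x} (pf : x ∈V r) (q₃ : Pos (σ x)) (q : Pos t) → extT s p v (varpos pf q₃) ≡ q → arity (subAt t q) ≡ arity (subAt (σ x) q₃)
    eI₂ pf q₃ q e = trans (arT (sym e)) (cong arity (subAt-inR pf q₃))

    eT : (o : Out s p) (q : Pos t) → outR v o ≡ q → arity (subAt t q) ≡ arity (subAt s (outS o))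
    eT o q e = trans (arT (sym e)) (sym (sh-ar (sameOut v o)))

    originE-inst : (z : NVPos r ⊎ VarOcc r) (q : Pos t) → extT s p v (embI r z) ≡ q → Fin (arity (subAt t q)) → KE ⊎ EdgeT r
    originE-inst (inj₁ (w , nv)) q e j = inj₂ (w , castF (eI₁ w nv q e) j)
    originE-inst (inj₂ (x , pf , q₃)) q e j = inj₁ (kevar x pf q₃ (castF (eI₂ pf q₃ q e) j))

    originE-split : (z : Out s p ⊎ Pos v) (q : Pos t) → [ outR v , extT s p v ] z ≡ q → Fin (arity (subAt t q)) → KE ⊎ EdgeT r
    originE-split (inj₁ o) q e j = inj₁ (keout o (castF (eT o q e) j))
    originE-split (inj₂ q₁) q e j = originE-inst (chooseI r q₁) q (trans (cong (extT s p v) (sectI r q₁)) e) j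

    originE : EdgeT t → KE ⊎ EdgeT r
    originE (q , j) = originE-split (chooseT s p v q) q (sectT s p v q) j

    originE-sect : ∀ e → [ gR₀E , fE w₀ ] (originE e) ≡ e
    originE-sect (q , j) = cT (chooseT s p v q) q (sectT s p v q) j
      where
      cI : ∀ z q e j → [ gR₀E , fE w₀ ] (originE-inst z q e j) ≡ (q , j)
      cI (inj₁ (w , nv)) q e j = edgeEq t (trans (homE₁ w₀ (w , castF (eI₁ w nv q e) j)) e) (trans (homE₂ w₀ (w , castF (eI₁ w nv q e) j)) (toℕ-castF (eI₁ w nv q e) j))
      cI (inj₂ (x , pf , q₃)) q e j = edgeEq t e (trans (toℕ-castF (cong arity (sym (subAt-inR pf q₃))) _) (toℕ-castF (eI₂ pf q₃ q e) j))
      cT : ∀ z q e j → [ gR₀E , fE w₀ ] (originE-split z q e j) ≡ (q , j)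
      cT (inj₁ o) q e j = edgeEq t e (trans (toℕ-castF (sh-ar (sameOut v o)) _) (toℕ-castF (eT o q e) j))
      cT (inj₂ q₁) q e j = cI (chooseI r q₁) q (trans (cong (extT s p v) (sectI r q₁)) e) j

    ConnV = Glued* {V (IG r)} {KV} {Pos r} u₀V (fV rK)
    ConnE = Glued* {E (IG r)} {KE} {EdgeT r} (fE u₀) (fE rK)

    lpos-here-inv : (r₀ : Term) (w : Pos r₀) → lpos r₀ w ≡ here → w ≡ here
    lpos-here-inv (var x) here e = refl
    lpos-here-inv (fun f ls) here e = refl
    lpos-here-inv (fun f ls) (there i w) ()

    varpos-here-inv : ∀ {x} {r₀ : Term} (pf : x ∈V r₀) (q : Pos (σ x)) → varpos pf q ≡ here → (q ≡ here) × (varPos pf ≡ here)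
    varpos-here-inv here q e = e , refl
    varpos-here-inv (there i pf) q ()

    rootConn : ∀ z → embI r z ≡ here → ConnV (originV-inst z) (inj₁ kroot)
    rootConn (inj₁ (w , nv)) e rewrite lpos-here-inv r w e = EqClosure.symmetric _ (glued nothing)
    rootConn (inj₂ (x , pf , q₃)) e with varpos-here-inv pf q₃ e
    ... | refl , vp = EqClosure.transitive _ (glued (just (x , pf))) (subst (λ z → ConnV (inj₂ z) (inj₁ kroot)) (sym vp) (EqClosure.symmetric _ (glued nothing)))

    originV-gR₀ : ∀ a → ConnV (originV (gR₀V a)) (inj₁ a)
    originV-gR₀ (kout o) = subst (λ z → ConnV (originV-split z) (inj₁ (kout o))) (sym (chooseT-out v o)) ε
    originV-gR₀ kroot rewrite chooseT-ext s p v here = rootConn (chooseI r here) (sectI r here)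
    originV-gR₀ (kvar x pf q) rewrite chooseT-ext s p v (varpos pf q) | chooseI-varpos r pf q = ε

    originV-w₀ : ∀ b → ConnV (originV (fV w₀ b)) (inj₂ b)
    originV-w₀ b rewrite chooseT-ext s p v (lpos r b) with isVarPos r b in nvb
    ... | false rewrite chooseI-lpos r b nvb = ε
    ... | true with posOcc r b nvb
    ...   | x , pf , refl rewrite lpos-varPos pf | chooseI-varpos r pf here = glued (just (x , pf))

    ceT-out : (o : Out s p) (z : Out s p ⊎ Pos v) (e : [ outR v , extT s p v ] z ≡ outR v o) (j : Fin (arity (subAt t (outR v o))))
              (k : Fin (arity (subAt s (outS o)))) → toℕ k ≡ toℕ j → z ≡ inj₁ o → originE-split z (outR v o) e j ≡ inj₁ (keout o k)
    ceT-out o .(inj₁ o) e j k tk refl = cong (λ z → inj₁ (keout o z)) (toℕ-injective (trans (toℕ-castF _ j) (sym tk)))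

    ceT-in : (q₁ : Pos v) (z : Out s p ⊎ Pos v) (e : [ outR v , extT s p v ] z ≡ extT s p v q₁) (j : Fin (arity (subAt t (extT s p v q₁))))
             (k : KE ⊎ EdgeT r) → (∀ e' → originE-inst (chooseI r q₁) (extT s p v q₁) e' j ≡ k) → z ≡ inj₂ q₁ → originE-split z (extT s p v q₁) e j ≡ k
    ceT-in q₁ .(inj₂ q₁) e j k H refl = H _

    ceI-var : ∀ {x} (pf : x ∈V r) (q : Pos (σ x)) (z : NVPos r ⊎ VarOcc r) (e : extT s p v (embI r z) ≡ extT s p v (varpos pf q))
              (j : Fin (arity (subAt t (extT s p v (varpos pf q))))) (k : Fin (arity (subAt (σ x) q)))
            → toℕ k ≡ toℕ j → z ≡ inj₂ (x , pf , q) → originE-inst z (extT s p v (varpos pf q)) e j ≡ inj₁ (kevar x pf q k)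
    ceI-var pf q .(inj₂ (_ , pf , q)) e j k tk refl = cong (λ z → inj₁ (kevar _ pf q z)) (toℕ-injective (trans (toℕ-castF _ j) (sym tk)))

    ceI-lpos : (w : Pos r) (nv : isVarPos r w ≡ false) (z : NVPos r ⊎ VarOcc r) (e : extT s p v (embI r z) ≡ extT s p v (lpos r w))
               (j : Fin (arity (subAt t (extT s p v (lpos r w))))) (k : Fin (arity (subAt r w)))
             → toℕ k ≡ toℕ j → z ≡ inj₁ (w , nv) → originE-inst z (extT s p v (lpos r w)) e j ≡ inj₂ (w , k)
    ceI-lpos w nv .(inj₁ (w , nv)) e j k tk refl = cong (λ z → inj₂ (w , z)) (toℕ-injective (trans (toℕ-castF _ j) (sym tk)))

    originE-gR₀ : ∀ a → ConnE (originE (gR₀E a)) (inj₁ a)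
    originE-gR₀ (keout o j) = subst (λ z → ConnE z (inj₁ (keout o j)))
      (sym (ceT-out o (chooseT s p v (outR v o)) (sectT s p v (outR v o)) _ j (sym (toℕ-castF _ j)) (chooseT-out v o))) ε
    originE-gR₀ (kevar x pf q j) = subst (λ z → ConnE z (inj₁ (kevar x pf q j)))
      (sym (ceT-in (varpos pf q) (chooseT s p v (extT s p v (varpos pf q))) (sectT s p v _) _ _
                  (λ e' → ceI-var pf q (chooseI r (varpos pf q)) e' _ j (sym (toℕ-castF _ j)) (chooseI-varpos r pf q)) (chooseT-ext s p v (varpos pf q)))) ε

    originE-w₀ : ∀ b → ConnE (originE (fE w₀ b)) (inj₂ b)
    originE-w₀ (w , j) with isVarPos r w in nvw
    ... | true = ⊥-elim (fin-var (subAt r w) nvw j)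
    ... | false = subst (λ z → ConnE z (inj₂ (w , j)))
      (sym (ceT-in (lpos r w) (chooseT s p v (extT s p v (lpos r w))) (sectT s p v _) _ _
                  (λ e' → ceI-lpos w nvw (chooseI r (lpos r w)) e' _ j (sym (homE₂ w₀ (w , j))) (chooseI-lpos r w nvw)) (chooseT-ext s p v (lpos r w)))) ε

    originV-lab : ∀ q → headLab (subAt t q) ≤L [ lv GK₀ , lv (enc r) ] (originV q)
    originV-lab q = lT (chooseT s p v q) q (sectT s p v q)
      where
      lI : ∀ z q → extT s p v (embI r z) ≡ q → headLab (subAt t q) ≤L [ lv GK₀ , lv (enc r) ] (originV-inst z)
      lI (inj₁ (w , nv)) .(extT s p v (lpos r w)) refl rewrite subAt-extT s p v (lpos r w) | subAt-lpos r w = ≡⇒≤L (sym (sh-lab (sh-subst _ nv)))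
      lI (inj₂ (x , pf , q₃)) .(extT s p v (varpos pf q₃)) refl = ≡⇒≤L (cong headLab (subAt-inR pf q₃))
      lT : ∀ z q → [ outR v , extT s p v ] z ≡ q → headLab (subAt t q) ≤L [ lv GK₀ , lv (enc r) ] (originV-split z)
      lT (inj₁ o) .(outR v o) refl = ≡⇒≤L (sym (sh-lab (sameOut v o)))
      lT (inj₂ q₁) q e = lI (chooseI r q₁) q (trans (cong (extT s p v) (sectI r q₁)) e)

    originE-lab : ∀ (e : EdgeT t) → num (toℕ (proj₂ e)) ≤L [ le GK₀ , le (enc r) ] (originE e)
    originE-lab (q , j) = lT (chooseT s p v q) q (sectT s p v q) j
      where
      lI : ∀ z q e j → num (toℕ j) ≤L [ le GK₀ , le (enc r) ] (originE-inst z q e j)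
      lI (inj₁ (w , nv)) q e j = ≡⇒≤L (cong num (sym (toℕ-castF _ j)))
      lI (inj₂ (x , pf , q₃)) q e j = ≡⇒≤L (cong num (sym (toℕ-castF _ j)))
      lT : ∀ z q e j → num (toℕ j) ≤L [ le GK₀ , le (enc r) ] (originE-split z q e j)
      lT (inj₁ o) q e j = ≡⇒≤L (cong num (sym (toℕ-castF _ j)))
      lT (inj₂ q₁) q e j = lI (chooseI r q₁) q _ j

    t-pushout : IsPushout u₀ rK (enc t) gR₀ w₀
    t-pushout = ExplicitPushout.isPushout u₀ rK (enc t) gR₀ w₀ com originV originV-sect originE originE-sect originV-gR₀ originV-w₀ originE-gR₀ originE-w₀ originV-lab originE-lab
      where
      com : (gR₀ ∘H u₀) ≈ (w₀ ∘H rK)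
      com = cv , (λ ())
        where
        cv : ∀ k → gR₀V (u₀V k) ≡ fV w₀ (fV rK k)
        cv nothing = cong (extT s p v) (sym (lpos-here r))
        cv (just (x , pf)) = cong (extT s p v) (sym (lpos-varPos pf))

    canonical-step : Step (encRule ρ) (enc s) (enc t)
    canonical-step = m₀ , m₀-mono , α₀ , ((λ w → α₀-m₀V w) , (λ e → α₀-m₀E e)) , L-pullback ,
            GK₀ , gL₀ , u'₀ , GK₀-pullback , u₀ , u₀-tK , u₀-m , gR₀ , w₀ , t-pushout

module Matching (Sg : Signature) where
  open WithSig Sg renaming (sym to ssym; subst to tsubst)
  open GraphMorphisms Sg
  open TermPositions Sg
  open Replacement Sg
  open PositionMorphisms Sg
  open CanonicalStep Sg

  edgeEq' : (b : Term) (e₁ e₂ : EdgeT b) → proj₁ e₁ ≡ proj₁ e₂ → toℕ (proj₂ e₁) ≡ toℕ (proj₂ e₂) → e₁ ≡ e₂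
  edgeEq' b (q , j) (q' , j') e t = edgeEq b e t

  module Rigidity {a b : Term} (h₁ h₂ : Hom (enc a) (enc b)) (h0 : fV h₁ here ≡ fV h₂ here) where
    hom-rigidE : ∀ w (j : Fin (arity (subAt a w))) → fV h₁ w ≡ fV h₂ w → fE h₁ (w , j) ≡ fE h₂ (w , j)
    hom-rigidE w j ih = edgeEq' b _ _ (trans (sym (src-c h₁ (w , j))) (trans ih (src-c h₂ (w , j))))
                                   (trans (sym (≤num (le-c h₁ (w , j)))) (≤num (le-c h₂ (w , j))))

    hom-rigidV : ∀ w → fV h₁ w ≡ fV h₂ w
    hom-rigidV = snocInd a (λ w → fV h₁ w ≡ fV h₂ w) h0
               (λ w j ih → trans (tgt-c h₁ (w , j)) (trans (cong (tgt (enc b)) (hom-rigidE w j ih)) (sym (tgt-c h₂ (w , j)))))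

    hom-rigid : h₁ ≈ h₂
    hom-rigid = hom-rigidV , (λ e → hom-rigidE (proj₁ e) (proj₂ e) (hom-rigidV (proj₁ e)))

  mutual
    findOcc : (x : ℕ) (a : Term) → Maybe (x ∈V a)
    findOcc x (var y) with x ≟ℕ y
    ... | yes refl = just here
    ... | no _ = nothing
    findOcc x (fun f ts) = mthere (findOccV x ts)

    findOccV : ∀ {n} (x : ℕ) (ts : Vec Term n) → Maybe (Σ (Fin n) λ i → x ∈V lookup ts i)
    findOccV x [] = nothing
    findOccV x (t ∷ ts) = mcons (findOcc x t) (findOccV x ts)

    mthere : ∀ {x f} {ts : Vec Term (ar f)} → Maybe (Σ (Fin (ar f)) λ i → x ∈V lookup ts i) → Maybe (x ∈V fun f ts)
    mthere nothing = nothing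
    mthere (just (i , pf)) = just (there i pf)

    mcons : ∀ {n x t} {ts : Vec Term n} → Maybe (x ∈V t) → Maybe (Σ (Fin n) λ i → x ∈V lookup ts i)
          → Maybe (Σ (Fin (suc n)) λ i → x ∈V lookup (t ∷ ts) i)
    mcons (just pf) _ = just (fz , pf)
    mcons nothing nothing = nothing
    mcons nothing (just (i , pf)) = just (fs i , pf)

  IsJust : ∀ {A : Set} → Maybe A → Set
  IsJust {A} m = Σ A λ a → m ≡ just a

  mutual
    findOcc-complete : ∀ {x} {a : Term} (pf : x ∈V a) → IsJust (findOcc x a)
    findOcc-complete {x} here with x ≟ℕ x
    ... | yes refl = here , refl
    ... | no ne = ⊥-elim (ne refl)
    findOcc-complete {x} (there {f} {ts} i pf) with findOccV x ts | findOccV-complete ts i pf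
    ... | just (j , pf') | _ = there j pf' , refl
    ... | nothing | _ , ()

    findOccV-complete : ∀ {n x} (ts : Vec Term n) (i : Fin n) (pf : x ∈V lookup ts i) → IsJust (findOccV x ts)
    findOccV-complete {x = x} (t ∷ ts) fz pf with findOcc x t | findOcc-complete pf
    ... | just pf' | _ = (fz , pf') , refl
    ... | nothing | _ , ()
    findOccV-complete {x = x} (t ∷ ts) (fs i) pf with findOcc x t
    ... | just pf' = (fz , pf') , refl
    ... | nothing with findOccV x ts | findOccV-complete ts i pf
    ...   | just (j , pf') | _ = (fs j , pf') , refl
    ...   | nothing | _ , ()

  childT : (u : Term) → Fin (arity u) → Term
  childT (var x) ()
  childT (fun f ts) j = lookup ts j

  subAt-child : (b : Term) (q : Pos b) (j : Fin (arity (subAt b q))) → subAt b (child b q j) ≡ childT (subAt b q) j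
  subAt-child (var x) here ()
  subAt-child (fun f ts) here j = refl
  subAt-child (fun f ts) (there i q) j = subAt-child (lookup ts i) q j

  childT-eq : ∀ {f} {bs : Vec Term (ar f)} (u : Term) → u ≡ fun f bs → (j : Fin (arity u)) (i : Fin (ar f)) → toℕ j ≡ toℕ i → childT u j ≡ lookup bs i
  childT-eq {bs = bs} .(fun _ bs) refl j i e = cong (lookup bs) (toℕ-injective e)

  headLab-sym : ∀ {f} (u : Term) → headLab u ≡ ssym f → Σ (Vec Term (ar f)) λ bs → u ≡ fun f bs
  headLab-sym (var x) ()
  headLab-sym (fun g us) refl = us , refl

  module MatchInstance (b : Term) (σ : ℕ → Term) where
    open Instantiation σ
    mutual
      subst-≡-image : (a : Term) (h : Hom (enc a) (enc b)) → (∀ x (pf : x ∈V a) → σ x ≡ subAt b (fV h (varPos pf))) → tsubst σ a ≡ subAt b (fV h here)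
      subst-≡-image (var x) h H = H x here
      subst-≡-image (fun f as) h H with headLab-sym (subAt b (fV h here)) (≤sym (lv-c h here))
      ... | bs , eqh = trans (cong (fun f) (substs-≡-images as bs (λ i → h ∘H subtermH (fun f as) (there i here)) (λ i x pf → H x (there i pf)) childEq)) (sym eqh)
        where
        childEq : ∀ i → lookup bs i ≡ subAt b (fV h (there i here))
        childEq i = sym (trans (cong (subAt b) (tgt-c h (here , i)))
                        (trans (subAt-child b (proj₁ (fE h (here , i))) (proj₂ (fE h (here , i))))
                               (childT-eq (subAt b (proj₁ (fE h (here , i)))) (trans (cong (subAt b) (sym (src-c h (here , i)))) eqh)
                                          (proj₂ (fE h (here , i))) i (sym (≤num (le-c h (here , i)))))))

      substs-≡-images : ∀ {n} (as bs : Vec Term n) (hs : ∀ i → Hom (enc (lookup as i)) (enc b))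
            → (∀ i x (pf : x ∈V lookup as i) → σ x ≡ subAt b (fV (hs i) (varPos pf)))
            → (∀ i → lookup bs i ≡ subAt b (fV (hs i) here)) → substs σ as ≡ bs
      substs-≡-images [] [] hs Hs E = refl
      substs-≡-images (a ∷ as) (c ∷ bs) hs Hs E =
        cong₂ _∷_ (trans (subst-≡-image a (hs fz) (Hs fz)) (sym (E fz))) (substs-≡-images as bs (λ i → hs (fs i)) (λ i → Hs (fs i)) (λ i → E (fs i)))

  module MatchSubstitution (a b : Term) (lin : Linear a) (h : Hom (enc a) (enc b)) where
    σ-of : ℕ → Term
    σ-of x with findOcc x a
    ... | just pf = subAt b (fV h (varPos pf))
    ... | nothing = var x

    σ-of-var : ∀ x (pf : x ∈V a) → σ-of x ≡ subAt b (fV h (varPos pf))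
    σ-of-var x pf with findOcc x a | findOcc-complete pf
    ... | just pf' | _ = cong (λ z → subAt b (fV h (varPos z))) (lin x pf' pf)
    ... | nothing | _ , ()

    subst-σ-of : tsubst σ-of a ≡ subAt b (fV h here)
    subst-σ-of = MatchInstance.subst-≡-image b σ-of a h σ-of-var

  redexOfMatch : (ρ : Rule) → LinearRule ρ → (s : Term) → Hom (enc (lhs ρ)) (enc s) → Redex
  redexOfMatch ρ (linL , linR) s m = record
    { ρ = ρ ; lhs-linear = linL ; rhs-linear = linR ; σ = σ-of ; s = s ; p = fV m here ; s∣p≡lσ = sym subst-σ-of }
    where open MatchSubstitution (lhs ρ) s linL m

module CanonicalStepProperties (Sg : Signature) where
  open WithSig Sg renaming (sym to ssym; subst to tsubst)
  open GraphMorphisms Sg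
  open TermPositions Sg
  open Replacement Sg
  open PositionMorphisms Sg
  open CanonicalStep Sg
  open Matching Sg

  occurrence-at : (u : Term) (q : Pos u) {x : ℕ} → subAt u q ≡ var x → Σ (x ∈V u) λ pf → varPos pf ≡ q
  occurrence-at (var y) here refl = here , refl
  occurrence-at (fun f ts) here ()
  occurrence-at (fun f ts) (there i q) e with occurrence-at (lookup ts i) q e
  ... | pf , e' = there i pf , cong (there i) e'

  LinearByPositions : Term → Set
  LinearByPositions u = ∀ x (q q' : Pos u) → subAt u q ≡ var x → subAt u q' ≡ var x → q ≡ q'

  linear⇒positions : ∀ u → Linear u → LinearByPositions u
  linear⇒positions u lin x q q' h h' with occurrence-at u q h | occurrence-at u q' h'
  ... | pf , e₁ | pf' , e₂ = trans (sym e₁) (trans (cong varPos (lin x pf pf')) e₂)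

  positions⇒linear : ∀ u → LinearByPositions u → Linear u
  positions⇒linear u P x pf pf' = Σinj (varPos-inj pf pf' (P x (varPos pf) (varPos pf') (subAt-varPos pf) (subAt-varPos pf')))

  outside-var : ∀ {s₀ : Term} {p₀ : Pos s₀} (v₀ : Term) {x : ℕ} (o : Out s₀ p₀) → subAt (replace s₀ p₀ v₀) (outR v₀ o) ≡ var x → subAt s₀ (outS o) ≡ var x
  outside-var {fun f ts} {there i p₀} v₀ oroot ()
  outside-var {fun f ts} {there i p₀} v₀ (oside j ne q) e = trans (sym (subAt-updNe ts i j {replace (lookup ts i) p₀ v₀} ne q)) e
  outside-var {fun f ts} {there i p₀} v₀ (odown o) e = outside-var v₀ o (trans (sym (subAt-updAt ts i (outR v₀ o))) e)

  module RewriteProperties (X : Redex) where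
    open CanonicalRewrite X public

    CVL = CV (enc l) (isVarPos l)
    CEL = CE (enc l) (isVarPos l)

    isOld : CVL → Bool
    isOld (old _) = true
    isOld (prime _) = false
    isOld cnode = false

    prime-src⇒prime-tgt : ∀ (e : CEL) y → src L' e ≡ prime y → tgt L' e ≡ prime y
    prime-src⇒prime-tgt (oldE _) y ()
    prime-src⇒prime-tgt (toPrm _) y ()
    prime-src⇒prime-tgt (loopP y') y refl = refl
    prime-src⇒prime-tgt toRoot y ()
    prime-src⇒prime-tgt loopC y ()

    root-prime⇒all-prime : (δ : Hom (enc s) L') (y : VarV (enc l) (isVarPos l)) → fV δ here ≡ prime y → ∀ q → fV δ q ≡ prime y
    root-prime⇒all-prime δ y h0 = snocInd s (λ q → fV δ q ≡ prime y) h0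
      (λ w j ih → trans (tgt-c δ (w , j)) (prime-src⇒prime-tgt (fE δ (w , j)) y (trans (sym (src-c δ (w , j))) ih)))

    non-old-tgt-unique : ∀ (e e' : CEL) → src L' e ≡ src L' e' → isOld (tgt L' e) ≡ false → isOld (tgt L' e') ≡ false → tgt L' e ≡ tgt L' e'
    non-old-tgt-unique (oldE _) e' h () h'
    non-old-tgt-unique toRoot e' h () h'
    non-old-tgt-unique e (oldE _) h h' ()
    non-old-tgt-unique e toRoot h h' ()
    non-old-tgt-unique (toPrm (w , c)) (toPrm (.w , c')) refl _ _ rewrite uip c c' = refl
    non-old-tgt-unique (toPrm _) (loopP _) () _ _
    non-old-tgt-unique (toPrm _) loopC () _ _
    non-old-tgt-unique (loopP _) (toPrm _) () _ _
    non-old-tgt-unique (loopP y) (loopP .y) refl _ _ = refl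
    non-old-tgt-unique (loopP _) loopC () _ _
    non-old-tgt-unique loopC (toPrm _) () _ _
    non-old-tgt-unique loopC (loopP _) () _ _
    non-old-tgt-unique loopC loopC _ _ _ = refl

    isOldE : CEL → Bool
    isOldE (oldE _) = true
    isOldE _ = false

    non-old-edge-unique : ∀ (e e' : CEL) → isOldE e ≡ false → isOldE e' ≡ false → src L' e ≡ src L' e' → tgt L' e ≡ tgt L' e' → e ≡ e'
    non-old-edge-unique (oldE _) e' () _ _ _
    non-old-edge-unique e (oldE _) _ () _ _
    non-old-edge-unique (toPrm a) (toPrm .a) _ _ _ refl = refl
    non-old-edge-unique (toPrm _) (loopP _) _ _ () _
    non-old-edge-unique (toPrm _) toRoot _ _ () _
    non-old-edge-unique (toPrm _) loopC _ _ () _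
    non-old-edge-unique (loopP _) (toPrm _) _ _ () _
    non-old-edge-unique (loopP a) (loopP .a) _ _ refl _ = refl
    non-old-edge-unique (loopP _) toRoot _ _ () _
    non-old-edge-unique (loopP _) loopC _ _ () _
    non-old-edge-unique toRoot (toPrm _) _ _ () _
    non-old-edge-unique toRoot (loopP _) _ _ () _
    non-old-edge-unique toRoot toRoot _ _ _ _ = refl
    non-old-edge-unique toRoot loopC _ _ _ ()
    non-old-edge-unique loopC (toPrm _) _ _ () _
    non-old-edge-unique loopC (loopP _) _ _ () _
    non-old-edge-unique loopC toRoot _ _ _ ()
    non-old-edge-unique loopC loopC _ _ _ _ = refl

    -- Agreement of two classifiers spreads from the root along the edges of s: images in l° are
    -- fixed by the match, and every vertex of L' has at most one edge to a vertex outside l°.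
    module ClassifierUnique (β γ : Hom (enc s) L') (cβ : Classifies β) (cγ : Classifies γ) where
      private
        Aβ = proj₁ cβ
        AβE = proj₁ (proj₂ cβ)
        Bβ = proj₂ (proj₂ cβ)
        Aγ = proj₁ cγ
        AγE = proj₁ (proj₂ cγ)
        Bγ = proj₂ (proj₂ cγ)

      old-transfer : ∀ (δ₁ δ₂ : Hom (enc s) L') → (∀ q w → fV δ₁ q ≡ old w → fV m₀ w ≡ q) → (∀ w → fV δ₂ (fV m₀ w) ≡ old w)
                  → ∀ q w → fV δ₁ q ≡ old w → fV δ₂ q ≡ old w
      old-transfer δ₁ δ₂ B A q w h = trans (cong (fV δ₂) (sym (B q w h))) (A w)

      root-agrees : fV β here ≡ fV γ here
      root-agrees with fV β here in eb | fV γ here in eg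
      ... | old w | _ = trans (sym (old-transfer β γ Bβ Aγ here w eb)) eg
      ... | cnode | old w = trans (sym eb) (old-transfer γ β Bγ Aβ here w eg)
      ... | prime y | _ = ⊥-elim (clash (trans (sym (Aβ here)) (root-prime⇒all-prime β y eb (fV m₀ here))))
        where
        clash : _≡_ {A = CVL} (old here) (prime y) → ⊥
        clash ()
      ... | cnode | prime y = ⊥-elim (clash (trans (sym (Aγ here)) (root-prime⇒all-prime γ y eg (fV m₀ here))))
        where
        clash : _≡_ {A = CVL} (old here) (prime y) → ⊥
        clash ()
      ... | cnode | cnode = refl

      non-old-child-agrees : ∀ q j → fV β q ≡ fV γ q → isOld (fV β (child s q j)) ≡ false → isOld (fV γ (child s q j)) ≡ false
               → fV β (child s q j) ≡ fV γ (child s q j)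
      non-old-child-agrees q j ih nb ng =
        trans (tgt-c β (q , j)) (trans (non-old-tgt-unique (fE β (q , j)) (fE γ (q , j)) srcs
                                          (trans (cong isOld (sym (tgt-c β (q , j)))) nb) (trans (cong isOld (sym (tgt-c γ (q , j)))) ng))
                                (sym (tgt-c γ (q , j))))
        where
        srcs = trans (sym (src-c β (q , j))) (trans ih (src-c γ (q , j)))

      child-agrees : ∀ q j → fV β q ≡ fV γ q → fV β (child s q j) ≡ fV γ (child s q j)
      child-agrees q j ih with fV β (child s q j) in e₁ | fV γ (child s q j) in e₂
      ... | old w | _ = trans (sym (old-transfer β γ Bβ Aγ _ w e₁)) e₂
      ... | prime y | old w = trans (sym e₁) (old-transfer γ β Bγ Aβ _ w e₂)
      ... | cnode | old w = trans (sym e₁) (old-transfer γ β Bγ Aβ _ w e₂)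
      ... | prime y | prime y' = trans (sym e₁) (trans (non-old-child-agrees q j ih (cong isOld e₁) (cong isOld e₂)) e₂)
      ... | prime y | cnode = trans (sym e₁) (trans (non-old-child-agrees q j ih (cong isOld e₁) (cong isOld e₂)) e₂)
      ... | cnode | prime y = trans (sym e₁) (trans (non-old-child-agrees q j ih (cong isOld e₁) (cong isOld e₂)) e₂)
      ... | cnode | cnode = refl

      agreeV : ∀ q → fV β q ≡ fV γ q
      agreeV = snocInd s (λ q → fV β q ≡ fV γ q) root-agrees (λ q j ih → child-agrees q j ih)

      oldE-or-not : ∀ (c : CEL) → (Σ (EdgeT l) λ a → c ≡ oldE a) ⊎ (isOldE c ≡ false)
      oldE-or-not (oldE a) = inj₁ (a , refl)
      oldE-or-not (toPrm _) = inj₂ refl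
      oldE-or-not (loopP _) = inj₂ refl
      oldE-or-not toRoot = inj₂ refl
      oldE-or-not loopC = inj₂ refl

      agreeE : ∀ e → fE β e ≡ fE γ e
      agreeE e with oldE-or-not (fE β e) | oldE-or-not (fE γ e)
      ... | inj₁ (a , e₁) | _ = trans (cong (fE β) (sym (oldE⇒m₀ β Bβ e a e₁))) (trans (AβE a) (sym (trans (cong (fE γ) (sym (oldE⇒m₀ β Bβ e a e₁))) (AγE a))))
      ... | inj₂ _ | inj₁ (a , e₂) = trans (trans (cong (fE β) (sym (oldE⇒m₀ γ Bγ e a e₂))) (AβE a)) (sym (trans (cong (fE γ) (sym (oldE⇒m₀ γ Bγ e a e₂))) (AγE a)))
      ... | inj₂ n₁ | inj₂ n₂ = non-old-edge-unique _ _ n₁ n₂ (trans (sym (src-c β e)) (trans (agreeV _) (src-c γ e)))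
                                                  (trans (sym (tgt-c β e)) (trans (agreeV _) (tgt-c γ e)))

      classifier-unique : β ≈ γ
      classifier-unique = agreeV , agreeE

    subst-nonvar : ∀ (u : Term) → isVarT u ≡ false → ∀ x → tsubst σ u ≡ var x → ⊥
    subst-nonvar (fun f ts) _ x ()

    VarOrigin : Pos t → Set
    VarOrigin q = (Σ (Out s p) λ o → outR v o ≡ q) ⊎ (Σ ℕ λ y → Σ (y ∈V r) λ pf → Σ (Pos (σ y)) λ q₃ → extT s p v (varpos pf q₃) ≡ q)

    varOrigin-inst : ∀ {x} (z : NVPos r ⊎ VarOcc r) (q : Pos t) → extT s p v (embI r z) ≡ q → subAt t q ≡ var x → VarOrigin q
    varOrigin-inst {x} (inj₁ (w , nv)) q e h = ⊥-elim (subst-nonvar _ nv x (trans (sym (trans (subAt-extT s p v (lpos r w)) (subAt-lpos r w))) (trans (cong (subAt t) e) h)))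
    varOrigin-inst (inj₂ (y , pf , q₃)) q e h = inj₂ (y , pf , q₃ , e)

    varOrigin : ∀ {x} (z : Out s p ⊎ Pos v) (q : Pos t) → [ outR v , extT s p v ] z ≡ q → subAt t q ≡ var x → VarOrigin q
    varOrigin (inj₁ o) q e h = inj₁ (o , e)
    varOrigin (inj₂ q₁) q e h = varOrigin-inst (chooseI r q₁) q (trans (cong (extT s p v) (sectI r q₁)) e) h

    originPos : ∀ {q} → VarOrigin q → Pos s
    originPos (inj₁ (o , _)) = outS o
    originPos (inj₂ (y , pf , q₃ , _)) = substPos (rhs⊆lhs pf) q₃

    originPos-var : ∀ {x q} (z : VarOrigin q) → subAt t q ≡ var x → subAt s (originPos z) ≡ var x
    originPos-var (inj₁ (o , e)) h = outside-var v o (trans (cong (subAt t) e) h)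
    originPos-var (inj₂ (y , pf , q₃ , e)) h = trans (subAt-substPos (rhs⊆lhs pf) q₃) (trans (sym (subAt-inR pf q₃)) (trans (cong (subAt t) e) h))

    old-or-prime-inj : ∀ (b b' : Bool) {A A' : Pos l} {c c'} → _≡_ {A = CVL} (if b then old A else prime (A , c)) (if b' then old A' else prime (A' , c')) → A ≡ A'
    old-or-prime-inj true true refl = refl
    old-or-prime-inj false false refl = refl
    old-or-prime-inj true false ()
    old-or-prime-inj false true ()

    originPos-inj : ∀ {q q'} (z : VarOrigin q) (z' : VarOrigin q') → originPos z ≡ originPos z' → q ≡ q'
    originPos-inj (inj₁ (o , e)) (inj₁ (o' , e')) k = trans (sym e) (trans (cong (outR v) (outS-inj o o' k)) e')
    originPos-inj (inj₁ (o , e)) (inj₂ (y , pf , q₃ , e')) k = ⊥-elim (ifNotC (isHere q₃) (sym (trans (sym (α₀V-out o)) (trans (cong α₀V k) (α₀V-var (rhs⊆lhs pf) q₃)))))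
    originPos-inj (inj₂ (y , pf , q₃ , e)) (inj₁ (o , e')) k = ⊥-elim (ifNotC (isHere q₃) (sym (trans (sym (α₀V-out o)) (trans (cong α₀V (sym k)) (α₀V-var (rhs⊆lhs pf) q₃)))))
    originPos-inj (inj₂ (y , pf , q₃ , e)) (inj₂ (y' , pf' , q₃' , e')) k
      with vpEq pf pf' (old-or-prime-inj (isHere q₃) (isHere q₃') (trans (sym (α₀V-var (rhs⊆lhs pf) q₃)) (trans (cong α₀V k) (α₀V-var (rhs⊆lhs pf') q₃'))))
    ... | refl rewrite rhs-occ-unique pf pf' = trans (sym e) (trans (cong (λ z → extT s p v (varpos pf' z)) (substPos-inj (rhs⊆lhs pf') k)) e')

    -- Each variable position of t comes from a variable position of s, outside the redex or inside
    -- an instance σ x with x in r; as r is linear, distinct positions of t have distinct origins.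
    rewrite-linear : Linear s → Linear t
    rewrite-linear ls = positions⇒linear t (λ x q q' h h' →
      let z = varOrigin (chooseT s p v q) q (sectT s p v q) h
          z' = varOrigin (chooseT s p v q') q' (sectT s p v q') h'
      in originPos-inj z z' (linear⇒positions s ls x (originPos z) (originPos z') (originPos-var z h) (originPos-var z' h')))

module Embedding (Sg : Signature) where
  open WithSig Sg renaming (sym to ssym; subst to tsubst)
  open GraphMorphisms Sg
  open TermPositions Sg
  open Replacement Sg
  open PositionMorphisms Sg
  open CanonicalStep Sg
  open Matching Sg
  open CanonicalStepProperties Sg

  step-preserving : (R : TRS) → LinearTRS R → (s t : Term) → Linear s → Linear t → s ⟶[ R ] t → enc s ⇒[ R ] enc t
  step-preserving R lin _ _ _ _ (i , C , σ , refl , refl) =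
    i , subst (λ t → Step (encRule ρ) (enc (plug C lσ)) (enc t)) (replace-hole C lσ (tsubst σ (rhs ρ)))
              (CanonicalRewrite.canonical-step redex)
    where
    ρ = rule R i
    lσ = tsubst σ (lhs ρ)
    redex : Redex
    redex = record { ρ = ρ ; lhs-linear = proj₁ (lin i) ; rhs-linear = proj₂ (lin i) ; σ = σ
                   ; s = plug C lσ ; p = holePos C lσ ; s∣p≡lσ = subAt-hole C lσ }

  closed : (R : TRS) → LinearTRS R → (s : Term) (G : Graph) → Linear s → enc s ⇒[ R ] G
       → Σ Term λ t → Linear t × (s ⟶[ R ] t) × (G ≅ enc t)
  closed R lin s G lin-s (i , m , _ , α , α∘m≈tL , left-pb , GK , gL , u' , middle-pb , u , u'∘u≈tK , gL∘u≈m∘l , gR , w , right-po) =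
    C.t , C.rewrite-linear lin-s , (i , ctxOf s C.p , C.σ , C.s≡C[lσ] , C.t≡C[rσ]) , G≅t
    where
    module C = RewriteProperties (redexOfMatch (rule R i) (lin i) s m)
    m≈m₀ : m ≈ C.m₀
    m≈m₀ = Rigidity.hom-rigid m C.m₀ (sym C.m₀-here)
    α-classifies : C.Classifies α
    α-classifies = (λ w → trans (cong (fV α) (sym (proj₁ m≈m₀ w))) (proj₁ α∘m≈tL w))
                 , (λ e → trans (cong (fE α) (sym (proj₂ m≈m₀ e))) (proj₂ α∘m≈tL e))
                 , (λ q w h → trans (sym (proj₁ m≈m₀ w)) (pullback-lifts-vertices C.tL α m left-pb q w h))
    α₀≈α : C.α₀ ≈ α
    α₀≈α = C.ClassifierUnique.classifier-unique C.α₀ α C.α₀-classifies α-classifies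
    GK₀-pullback-α : IsPullback α C.l' C.GK₀ C.gL₀ C.u'₀
    GK₀-pullback-α = pullback-resp-≈ {f = C.α₀} {f' = α} {g = C.l'} {p₁ = C.gL₀} {p₂ = C.u'₀} α₀≈α C.GK₀-pullback
    gL₀∘u₀≈m∘l : (C.gL₀ ∘H C.u₀) ≈ (m ∘H C.lK)
    gL₀∘u₀≈m∘l = ≈-trans {f = C.gL₀ ∘H C.u₀} {g = C.m₀ ∘H C.lK} {h = m ∘H C.lK}
                   C.u₀-m (∘-congʳ C.m₀ m C.lK (≈-sym {f = m} {g = C.m₀} m≈m₀))
    G≅t : G ≅ enc C.t
    G≅t = pushout-over-pullback-unique α C.l' C.tK (m ∘H C.lK) C.rK C.gL₀ C.u'₀ C.u₀ C.gR₀ C.w₀ gL u' u gR w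
            GK₀-pullback-α C.u₀-tK gL₀∘u₀≈m∘l C.t-pushout middle-pb u'∘u≈tK gL∘u≈m∘l right-po

theorem35 : (Sg : Signature) → let open WithSig Sg in
    (R : TRS) → LinearTRS R →
    ((s t : Term) → Linear s → Linear t → s ⟶[ R ] t → enc s ⇒[ R ] enc t)
    × ((s : Term) (G : Graph) → Linear s → enc s ⇒[ R ] G →
    Σ Term λ t → Linear t × (s ⟶[ R ] t) × (G ≅ enc t))
theorem35 Sg R lin = step-preserving R lin , closed R lin
  where open Embedding Sg
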